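{- Fix a positive integer $k$, and let $(s_n)_{n\ge m_0}$ be a sequence of non-negative integers as described in the context (satisfying $2s_n\le n-k-1$, $s_n/n\to 0$, and $2^{s_n}\ge n^2$). Then $\lim_{n\to\infty}\sigma(\mathcal{T}_{n,k})=\lim_{n\to\infty}\sigma(\mathcal{T}_{n-k+1,1})$.
   Context: All graphs are finite and simple. A subtree of a graph $G$ is a (nonempty) subgraph that is a tree. For a nonempty family $\mathcal{T}$ of subtrees of a graph $G$ on $n$ vertices, $\mu(\mathcal{T})=\frac{1}{|\mathcal{T}|}\sum_{T\in\mathcal{T}}|V(T)|$ and $\sigma(\mathcal{T})=\mu(\mathcal{T})/n$. Construction: fix a positive integer $k$ and a sequence $(s_n)_{n\ge m_0}$ of non-negative integers with (1) $2s_n\le n-k-1$ for all $n\ge m_0$, (2) $\lim_{n\to\infty}s_n/n=0$, (3) $2^{s_n}\ge n^2$ for all $n\ge m_0$. Let $P=v_1v_2\cdots v_{n-2s_n}$ be a path, and write $w=v_{n-2s_n}$ and $P^*=v_kv_{k+1}\cdots w$. Let $G_n$ be obtained from $P$ by attaching $s_n$ new pendant vertices (leaves) to $v_1$ and $s_n$ new pendant vertices to $w$; so $|V(G_n)|=n$. Let $G_{n,k}=G_n+\{v_1w,v_2w,\dots,v_kw\}$ (adding these $k$ edges). Let $\mathcal{T}_{n,k}$ be the family of subtrees of $G_{n,k}$ that contain all of the vertices $v_1,v_k,w$ but do not contain the path $P^*$; its density is $\sigma(\mathcal{T}_{n,k})=\mu(\mathcal{T}_{n,k})/n$. In particular, for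 $k=1$, $\mathcal{T}_{n,1}$ is the family of subtrees of $G_{n,1}=G_n+v_1w$ containing the edge $v_1w$, and $\sigma(\mathcal{T}_{n-k+1,1})$ is its density for the graph on $n-k+1$ vertices. -}

module Defs where

open import Data.Bool using (Bool; true; false; _∧_; _∨_; not; if_then_else_)
open import Data.Nat using (ℕ; zero; suc; _+_; _*_; _∸_; _≡ᵇ_; _<ᵇ_; _≤_; _^_)
open import Data.Nat.Properties using ()
open import Data.List using (List; []; _∷_; _++_; map; length; upTo; concatMap; filter; foldr)
open import Data.Bool.ListAction using (any; all)
open import Data.Nat.ListAction using (sum)
open import Data.Product using (_×_; _,_; proj₁; proj₂; Σ; ∃)
open import Data.Integer using (+_)
open import Data.Rational using (ℚ; 0ℚ; _/_; _-_; _<_; ∣_∣)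
open import Relation.Nullary.Decidable using (does)
open import Data.Bool.Properties using (T?)

-- Finite simple graphs on vertex set {0,…,n-1} given by an edge list
-- (each unordered edge listed once, endpoints distinct).

Edge : Set
Edge = ℕ × ℕ

-- A subgraph is given by a vertex set S (characteristic list of length n)
-- and a subset F of the edge list (characteristic list of length |E|).

subsets : ℕ → List (List Bool)
subsets zero    = [] ∷ []
subsets (suc m) = concatMap (λ xs → (false ∷ xs) ∷ (true ∷ xs) ∷ []) (subsets m)

memb : List Bool → ℕ → Bool
memb []      _       = false
memb (b ∷ _) zero    = b
memb (_ ∷ bs) (suc i) = memb bs i

selected : List Edge → List Bool → List Edge
selected []       _             = []
selected (_ ∷ es) []            = []
selected (e ∷ es) (true ∷ bs)   = e ∷ selected es bs
selected (e ∷ es) (false ∷ bs)  = selected es bs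

countTrue : List Bool → ℕ
countTrue []           = 0
countTrue (true ∷ bs)  = suc (countTrue bs)
countTrue (false ∷ bs) = countTrue bs

firstIn : List Bool → ℕ
firstIn []           = 0
firstIn (true ∷ _)   = 0
firstIn (false ∷ bs) = suc (firstIn bs)

reachStep : List Edge → (ℕ → Bool) → (ℕ → Bool)
reachStep F R x = R x ∨ any (λ e → ((proj₁ e ≡ᵇ x) ∧ R (proj₂ e)) ∨ ((proj₂ e ≡ᵇ x) ∧ R (proj₁ e))) F

iter : ℕ → List Edge → (ℕ → Bool) → (ℕ → Bool)
iter zero    F R = R
iter (suc t) F R = iter t F (reachStep F R)

-- vertices reachable from r using edges F (n iterations suffice on n vertices)
reach : ℕ → List Edge → ℕ → (ℕ → Bool)
reach n F r = iter n F (λ x → x ≡ᵇ r)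

-- (S , F) is a subtree of the graph (n , E):
--   nonempty, every selected edge has both ends in S, (S,F) connected,
--   and |F| = |S| - 1  (a connected graph with |E| = |V| - 1 is a tree).
isSubtree : ℕ → List Edge → List Bool → List Bool → Bool
isSubtree n E S Fb =
  let F = selected E Fb in
  (0 <ᵇ countTrue S)
  ∧ all (λ e → memb S (proj₁ e) ∧ memb S (proj₂ e)) F
  ∧ (suc (length F) ≡ᵇ countTrue S)
  ∧ all (λ x → not (memb S x) ∨ reach n F (firstIn S) x) (upTo n)

subtrees : ℕ → List Edge → List (List Bool × List Bool)
subtrees n E =
  filter (λ p → T? (isSubtree n E (proj₁ p) (proj₂ p)))
    (concatMap (λ S → map (λ Fb → (S , Fb)) (subsets (length E))) (subsets n))

-- The graph G_{n,k} built with s pendant vertices at each end.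
-- Labels: v_i ↦ i-1 (i = 1..L, L = n - 2s), w = v_L ↦ L-1,
-- leaves at v_1 ↦ L, …, L+s-1 ; leaves at w ↦ L+s, …, L+2s-1.

pathLen : ℕ → ℕ → ℕ
pathLen n s = n ∸ (2 * s)

wV : ℕ → ℕ → ℕ
wV n s = pathLen n s ∸ 1

Gedges : ℕ → ℕ → ℕ → List Edge
Gedges n s k =
  let L = pathLen n s in
     map (λ i → (i , suc i)) (upTo (L ∸ 1))
  ++ map (λ j → (0 , L + j)) (upTo s)
  ++ map (λ j → (L ∸ 1 , L + s + j)) (upTo s)
  -- the added edges v_i w (i = 1..k), omitting those already present
  -- (v_{L-1} w is a path edge), so the graph stays simple
  ++ map (λ i → (i , L ∸ 1)) (filter (λ i → T? (suc i <ᵇ L ∸ 1)) (upTo k))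

-- does the subgraph (S , F) contain all of the path P* = v_k v_{k+1} ⋯ w ?
containsPstar : ℕ → ℕ → ℕ → List Bool → List Bool → Bool
containsPstar n s k S Fb =
  let F = selected (Gedges n s k) Fb
      L = pathLen n s in
  all (λ i → memb S i) (map (λ j → k ∸ 1 + j) (upTo (L ∸ (k ∸ 1))))
  ∧ all (λ i → any (λ e → (proj₁ e ≡ᵇ i) ∧ (proj₂ e ≡ᵇ suc i)) F)
        (map (λ j → k ∸ 1 + j) (upTo (L ∸ 1 ∸ (k ∸ 1))))

inFamily : ℕ → ℕ → ℕ → List Bool → List Bool → Bool
inFamily n s k S Fb =
  memb S 0 ∧ memb S (k ∸ 1) ∧ memb S (wV n s) ∧ not (containsPstar n s k S Fb)

family : ℕ → ℕ → ℕ → List (List Bool × List Bool)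
family n s k =
  filter (λ p → T? (inFamily n s k (proj₁ p) (proj₂ p))) (subtrees n (Gedges n s k))

-- a / b as a rational, with the convention a / 0 = 0
ratio : ℕ → ℕ → ℚ
ratio a zero    = 0ℚ
ratio a (suc b) = (+ a) / suc b

-- σ(𝒯) = μ(𝒯)/n = (Σ_T |V(T)|) / (|𝒯| · n)
sigma : ℕ → ℕ → ℕ → ℚ
sigma n s k =
  let 𝒯 = family n s k in
  ratio (sum (map (λ p → countTrue (proj₁ p)) 𝒯)) (length 𝒯 * n)

TendsToZero : (ℕ → ℚ) → Set
TendsToZero a = ∀ (ε : ℚ) → 0ℚ < ε → ∃ λ N → ∀ n → N ≤ n → ∣ a n ∣ < ε

Admissible : ℕ → (ℕ → ℕ) → ℕ → Set
Admissible k s m₀ =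
    (∀ n → m₀ ≤ n → 2 * s n + k + 1 ≤ n)
  × TendsToZero (λ n → ratio (s n) n)
  × (∀ n → m₀ ≤ n → n ^ 2 ≤ 2 ^ s n)

{-# OPTIONS --safe #-}

-- A member of 𝒯_{n,k} is made of independent pieces: a tree on v₁, …, v_k, w (path edges and chords)
-- containing v₁, v_k and w; a splitting of the path v_k … w into a segment at v_k and a segment at w,
-- with at least one edge missing between them; and arbitrary sets of leaves at v₁ and at w. The size of
-- the family and its total number of vertices therefore factorise. With m inner path vertices there are
-- (m+1)(m+2)/2 splittings, with 2m/3 vertices on average, the leaves contribute s on average, and the tree
-- on the left has between 2 and k+1 vertices. Hence |μ(𝒯_{n,k}) − 2n/3| ≤ k + 1 + s, so σ(𝒯_{n,k}) → 2/3
-- for every k as soon as s_n/n → 0, and both sides of the statement have the limit 2/3.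

module Submission where

module BoolLemmas where

  open import Data.Bool using (Bool; true; false; _∧_; _∨_; not; T)
  open import Data.Bool.Properties using (T-∧; T-∨; T?)
  open import Data.Unit using (tt)
  open import Data.Empty using (⊥-elim)
  open import Data.Nat using (ℕ; _*_; _≡ᵇ_; _<_)
  open import Data.Nat.Properties using (≡⇒≡ᵇ; anyUpTo?; +-identityʳ)
  open import Data.Product using (_×_; _,_; proj₁; proj₂; ∃)
  open import Data.Sum using (_⊎_; inj₁; inj₂)
  open import Function.Bundles using (Equivalence)
  open import Relation.Binary.PropositionalEquality using (_≡_; refl; sym)
  open import Relation.Nullary using (¬_; yes; no; ¬?)
  open import Relation.Nullary.Decidable using (decidable-stable)

  ∧-intro : ∀ {a b} → T a → T b → T (a ∧ b)
  ∧-intro ta tb = Equivalence.from T-∧ (ta , tb)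

  ∧-elimˡ : ∀ a {b} → T (a ∧ b) → T a
  ∧-elimˡ a t = proj₁ (Equivalence.to (T-∧ {a}) t)

  ∧-elimʳ : ∀ a {b} → T (a ∧ b) → T b
  ∧-elimʳ a t = proj₂ (Equivalence.to (T-∧ {a}) t)

  ∨-introˡ : ∀ {a} b → T a → T (a ∨ b)
  ∨-introˡ b ta = Equivalence.from T-∨ (inj₁ ta)

  ∨-introʳ : ∀ a {b} → T b → T (a ∨ b)
  ∨-introʳ a tb = Equivalence.from (T-∨ {a}) (inj₂ tb)

  ∨-elim : ∀ a {b} → T (a ∨ b) → T a ⊎ T b
  ∨-elim a = Equivalence.to (T-∨ {a})

  not∨-elim : ∀ a b → T (not a ∨ b) → T a → T b
  not∨-elim true b q _ = q

  not∨-neg : ∀ a b → ¬ T (not a ∨ b) → T a × ¬ T b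
  not∨-neg true  b nq = tt , nq
  not∨-neg false b nq = ⊥-elim (nq tt)

  ≡ᵇ-refl : ∀ n → T (n ≡ᵇ n)
  ≡ᵇ-refl n = ≡⇒≡ᵇ n n refl

  all-below-or-counterexample : ∀ (f : ℕ → Bool) n → (∀ x → x < n → T (f x)) ⊎ (∃ λ x → x < n × ¬ T (f x))
  all-below-or-counterexample f n with anyUpTo? (λ x → ¬? (T? (f x))) n
  ... | yes counterexample = inj₂ counterexample
  ... | no  none = inj₁ λ x x<n → decidable-stable (T? (f x)) (λ ¬fx → none (x , x<n , ¬fx))

  ind : Bool → ℕ
  ind true  = 1
  ind false = 0

  ind-∧ : ∀ a b → ind (a ∧ b) ≡ ind a * ind b
  ind-∧ true  b = sym (+-identityʳ (ind b))
  ind-∧ false b = refl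

module Reachability where

  open import Defs
  open BoolLemmas
  open import Data.Bool using (Bool; true; false; _∧_; _∨_; not; T)
  open import Data.Unit using (tt)
  open import Data.Empty using (⊥-elim)
  open import Data.Nat using (ℕ; zero; suc; _+_; _≡ᵇ_; _≤_; _<_; _≤?_; z≤n; s≤s)
  open import Data.Nat.Properties
  open import Data.List using (List; []; _∷_; length; upTo)
  open import Data.List.Properties using (length-upTo)
  open import Data.List.Membership.Propositional using (_∈_; lose; find)
  open import Data.List.Membership.Propositional.Properties using (∈-upTo⁺)
  open import Data.List.Relation.Unary.Any using (here; there)
  open import Data.List.Relation.Unary.Any.Properties using (any⁺; any⁻)
  open import Data.Product using (_×_; _,_; proj₁; proj₂; ∃)
  open import Data.Sum using (_⊎_; inj₁; inj₂)
  open import Relation.Binary.PropositionalEquality using (_≡_; refl; sym; subst)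
  open import Relation.Nullary using (¬_; yes; no)

  Adj : List Edge → ℕ → ℕ → Set
  Adj F u v = (u , v) ∈ F ⊎ (v , u) ∈ F

  step-self : ∀ F R x → T (R x) → T (reachStep F R x)
  step-self F R x t = ∨-introˡ _ t

  step-edge : ∀ F R {x y} → Adj F y x → T (R y) → T (reachStep F R x)
  step-edge F R {x} {y} (inj₁ yx∈F) t =
    ∨-introʳ (R x) (any⁺ _ (lose yx∈F (∨-introʳ ((y ≡ᵇ x) ∧ R x) (∧-intro (≡ᵇ-refl x) t))))
  step-edge F R {x} {y} (inj₂ xy∈F) t =
    ∨-introʳ (R x) (any⁺ _ (lose xy∈F (∨-introˡ _ (∧-intro (≡ᵇ-refl x) t))))

  step-elim : ∀ F R x → T (reachStep F R x) → T (R x) ⊎ (∃ λ y → Adj F y x × T (R y))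
  step-elim F R x t with ∨-elim (R x) t
  ... | inj₁ Rx = inj₁ Rx
  ... | inj₂ q with find (any⁻ _ F q)
  ... | (a , b) , ab∈F , r with ∨-elim ((a ≡ᵇ x) ∧ R b) r
  ... | inj₁ r₁ with ≡ᵇ⇒≡ a x (∧-elimˡ (a ≡ᵇ x) r₁)
  ... | refl = inj₂ (b , inj₂ ab∈F , ∧-elimʳ (a ≡ᵇ x) r₁)
  step-elim F R x t | inj₂ q | (a , b) , ab∈F , r | inj₂ r₂ with ≡ᵇ⇒≡ b x (∧-elimˡ (b ≡ᵇ x) r₂)
  ... | refl = inj₂ (a , inj₁ ab∈F , ∧-elimʳ (b ≡ᵇ x) r₂)

  iter-suc : ∀ t F R x → iter (suc t) F R x ≡ reachStep F (iter t F R) x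
  iter-suc zero    F R x = refl
  iter-suc (suc t) F R x = iter-suc t F (reachStep F R) x

  reachStep-simulate : (f : ℕ → ℕ) (F₁ F₂ : List Edge) →
    (∀ u v → Adj F₁ u v → f u ≡ f v ⊎ Adj F₂ (f u) (f v)) →
    ∀ R₁ R₂ → (∀ x → T (R₁ x) → T (R₂ (f x))) →
    ∀ x → T (reachStep F₁ R₁ x) → T (reachStep F₂ R₂ (f x))
  reachStep-simulate f F₁ F₂ edges R₁ R₂ hR x t with step-elim F₁ R₁ x t
  ... | inj₁ q = step-self F₂ R₂ (f x) (hR x q)
  ... | inj₂ (y , adj , q) with edges y x adj
  ... | inj₁ fy≡fx = step-self F₂ R₂ (f x) (subst (λ z → T (R₂ z)) fy≡fx (hR y q))
  ... | inj₂ adj₂  = step-edge F₂ R₂ adj₂ (hR y q)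

  iter-simulate : (f : ℕ → ℕ) (F₁ F₂ : List Edge) →
    (∀ u v → Adj F₁ u v → f u ≡ f v ⊎ Adj F₂ (f u) (f v)) →
    ∀ t R₁ R₂ → (∀ x → T (R₁ x) → T (R₂ (f x))) →
    ∀ x → T (iter t F₁ R₁ x) → T (iter t F₂ R₂ (f x))
  iter-simulate f F₁ F₂ edges zero    R₁ R₂ hR = hR
  iter-simulate f F₁ F₂ edges (suc t) R₁ R₂ hR =
    iter-simulate f F₁ F₂ edges t (reachStep F₁ R₁) (reachStep F₂ R₂) (reachStep-simulate f F₁ F₂ edges R₁ R₂ hR)

  reachStep-mono : ∀ F R₁ R₂ → (∀ x → T (R₁ x) → T (R₂ x)) → ∀ x → T (reachStep F R₁ x) → T (reachStep F R₂ x)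
  reachStep-mono F = reachStep-simulate (λ x → x) F F (λ u v adj → inj₂ adj)

  iter-inflationary : ∀ t F R x → T (iter t F R x) → T (iter (suc t) F R x)
  iter-inflationary t F R x q = subst T (sym (iter-suc t F R x)) (step-self F (iter t F R) x q)

  iter-mono : ∀ {t t'} F R x → t ≤ t' → T (iter t F R x) → T (iter t' F R x)
  iter-mono {t} F R x t≤t' q with m≤n⇒∃[o]m+o≡n t≤t'
  ... | j , refl = go j
    where
    go : ∀ j → T (iter (t + j) F R x)
    go zero    = subst (λ z → T (iter z F R x)) (sym (+-identityʳ t)) q
    go (suc j) = subst (λ z → T (iter z F R x)) (sym (+-suc t j)) (iter-inflationary (t + j) F R x (go j))

  iter-edge : ∀ t F R {x y} → Adj F y x → T (iter t F R y) → T (iter (suc t) F R x)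
  iter-edge t F R adj q = subst T (sym (iter-suc t F R _)) (step-edge F (iter t F R) adj q)

  iter-closed : ∀ (Closed : ℕ → Set) F → (∀ u v → Adj F u v → Closed u → Closed v) →
    ∀ t R → (∀ x → T (R x) → Closed x) → ∀ x → T (iter t F R x) → Closed x
  iter-closed Closed F closed zero    R hR = hR
  iter-closed Closed F closed (suc t) R hR = iter-closed Closed F closed t (reachStep F R) hstep
    where
    hstep : ∀ x → T (reachStep F R x) → Closed x
    hstep x q with step-elim F R x q
    ... | inj₁ r = hR x r
    ... | inj₂ (y , adj , r) = closed y x adj (hR y r)

  reached-incident : ∀ F r t x → T (iter t F (λ y → y ≡ᵇ r) x) → x ≡ r ⊎ ∃ λ y → Adj F y x
  reached-incident F r t = iter-closed (λ x → x ≡ r ⊎ ∃ λ y → Adj F y x) F (λ u v adj _ → inj₂ (u , adj)) t _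
    (λ x q → inj₁ (≡ᵇ⇒≡ x r q))

  countOn : (ℕ → Bool) → List ℕ → ℕ
  countOn f []       = 0
  countOn f (x ∷ xs) = ind (f x) + countOn f xs

  countOn-≤-length : ∀ f xs → countOn f xs ≤ length xs
  countOn-≤-length f [] = z≤n
  countOn-≤-length f (x ∷ xs) with f x
  ... | true  = s≤s (countOn-≤-length f xs)
  ... | false = m≤n⇒m≤1+n (countOn-≤-length f xs)

  countOn-mono : ∀ f g xs → (∀ x → x ∈ xs → T (f x) → T (g x)) → countOn f xs ≤ countOn g xs
  countOn-mono f g [] f⇒g = z≤n
  countOn-mono f g (x ∷ xs) f⇒g with f x in fx | g x in gx
  ... | true  | true  = s≤s (countOn-mono f g xs (λ y m → f⇒g y (there m)))
  ... | false | true  = m≤n⇒m≤1+n (countOn-mono f g xs (λ y m → f⇒g y (there m)))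
  ... | false | false = countOn-mono f g xs (λ y m → f⇒g y (there m))
  ... | true  | false with f⇒g x (here refl) (subst T (sym fx) tt)
  ... | q rewrite gx = ⊥-elim q

  countOn-strict : ∀ f g xs → (∀ x → x ∈ xs → T (f x) → T (g x)) →
    ∀ {x} → x ∈ xs → T (g x) → ¬ T (f x) → suc (countOn f xs) ≤ countOn g xs
  countOn-strict f g (y ∷ xs) f⇒g (here refl) gy ¬fy with f y | g y
  ... | true  | _     = ⊥-elim (¬fy tt)
  ... | false | false = ⊥-elim gy
  ... | false | true  = s≤s (countOn-mono f g xs (λ z m → f⇒g z (there m)))
  countOn-strict f g (y ∷ xs) f⇒g (there x∈xs) gx ¬fx with f y in fy | g y in gy
  ... | true  | true  = s≤s (countOn-strict f g xs (λ z m → f⇒g z (there m)) x∈xs gx ¬fx)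
  ... | false | true  = s≤s (<⇒≤ (countOn-strict f g xs (λ z m → f⇒g z (there m)) x∈xs gx ¬fx))
  ... | false | false = countOn-strict f g xs (λ z m → f⇒g z (there m)) x∈xs gx ¬fx
  ... | true  | false with f⇒g y (here refl) (subst T (sym fy) tt)
  ... | q rewrite gy = ⊥-elim q

  countOn-false : ∀ xs → countOn (λ _ → false) xs ≡ 0
  countOn-false []       = refl
  countOn-false (x ∷ xs) = countOn-false xs

  EdgesBelow : ℕ → List Edge → Set
  EdgesBelow n F = ∀ e → e ∈ F → proj₁ e < n × proj₂ e < n

  -- The sets reached after t steps grow strictly inside {0, …, n-1} until they reach a fixpoint,
  -- so the fixpoint is attained within the n steps that `reach` performs.
  module Saturation (n : ℕ) (F : List Edge) (r : ℕ) (below : EdgesBelow n F) (r<n : r < n) where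
    Reached : ℕ → ℕ → Bool
    Reached t = iter t F (λ x → x ≡ᵇ r)

    Reached-below : ∀ t x → T (Reached t x) → x < n
    Reached-below t = iter-closed (_< n) F closed t _ (λ x q → subst (_< n) (sym (≡ᵇ⇒≡ x r q)) r<n)
      where
      closed : ∀ u v → Adj F u v → u < n → v < n
      closed u v (inj₁ uv∈F) _ = proj₂ (below _ uv∈F)
      closed u v (inj₂ vu∈F) _ = proj₁ (below _ vu∈F)

    Saturated : ℕ → Set
    Saturated t = ∀ x → T (Reached (suc t) x) → T (Reached t x)

    saturated-stays : ∀ t → Saturated t → ∀ j x → T (Reached (j + t) x) → T (Reached t x)
    saturated-stays t sat zero    x q = q
    saturated-stays t sat (suc j) x q =
      sat x (subst T (sym (iter-suc t F _ x))
        (reachStep-mono F (Reached (j + t)) (Reached t) (saturated-stays t sat j) x (subst T (iter-suc (j + t) F _ x) q)))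

    saturated-or-growing : ∀ t → t ≤ n → (∃ λ t₀ → t₀ < t × Saturated t₀) ⊎ (suc t ≤ countOn (Reached t) (upTo n))
    saturated-or-growing zero _ = inj₂ (subst (λ c → suc c ≤ countOn (Reached 0) (upTo n)) (countOn-false (upTo n))
      (countOn-strict (λ _ → false) (Reached 0) (upTo n) (λ x _ ()) (∈-upTo⁺ r<n) (≡ᵇ-refl r) (λ ())))
    saturated-or-growing (suc t) t<n with saturated-or-growing t (<⇒≤ t<n)
    ... | inj₁ (t₀ , t₀<t , sat) = inj₁ (t₀ , m<n⇒m<1+n t₀<t , sat)
    ... | inj₂ growing with all-below-or-counterexample (λ x → not (Reached (suc t) x) ∨ Reached t x) n
    ... | inj₁ same = inj₁ (t , ≤-refl , λ x q → not∨-elim (Reached (suc t) x) (Reached t x) (same x (Reached-below (suc t) x q)) q)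
    ... | inj₂ (x , x<n , new) with not∨-neg (Reached (suc t) x) (Reached t x) new
    ... | now , ¬before = inj₂ (≤-trans (s≤s growing)
          (countOn-strict (Reached t) (Reached (suc t)) (upTo n) (λ y _ → iter-inflationary t F _ y) (∈-upTo⁺ x<n) now ¬before))

    saturates-before-n : ∃ λ t₀ → t₀ < n × Saturated t₀
    saturates-before-n with saturated-or-growing n ≤-refl
    ... | inj₁ saturated = saturated
    ... | inj₂ too-many = ⊥-elim (<-irrefl refl (≤-trans too-many
          (subst (countOn (Reached n) (upTo n) ≤_) (length-upTo n) (countOn-≤-length (Reached n) (upTo n)))))

    reach-complete : ∀ t x → T (Reached t x) → T (reach n F r x)
    reach-complete t x q with saturates-before-n
    ... | t₀ , t₀<n , sat with t ≤? n
    ... | yes t≤n = iter-mono F _ x t≤n q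
    ... | no  t≰n with m≤n⇒∃[o]m+o≡n (≤-trans (<⇒≤ t₀<n) (<⇒≤ (≰⇒> t≰n)))
    ... | j , refl = iter-mono F _ x (<⇒≤ t₀<n) (saturated-stays t₀ sat j x (subst (λ z → T (Reached z x)) (+-comm t₀ j) q))

module Lists where

  open import Defs
  open import Data.Bool using (Bool; true; false; _∧_; T)
  open import Data.Unit using (tt)
  open import Data.Nat using (ℕ; zero; suc; _+_; _≤_; _<_; z≤n; s≤s)
  open import Data.Nat.Properties
  open import Data.List using (List; []; _∷_; _++_; length; applyUpTo; replicate)
  open import Data.List.Membership.Propositional using (_∈_; lose; find)
  open import Data.List.Membership.Propositional.Properties using (∈-concatMap⁺; ∈-concatMap⁻)
  open import Data.List.Relation.Unary.Any using (here; there)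
  open import Data.Product using (_×_; _,_; ∃)
  open import Relation.Binary.PropositionalEquality using (_≡_; refl; cong)

  ∈-selected⁻ : ∀ (g : ℕ → Edge) j Z e → e ∈ selected (applyUpTo g j) Z → ∃ λ i → i < j × T (memb Z i) × e ≡ g i
  ∈-selected⁻ g (suc j) (true ∷ Z) e (here refl) = 0 , s≤s z≤n , tt , refl
  ∈-selected⁻ g (suc j) (true ∷ Z) e (there mem) with ∈-selected⁻ (λ i → g (suc i)) j Z e mem
  ... | i , lt , q , eq = suc i , s≤s lt , q , eq
  ∈-selected⁻ g (suc j) (false ∷ Z) e mem with ∈-selected⁻ (λ i → g (suc i)) j Z e mem
  ... | i , lt , q , eq = suc i , s≤s lt , q , eq

  ∈-selected⁺ : ∀ (g : ℕ → Edge) j Z i → i < j → T (memb Z i) → g i ∈ selected (applyUpTo g j) Z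
  ∈-selected⁺ g (suc j) (true ∷ Z) zero lt q = here refl
  ∈-selected⁺ g (suc j) (true ∷ Z) (suc i) (s≤s lt) q = there (∈-selected⁺ (λ i → g (suc i)) j Z i lt q)
  ∈-selected⁺ g (suc j) (false ∷ Z) (suc i) (s≤s lt) q = ∈-selected⁺ (λ i → g (suc i)) j Z i lt q

  length-selected : ∀ (E : List Edge) Z → length Z ≡ length E → length (selected E Z) ≡ countTrue Z
  length-selected [] [] eq = refl
  length-selected (e ∷ E) (true ∷ Z) eq = cong suc (length-selected E Z (suc-injective eq))
  length-selected (e ∷ E) (false ∷ Z) eq = length-selected E Z (suc-injective eq)

  selected-++ : ∀ (E1 E2 : List Edge) Z1 Z2 → length Z1 ≡ length E1 → selected (E1 ++ E2) (Z1 ++ Z2) ≡ selected E1 Z1 ++ selected E2 Z2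
  selected-++ [] E2 [] Z2 eq = refl
  selected-++ (e ∷ E1) E2 (true ∷ Z1) Z2 eq = cong (e ∷_) (selected-++ E1 E2 Z1 Z2 (suc-injective eq))
  selected-++ (e ∷ E1) E2 (false ∷ Z1) Z2 eq = selected-++ E1 E2 Z1 Z2 (suc-injective eq)

  memb-++ˡ : ∀ xs ys i → i < length xs → memb (xs ++ ys) i ≡ memb xs i
  memb-++ˡ (x ∷ xs) ys zero lt = refl
  memb-++ˡ (x ∷ xs) ys (suc i) (s≤s lt) = memb-++ˡ xs ys i lt

  memb-++ʳ : ∀ xs ys j → memb (xs ++ ys) (length xs + j) ≡ memb ys j
  memb-++ʳ [] ys j = refl
  memb-++ʳ (x ∷ xs) ys j = memb-++ʳ xs ys j

  memb⇒<length : ∀ xs i → T (memb xs i) → i < length xs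
  memb⇒<length (x ∷ xs) zero q = s≤s z≤n
  memb⇒<length (x ∷ xs) (suc i) q = s≤s (memb⇒<length xs i q)

  countTrue-++ : ∀ xs ys → countTrue (xs ++ ys) ≡ countTrue xs + countTrue ys
  countTrue-++ [] ys = refl
  countTrue-++ (true ∷ xs) ys = cong suc (countTrue-++ xs ys)
  countTrue-++ (false ∷ xs) ys = countTrue-++ xs ys

  countTrue≤length : ∀ xs → countTrue xs ≤ length xs
  countTrue≤length [] = z≤n
  countTrue≤length (true ∷ xs) = s≤s (countTrue≤length xs)
  countTrue≤length (false ∷ xs) = m≤n⇒m≤1+n (countTrue≤length xs)

  memb⇒countTrue-pos : ∀ xs i → T (memb xs i) → 1 ≤ countTrue xs
  memb⇒countTrue-pos (true ∷ xs) zero q = s≤s z≤n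
  memb⇒countTrue-pos (true ∷ xs) (suc i) q = s≤s z≤n
  memb⇒countTrue-pos (false ∷ xs) (suc i) q = memb⇒countTrue-pos xs i q

  countTrue-replicate-false : ∀ j → countTrue (replicate j false) ≡ 0
  countTrue-replicate-false zero = refl
  countTrue-replicate-false (suc j) = countTrue-replicate-false j

  countTrue-replicate-true : ∀ j → countTrue (replicate j true) ≡ j
  countTrue-replicate-true zero = refl
  countTrue-replicate-true (suc j) = cong suc (countTrue-replicate-true j)

  memb-replicate-false : ∀ j i → memb (replicate j false) i ≡ false
  memb-replicate-false zero i = refl
  memb-replicate-false (suc j) zero = refl
  memb-replicate-false (suc j) (suc i) = memb-replicate-false j i

  beq : Bool → Bool → Bool
  beq true true = true
  beq false false = true
  beq _ _ = false

  eqB : List Bool → List Bool → Bool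
  eqB [] [] = true
  eqB (x ∷ xs) (y ∷ ys) = beq x y ∧ eqB xs ys
  eqB _ _ = false

  eqB-memb : ∀ xs ys → T (eqB xs ys) → ∀ i → memb xs i ≡ memb ys i
  eqB-memb [] [] q i = refl
  eqB-memb (true ∷ xs) (true ∷ ys) q zero = refl
  eqB-memb (false ∷ xs) (false ∷ ys) q zero = refl
  eqB-memb (true ∷ xs) (true ∷ ys) q (suc i) = eqB-memb xs ys q i
  eqB-memb (false ∷ xs) (false ∷ ys) q (suc i) = eqB-memb xs ys q i

  eqB-count : ∀ xs ys → T (eqB xs ys) → countTrue xs ≡ countTrue ys
  eqB-count [] [] q = refl
  eqB-count (true ∷ xs) (true ∷ ys) q = cong suc (eqB-count xs ys q)
  eqB-count (false ∷ xs) (false ∷ ys) q = eqB-count xs ys q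

  eqB-intro : ∀ xs ys → length xs ≡ length ys → (∀ i → memb xs i ≡ memb ys i) → T (eqB xs ys)
  eqB-intro [] [] _ h = tt
  eqB-intro (true ∷ xs) (true ∷ ys) eq h = eqB-intro xs ys (suc-injective eq) (λ i → h (suc i))
  eqB-intro (false ∷ xs) (false ∷ ys) eq h = eqB-intro xs ys (suc-injective eq) (λ i → h (suc i))
  eqB-intro (true ∷ xs) (false ∷ ys) eq h with h 0
  ... | ()
  eqB-intro (false ∷ xs) (true ∷ ys) eq h with h 0
  ... | ()

  eqB-refl : ∀ xs → T (eqB xs xs)
  eqB-refl [] = tt
  eqB-refl (true ∷ xs) = eqB-refl xs
  eqB-refl (false ∷ xs) = eqB-refl xs

  subsets-length : ∀ j xs → xs ∈ subsets j → length xs ≡ j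
  subsets-length zero    .[] (here refl) = refl
  subsets-length (suc j) xs  mem with find (∈-concatMap⁻ (λ ys → (false ∷ ys) ∷ (true ∷ ys) ∷ []) {subsets j} mem)
  ... | ys , ys∈ , here refl         = cong suc (subsets-length j ys ys∈)
  ... | ys , ys∈ , there (here refl) = cong suc (subsets-length j ys ys∈)

  ∈-subsets : ∀ j xs → length xs ≡ j → xs ∈ subsets j
  ∈-subsets zero    []       _  = here refl
  ∈-subsets (suc j) (x ∷ xs) eq =
    ∈-concatMap⁺ (λ ys → (false ∷ ys) ∷ (true ∷ ys) ∷ []) (lose (∈-subsets j xs (suc-injective eq)) (extend x))
    where
    extend : ∀ x → (x ∷ xs) ∈ (false ∷ xs) ∷ (true ∷ xs) ∷ []
    extend false = here refl
    extend true  = there (here refl)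

module Sums where

  open import Defs
  open BoolLemmas using (ind)
  open Lists using (eqB)
  open import Data.Bool using (Bool; true; false; _∧_; T)
  open import Data.Nat using (ℕ; zero; suc; _+_; _*_; _^_; _≤_; z≤n)
  open import Data.Nat.Properties
  open import Data.List using (List; []; _∷_; _++_; map; length; concatMap; filter; replicate)
  open import Data.Bool.ListAction using (and)
  open import Data.Nat.ListAction using (sum)
  open import Data.Nat.ListAction.Properties using (sum-++)
  open import Data.List.Properties using (map-++; map-∘)
  open import Data.List.Membership.Propositional using (_∈_)
  open import Data.List.Relation.Unary.Any using (here; there)
  open import Relation.Binary.PropositionalEquality using (_≡_; refl; sym; trans; cong; cong₂; module ≡-Reasoning)
  open import Data.Bool.Properties using (T?)
  open import Data.Nat.Tactic.RingSolver using (solve-∀)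
  open ≡-Reasoning

  ∑ : {A : Set} → List A → (A → ℕ) → ℕ
  ∑ xs f = sum (map f xs)

  module _ {A : Set} where
    ∑-cong-∈ : ∀ (xs : List A) {f g : A → ℕ} → (∀ x → x ∈ xs → f x ≡ g x) → ∑ xs f ≡ ∑ xs g
    ∑-cong-∈ [] h = refl
    ∑-cong-∈ (x ∷ xs) h = cong₂ _+_ (h x (here refl)) (∑-cong-∈ xs (λ y m → h y (there m)))

    ∑-cong : ∀ (xs : List A) {f g : A → ℕ} → (∀ x → f x ≡ g x) → ∑ xs f ≡ ∑ xs g
    ∑-cong xs h = ∑-cong-∈ xs (λ x _ → h x)

    ∑-mono : ∀ (xs : List A) {f g : A → ℕ} → (∀ x → x ∈ xs → f x ≤ g x) → ∑ xs f ≤ ∑ xs g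
    ∑-mono [] h = z≤n
    ∑-mono (x ∷ xs) h = +-mono-≤ (h x (here refl)) (∑-mono xs (λ y m → h y (there m)))

    ∑-++ : ∀ (xs ys : List A) f → ∑ (xs ++ ys) f ≡ ∑ xs f + ∑ ys f
    ∑-++ xs ys f = trans (cong sum (map-++ f xs ys)) (sum-++ (map f xs) (map f ys))

    ∑-+ : ∀ (xs : List A) f g → ∑ xs (λ x → f x + g x) ≡ ∑ xs f + ∑ xs g
    ∑-+ [] f g = refl
    ∑-+ (x ∷ xs) f g = trans (cong (f x + g x +_) (∑-+ xs f g)) (interchange (f x) (g x) (∑ xs f) (∑ xs g))
      where
      interchange : ∀ a b c d → a + b + (c + d) ≡ a + c + (b + d)
      interchange = solve-∀

    ∑-*ˡ : ∀ (xs : List A) c f → ∑ xs (λ x → c * f x) ≡ c * ∑ xs f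
    ∑-*ˡ [] c f = sym (*-zeroʳ c)
    ∑-*ˡ (x ∷ xs) c f = trans (cong (c * f x +_) (∑-*ˡ xs c f)) (sym (*-distribˡ-+ c (f x) (∑ xs f)))

    ∑-*ʳ : ∀ (xs : List A) c f → ∑ xs (λ x → f x * c) ≡ ∑ xs f * c
    ∑-*ʳ [] c f = refl
    ∑-*ʳ (x ∷ xs) c f = trans (cong (f x * c +_) (∑-*ʳ xs c f)) (sym (*-distribʳ-+ c (f x) (∑ xs f)))

    ∑-zero : ∀ (xs : List A) f → (∀ x → x ∈ xs → f x ≡ 0) → ∑ xs f ≡ 0
    ∑-zero [] f h = refl
    ∑-zero (x ∷ xs) f h = cong₂ _+_ (h x (here refl)) (∑-zero xs f (λ y m → h y (there m)))

  ∑-concatMap : ∀ {A B : Set} (h : A → List B) (xs : List A) f → ∑ (concatMap h xs) f ≡ ∑ xs (λ x → ∑ (h x) f)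
  ∑-concatMap h [] f = refl
  ∑-concatMap h (x ∷ xs) f = trans (∑-++ (h x) (concatMap h xs) f) (cong (∑ (h x) f +_) (∑-concatMap h xs f))

  ∑-map : ∀ {A B : Set} (h : A → B) (xs : List A) f → ∑ (map h xs) f ≡ ∑ xs (λ x → f (h x))
  ∑-map h xs f = cong sum (sym (map-∘ xs))

  ∑-filter : ∀ {A : Set} (p : A → Bool) (xs : List A) g → ∑ (filter (λ x → T? (p x)) xs) g ≡ ∑ xs (λ x → ind (p x) * g x)
  ∑-filter p [] g = refl
  ∑-filter p (x ∷ xs) g with p x
  ... | true  = cong₂ _+_ (sym (+-identityʳ (g x))) (∑-filter p xs g)
  ... | false = ∑-filter p xs g

  length-∑ : ∀ {A : Set} (xs : List A) → length xs ≡ ∑ xs (λ _ → 1)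
  length-∑ [] = refl
  length-∑ (x ∷ xs) = cong suc (length-∑ xs)

  ∑-subsets-suc : ∀ j (g : List Bool → ℕ) → ∑ (subsets (suc j)) g ≡ ∑ (subsets j) (λ x → g (false ∷ x) + g (true ∷ x))
  ∑-subsets-suc j g = trans (∑-concatMap _ (subsets j) g) (∑-cong (subsets j) (λ x → cong (g (false ∷ x) +_) (+-identityʳ (g (true ∷ x)))))

  ∑-subsets-+ : ∀ a b (g : List Bool → ℕ) → ∑ (subsets (a + b)) g ≡ ∑ (subsets a) (λ y → ∑ (subsets b) (λ z → g (y ++ z)))
  ∑-subsets-+ zero b g = sym (+-identityʳ _)
  ∑-subsets-+ (suc a) b g = begin
    ∑ (subsets (suc (a + b))) g ≡⟨ ∑-subsets-suc (a + b) g ⟩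
    ∑ (subsets (a + b)) (λ x → g (false ∷ x) + g (true ∷ x)) ≡⟨ ∑-+ (subsets (a + b)) _ _ ⟩
    ∑ (subsets (a + b)) (λ x → g (false ∷ x)) + ∑ (subsets (a + b)) (λ x → g (true ∷ x))
      ≡⟨ cong₂ _+_ (∑-subsets-+ a b (λ x → g (false ∷ x))) (∑-subsets-+ a b (λ x → g (true ∷ x))) ⟩
    ∑ (subsets a) (λ y → ∑ (subsets b) (λ z → g (false ∷ y ++ z))) + ∑ (subsets a) (λ y → ∑ (subsets b) (λ z → g (true ∷ y ++ z)))
      ≡⟨ sym (∑-+ (subsets a) _ _) ⟩
    ∑ (subsets a) (λ y → ∑ (subsets b) (λ z → g (false ∷ y ++ z)) + ∑ (subsets b) (λ z → g (true ∷ y ++ z)))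
      ≡⟨ sym (∑-subsets-suc a _) ⟩
    ∑ (subsets (suc a)) (λ y → ∑ (subsets b) (λ z → g (y ++ z))) ∎

  ∑-subsets-1 : ∀ j → ∑ (subsets j) (λ _ → 1) ≡ 2 ^ j
  ∑-subsets-1 zero = refl
  ∑-subsets-1 (suc j) = trans (∑-subsets-suc j (λ _ → 1)) (trans (∑-+ (subsets j) (λ _ → 1) (λ _ → 1))
    (trans (cong₂ _+_ (∑-subsets-1 j) (∑-subsets-1 j)) (cong (2 ^ j +_) (sym (+-identityʳ (2 ^ j))))))

  ∑-subsets-countTrue : ∀ j → 2 * ∑ (subsets j) countTrue ≡ j * 2 ^ j
  ∑-subsets-countTrue zero = refl
  ∑-subsets-countTrue (suc j) = begin
    2 * ∑ (subsets (suc j)) countTrue ≡⟨ cong (2 *_) (∑-subsets-suc j countTrue) ⟩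
    2 * ∑ (subsets j) (λ x → countTrue x + suc (countTrue x)) ≡⟨ cong (2 *_) (∑-cong (subsets j) (λ x → +-suc (countTrue x) (countTrue x))) ⟩
    2 * ∑ (subsets j) (λ x → 1 + (countTrue x + countTrue x)) ≡⟨ cong (2 *_) (∑-+ (subsets j) (λ _ → 1) _) ⟩
    2 * (∑ (subsets j) (λ _ → 1) + ∑ (subsets j) (λ x → countTrue x + countTrue x)) ≡⟨ cong (λ z → 2 * (z + ∑ (subsets j) (λ x → countTrue x + countTrue x))) (∑-subsets-1 j) ⟩
    2 * (2 ^ j + ∑ (subsets j) (λ x → countTrue x + countTrue x)) ≡⟨ cong (λ z → 2 * (2 ^ j + z)) (∑-+ (subsets j) countTrue countTrue) ⟩
    2 * (2 ^ j + (∑ (subsets j) countTrue + ∑ (subsets j) countTrue)) ≡⟨ lem (2 ^ j) (∑ (subsets j) countTrue) (∑-subsets-countTrue j) ⟩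
    suc j * 2 ^ suc j ∎
    where
    lem : ∀ p q → 2 * q ≡ j * p → 2 * (p + (q + q)) ≡ suc j * (2 * p)
    lem p q h = begin
      2 * (p + (q + q))    ≡⟨ regroup p q ⟩
      2 * p + 2 * (2 * q)  ≡⟨ cong (λ z → 2 * p + 2 * z) h ⟩
      2 * p + 2 * (j * p)  ≡⟨ collect j p ⟩
      suc j * (2 * p)      ∎
      where
      regroup : ∀ p q → 2 * (p + (q + q)) ≡ 2 * p + 2 * (2 * q)
      regroup = solve-∀
      collect : ∀ j p → 2 * p + 2 * (j * p) ≡ suc j * (2 * p)
      collect = solve-∀

  module _ {T : Set} where
    ∑⁵ : List T → List T → List T → List T → List T → (T → T → T → T → T → ℕ) → ℕ
    ∑⁵ l1 l2 l3 l4 l5 f = ∑ l1 (λ a → ∑ l2 (λ b → ∑ l3 (λ c → ∑ l4 (λ d → ∑ l5 (λ e → f a b c d e)))))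

    ∑⁵-cong : ∀ l1 l2 l3 l4 l5 {f g : T → T → T → T → T → ℕ} →
      (∀ a b c d e → a ∈ l1 → b ∈ l2 → c ∈ l3 → d ∈ l4 → e ∈ l5 → f a b c d e ≡ g a b c d e) → ∑⁵ l1 l2 l3 l4 l5 f ≡ ∑⁵ l1 l2 l3 l4 l5 g
    ∑⁵-cong l1 l2 l3 l4 l5 h = ∑-cong-∈ l1 (λ a ma → ∑-cong-∈ l2 (λ b mb → ∑-cong-∈ l3 (λ c mc → ∑-cong-∈ l4 (λ d md → ∑-cong-∈ l5 (λ e me → h a b c d e ma mb mc md me)))))

    ∑⁵-+ : ∀ l1 l2 l3 l4 l5 (f g : T → T → T → T → T → ℕ) →
      ∑⁵ l1 l2 l3 l4 l5 (λ a b c d e → f a b c d e + g a b c d e) ≡ ∑⁵ l1 l2 l3 l4 l5 f + ∑⁵ l1 l2 l3 l4 l5 g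
    ∑⁵-+ l1 l2 l3 l4 l5 f g =
      trans (∑-cong l1 (λ a → trans (∑-cong l2 (λ b → trans (∑-cong l3 (λ c → trans (∑-cong l4 (λ d → ∑-+ l5 _ _)) (∑-+ l4 _ _))) (∑-+ l3 _ _))) (∑-+ l2 _ _)))
            (∑-+ l1 _ _)

    private
      r1 : ∀ f g h k → f * (g * (h * k)) ≡ (f * (g * h)) * k
      r1 = solve-∀
      r2 : ∀ f g h K → (f * (g * h)) * K ≡ h * (f * g * K)
      r2 = solve-∀
      r3 : ∀ H f g K → H * (f * g * K) ≡ f * (g * (H * K))
      r3 = solve-∀
      r4 : ∀ F g R → F * (g * R) ≡ g * (F * R)
      r4 = solve-∀

    ∑⁴-product : ∀ (la lb lc ld : List T) (F G H K : T → ℕ) →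
      ∑ la (λ a → ∑ lb (λ b → ∑ lc (λ c → ∑ ld (λ d → F a * (G b * (H c * K d))))))
      ≡ ∑ la F * (∑ lb G * (∑ lc H * ∑ ld K))
    ∑⁴-product la lb lc ld F G H K = begin
      ∑ la (λ a → ∑ lb (λ b → ∑ lc (λ c → ∑ ld (λ d → F a * (G b * (H c * K d))))))
        ≡⟨ ∑-cong la (λ a → ∑-cong lb (λ b → ∑-cong lc (λ c → trans (∑-cong ld (λ d → r1 (F a) (G b) (H c) (K d))) (∑-*ˡ ld (F a * (G b * H c)) K)))) ⟩
      ∑ la (λ a → ∑ lb (λ b → ∑ lc (λ c → (F a * (G b * H c)) * ΣK)))
        ≡⟨ ∑-cong la (λ a → ∑-cong lb (λ b → trans (∑-cong lc (λ c → r2 (F a) (G b) (H c) ΣK)) (∑-*ʳ lc _ H))) ⟩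
      ∑ la (λ a → ∑ lb (λ b → ΣH * (F a * G b * ΣK)))
        ≡⟨ ∑-cong la (λ a → trans (∑-cong lb (λ b → r3 ΣH (F a) (G b) ΣK)) (∑-*ˡ lb (F a) (λ b → G b * (ΣH * ΣK)))) ⟩
      ∑ la (λ a → F a * ∑ lb (λ b → G b * (ΣH * ΣK)))
        ≡⟨ ∑-cong la (λ a → cong (F a *_) (∑-*ʳ lb (ΣH * ΣK) G)) ⟩
      ∑ la (λ a → F a * (∑ lb G * (ΣH * ΣK))) ≡⟨ ∑-*ʳ la _ F ⟩
      ∑ la F * (∑ lb G * (ΣH * ΣK)) ∎
      where
      ΣH = ∑ lc H
      ΣK = ∑ ld K

    ∑⁵-product-15 : ∀ (la lb lc ld le : List T) (F : T → T → ℕ) (G H K : T → ℕ) →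
      ∑⁵ la lb lc ld le (λ a b c d e → F a e * (G b * (H c * K d)))
      ≡ ∑ la (λ a → ∑ le (F a)) * (∑ lb G * (∑ lc H * ∑ ld K))
    ∑⁵-product-15 la lb lc ld le F G H K =
      trans (∑-cong la (λ a → ∑-cong lb (λ b → ∑-cong lc (λ c → ∑-cong ld (λ d → ∑-*ʳ le _ (F a))))))
            (∑⁴-product la lb lc ld (λ a → ∑ le (F a)) G H K)

    ∑⁵-product-13 : ∀ (la lb lc ld le : List T) (F : T → T → ℕ) (G H K : T → ℕ) →
      ∑⁵ la lb lc ld le (λ a b c d e → F a c * (G b * (H d * K e)))
      ≡ ∑ la (λ a → ∑ lc (F a)) * (∑ lb G * (∑ ld H * ∑ le K))
    ∑⁵-product-13 la lb lc ld le F G H K = begin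
      ∑⁵ la lb lc ld le (λ a b c d e → F a c * (G b * (H d * K e)))
        ≡⟨ ∑-cong la (λ a → ∑-cong lb (λ b → ∑-cong lc (λ c → ∑-cong ld (λ d →
             trans (∑-cong le (λ e → r1 (F a c) (G b) (H d) (K e))) (∑-*ˡ le (F a c * (G b * H d)) K))))) ⟩
      ∑ la (λ a → ∑ lb (λ b → ∑ lc (λ c → ∑ ld (λ d → (F a c * (G b * H d)) * ΣK))))
        ≡⟨ ∑-cong la (λ a → ∑-cong lb (λ b → ∑-cong lc (λ c → trans (∑-cong ld (λ d → r2 (F a c) (G b) (H d) ΣK)) (∑-*ʳ ld _ H)))) ⟩
      ∑ la (λ a → ∑ lb (λ b → ∑ lc (λ c → ΣH * (F a c * G b * ΣK))))
        ≡⟨ ∑-cong la (λ a → ∑-cong lb (λ b → trans (∑-cong lc (λ c → r3 ΣH (F a c) (G b) ΣK)) (∑-*ʳ lc _ (F a)))) ⟩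
      ∑ la (λ a → ∑ lb (λ b → ∑ lc (F a) * (G b * (ΣH * ΣK))))
        ≡⟨ ∑-cong la (λ a → trans (∑-cong lb (λ b → r4 (∑ lc (F a)) (G b) (ΣH * ΣK))) (∑-*ʳ lb _ G)) ⟩
      ∑ la (λ a → ∑ lb G * (∑ lc (F a) * (ΣH * ΣK)))
        ≡⟨ ∑-cong la (λ a → r4 (∑ lb G) (∑ lc (F a)) (ΣH * ΣK)) ⟩
      ∑ la (λ a → ∑ lc (F a) * (∑ lb G * (ΣH * ΣK))) ≡⟨ ∑-*ʳ la _ (λ a → ∑ lc (F a)) ⟩
      ∑ la (λ a → ∑ lc (F a)) * (∑ lb G * (ΣH * ΣK)) ∎
      where
      ΣH = ∑ ld H
      ΣK = ∑ le K

  ∑-subsets-split⁵ : ∀ a b c d e (f : List Bool → ℕ) →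
    ∑ (subsets (a + (b + (c + (d + e))))) f ≡ ∑⁵ (subsets a) (subsets b) (subsets c) (subsets d) (subsets e) (λ A B C D E → f (A ++ (B ++ (C ++ (D ++ E)))))
  ∑-subsets-split⁵ a b c d e f =
    trans (∑-subsets-+ a _ f) (∑-cong (subsets a) (λ A →
    trans (∑-subsets-+ b _ _) (∑-cong (subsets b) (λ B →
    trans (∑-subsets-+ c _ _) (∑-cong (subsets c) (λ C →
    ∑-subsets-+ d e _))))))

  ∑⁵∑⁵-product : ∀ {T : Set} (lA lB lC lD1 lD2 lX lY lZ1 lZ2 lW : List T)
    (pL : T → T → T → T → ℕ) (pR : T → T → ℕ) (p1 p2 : T → T → ℕ) →
    ∑⁵ lA lB lC lD1 lD2 (λ A B C D1 D2 → ∑⁵ lX lY lZ1 lZ2 lW (λ X Y Z1 Z2 W → pL A C X W * (pR B Y * (p1 D1 Z1 * p2 D2 Z2))))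
    ≡ ∑ lA (λ A → ∑ lC (λ C → ∑ lX (λ X → ∑ lW (λ W → pL A C X W))))
      * (∑ lB (λ B → ∑ lY (pR B)) * (∑ lD1 (λ D → ∑ lZ1 (p1 D)) * ∑ lD2 (λ D → ∑ lZ2 (p2 D))))
  ∑⁵∑⁵-product lA lB lC lD1 lD2 lX lY lZ1 lZ2 lW pL pR p1 p2 =
    trans (∑⁵-cong lA lB lC lD1 lD2 (λ A B C D1 D2 _ _ _ _ _ → ∑⁵-product-15 lX lY lZ1 lZ2 lW (pL A C) (pR B) (p1 D1) (p2 D2)))
          (∑⁵-product-13 lA lB lC lD1 lD2 (λ A C → ∑ lX (λ X → ∑ lW (pL A C X))) (λ B → ∑ lY (pR B)) (λ D → ∑ lZ1 (p1 D)) (λ D → ∑ lZ2 (p2 D)))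

  ∑-and : ∀ j (f : List Bool → ℕ) → ∑ (subsets j) (λ x → ind (and x) * f x) ≡ f (replicate j true)
  ∑-and zero f = trans (+-identityʳ _) (+-identityʳ _)
  ∑-and (suc j) f = begin
    ∑ (subsets (suc j)) (λ x → ind (and x) * f x) ≡⟨ ∑-subsets-suc j _ ⟩
    ∑ (subsets j) (λ x → 0 + ind (true ∧ and x) * f (true ∷ x)) ≡⟨ ∑-and j (λ x → f (true ∷ x)) ⟩
    f (replicate (suc j) true) ∎

  ∑-and-1 : ∀ j → ∑ (subsets j) (λ x → ind (and x)) ≡ 1
  ∑-and-1 j = trans (∑-cong (subsets j) (λ x → sym (*-identityʳ (ind (and x))))) (∑-and j (λ _ → 1))

  ∑∑-eqB : ∀ j (f : List Bool → ℕ) → ∑ (subsets j) (λ D → ∑ (subsets j) (λ Z → ind (eqB D Z) * f D)) ≡ ∑ (subsets j) f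
  ∑∑-eqB zero f = cong (_+ 0) (trans (+-identityʳ _) (*-identityˡ (f [])))
  ∑∑-eqB (suc j) f = begin
    ∑ (subsets (suc j)) (λ D → ∑ (subsets (suc j)) (λ Z → ind (eqB D Z) * f D))
      ≡⟨ ∑-cong (subsets (suc j)) (λ D → ∑-subsets-suc j _) ⟩
    ∑ (subsets (suc j)) (λ D → ∑ (subsets j) (λ Z → ind (eqB D (false ∷ Z)) * f D + ind (eqB D (true ∷ Z)) * f D))
      ≡⟨ ∑-subsets-suc j _ ⟩
    ∑ (subsets j) (λ D → ∑ (subsets j) (λ Z → ind (eqB D Z) * f (false ∷ D) + 0) + ∑ (subsets j) (λ Z → 0 + ind (eqB D Z) * f (true ∷ D)))
      ≡⟨ ∑-cong (subsets j) (λ D → cong₂ _+_ (∑-cong (subsets j) (λ Z → +-identityʳ _)) refl) ⟩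
    ∑ (subsets j) (λ D → ∑ (subsets j) (λ Z → ind (eqB D Z) * f (false ∷ D)) + ∑ (subsets j) (λ Z → ind (eqB D Z) * f (true ∷ D)))
      ≡⟨ ∑-+ (subsets j) _ _ ⟩
    _ ≡⟨ cong₂ _+_ (∑∑-eqB j (λ D → f (false ∷ D))) (∑∑-eqB j (λ D → f (true ∷ D))) ⟩
    ∑ (subsets j) (λ D → f (false ∷ D)) + ∑ (subsets j) (λ D → f (true ∷ D)) ≡⟨ sym (∑-+ (subsets j) _ _) ⟩
    ∑ (subsets j) (λ D → f (false ∷ D) + f (true ∷ D)) ≡⟨ sym (∑-subsets-suc j f) ⟩
    ∑ (subsets (suc j)) f ∎

module Shape where

  open import Defs
  open BoolLemmas
  open Lists
  open Sums
  open import Data.Bool using (Bool; true; false; _∧_; T)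
  open import Data.Unit using (tt)
  open import Data.Empty using (⊥-elim)
  open import Data.Nat using (ℕ; zero; suc; _+_; _*_; _≤_; _<_; z≤n; s≤s)
  open import Data.Nat.Properties
  open import Data.List using (List; []; _∷_; length; replicate)
  open import Data.Bool.ListAction using (and)
  open import Data.Product using (_×_; _,_; ∃)
  open import Data.Sum using (_⊎_; inj₁; inj₂)
  open import Relation.Binary.PropositionalEquality using (_≡_; refl; sym; trans; cong; cong₂; subst; module ≡-Reasoning)
  open import Relation.Nullary using (¬_)
  open import Data.Nat.Tactic.RingSolver
  open ≡-Reasoning

  -- B and Y are the vertex and edge bits of the path between v_k and w (inner vertices, then all edges).
  -- splitPath B Y: they form a segment starting at v_k and a segment ending at w, with an edge missing
  -- between them; splitAtStart is the case where already the first edge is missing.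
  splitAtStart : List Bool → List Bool → Bool
  splitAtStart B [] = false
  splitAtStart B (true ∷ Y) = false
  splitAtStart [] (false ∷ Y) = and Y
  splitAtStart (true ∷ B) (false ∷ Y) = and B ∧ and Y
  splitAtStart (false ∷ B) (false ∷ Y) = splitAtStart B Y

  splitPath : List Bool → List Bool → Bool
  splitPath B [] = false
  splitPath B (false ∷ Y) = splitAtStart B (false ∷ Y)
  splitPath [] (true ∷ Y) = false
  splitPath (b ∷ B) (true ∷ Y) = b ∧ splitPath B Y

  ∑splitAtStart : ℕ → (List Bool → ℕ) → ℕ
  ∑splitAtStart m1 f = ∑ (subsets m1) (λ B → ∑ (subsets (suc m1)) (λ Y → ind (splitAtStart B Y) * f B))

  ∑splitPath : ℕ → (List Bool → ℕ) → ℕ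
  ∑splitPath m1 f = ∑ (subsets m1) (λ B → ∑ (subsets (suc m1)) (λ Y → ind (splitPath B Y) * f B))

  ∑splitAtStart-0 : ∀ f → ∑splitAtStart 0 f ≡ f []
  ∑splitAtStart-0 f = trans (+-identityʳ _) (trans (+-identityʳ _) (*-identityˡ (f [])))

  ∑splitAtStart-suc : ∀ m1 f → ∑splitAtStart (suc m1) f ≡ ∑splitAtStart m1 (λ B → f (false ∷ B)) + f (true ∷ replicate m1 true)
  ∑splitAtStart-suc m1 f = begin
    ∑splitAtStart (suc m1) f ≡⟨ ∑-cong (subsets (suc m1)) (λ B → trans (∑-subsets-suc (suc m1) _) (∑-cong (subsets (suc m1)) (λ Y → +-identityʳ _))) ⟩
    ∑ (subsets (suc m1)) (λ B → ∑ (subsets (suc m1)) (λ Y → ind (splitAtStart B (false ∷ Y)) * f B)) ≡⟨ ∑-subsets-suc m1 _ ⟩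
    ∑ (subsets m1) (λ B → ∑ (subsets (suc m1)) (λ Y → ind (splitAtStart B Y) * f (false ∷ B)) + ∑ (subsets (suc m1)) (λ Y → ind (and B ∧ and Y) * f (true ∷ B)))
      ≡⟨ ∑-+ (subsets m1) _ _ ⟩
    ∑splitAtStart m1 (λ B → f (false ∷ B)) + ∑ (subsets m1) (λ B → ∑ (subsets (suc m1)) (λ Y → ind (and B ∧ and Y) * f (true ∷ B)))
      ≡⟨ cong (∑splitAtStart m1 (λ B → f (false ∷ B)) +_) lem ⟩
    ∑splitAtStart m1 (λ B → f (false ∷ B)) + f (true ∷ replicate m1 true) ∎
    where
    lem : ∑ (subsets m1) (λ B → ∑ (subsets (suc m1)) (λ Y → ind (and B ∧ and Y) * f (true ∷ B))) ≡ f (true ∷ replicate m1 true)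
    lem = begin
      ∑ (subsets m1) (λ B → ∑ (subsets (suc m1)) (λ Y → ind (and B ∧ and Y) * f (true ∷ B)))
        ≡⟨ ∑-cong (subsets m1) (λ B → trans (∑-cong (subsets (suc m1)) (λ Y →
             trans (cong (_* f (true ∷ B)) (ind-∧ (and B) (and Y))) (trans (*-assoc (ind (and B)) _ _) (cong (ind (and B) *_) (*-comm (ind (and Y)) _)))))
             (∑-*ˡ (subsets (suc m1)) (ind (and B)) _)) ⟩
      ∑ (subsets m1) (λ B → ind (and B) * ∑ (subsets (suc m1)) (λ Y → f (true ∷ B) * ind (and Y)))
        ≡⟨ ∑-cong (subsets m1) (λ B → cong (ind (and B) *_) (trans (∑-*ˡ (subsets (suc m1)) (f (true ∷ B)) _) (trans (cong (f (true ∷ B) *_) (∑-and-1 (suc m1))) (*-identityʳ _)))) ⟩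
      ∑ (subsets m1) (λ B → ind (and B) * f (true ∷ B)) ≡⟨ ∑-and m1 (λ B → f (true ∷ B)) ⟩
      f (true ∷ replicate m1 true) ∎

  ∑splitPath-0 : ∀ f → ∑splitPath 0 f ≡ f []
  ∑splitPath-0 f = trans (+-identityʳ _) (trans (+-identityʳ _) (*-identityˡ (f [])))

  ∑splitPath-suc : ∀ m1 f → ∑splitPath (suc m1) f ≡ ∑splitAtStart (suc m1) f + ∑splitPath m1 (λ B → f (true ∷ B))
  ∑splitPath-suc m1 f = begin
    ∑splitPath (suc m1) f ≡⟨ ∑-cong (subsets (suc m1)) (λ B → ∑-subsets-suc (suc m1) _) ⟩
    ∑ (subsets (suc m1)) (λ B → ∑ (subsets (suc m1)) (λ Y → ind (splitAtStart B (false ∷ Y)) * f B + ind (splitPath B (true ∷ Y)) * f B))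
      ≡⟨ ∑-cong (subsets (suc m1)) (λ B → ∑-+ (subsets (suc m1)) _ _) ⟩
    ∑ (subsets (suc m1)) (λ B → ∑ (subsets (suc m1)) (λ Y → ind (splitAtStart B (false ∷ Y)) * f B) + ∑ (subsets (suc m1)) (λ Y → ind (splitPath B (true ∷ Y)) * f B))
      ≡⟨ ∑-+ (subsets (suc m1)) _ _ ⟩
    ∑ (subsets (suc m1)) (λ B → ∑ (subsets (suc m1)) (λ Y → ind (splitAtStart B (false ∷ Y)) * f B)) + ∑ (subsets (suc m1)) (λ B → ∑ (subsets (suc m1)) (λ Y → ind (splitPath B (true ∷ Y)) * f B))
      ≡⟨ cong₂ _+_ (sym (∑-cong (subsets (suc m1)) (λ B → trans (∑-subsets-suc (suc m1) _) (∑-cong (subsets (suc m1)) (λ Y → +-identityʳ _)))))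
                    (trans (∑-subsets-suc m1 _) (∑-cong (subsets m1) (λ B → cong (_+ ∑ (subsets (suc m1)) (λ Y → ind (splitPath B Y) * f (true ∷ B))) (∑-zero (subsets (suc m1)) (λ Y → ind (splitPath (false ∷ B) (true ∷ Y)) * f (false ∷ B)) (λ _ _ → refl))))) ⟩
    ∑splitAtStart (suc m1) f + ∑splitPath m1 (λ B → f (true ∷ B)) ∎

  ∑splitPath-+ : ∀ m1 f g → ∑splitPath m1 (λ B → f B + g B) ≡ ∑splitPath m1 f + ∑splitPath m1 g
  ∑splitPath-+ m1 f g = trans (∑-cong (subsets m1) (λ B → trans (∑-cong (subsets (suc m1)) (λ Y → *-distribˡ-+ (ind (splitPath B Y)) (f B) (g B))) (∑-+ (subsets (suc m1)) _ _))) (∑-+ (subsets m1) _ _)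

  ∑splitAtStart-1 : ∀ m1 → ∑splitAtStart m1 (λ _ → 1) ≡ suc m1
  ∑splitAtStart-1 zero = ∑splitAtStart-0 (λ _ → 1)
  ∑splitAtStart-1 (suc m1) = trans (∑splitAtStart-suc m1 _) (trans (cong (_+ 1) (∑splitAtStart-1 m1)) (+-comm (suc m1) 1))

  ∑splitAtStart-countTrue : ∀ m1 → 2 * ∑splitAtStart m1 countTrue ≡ m1 * suc m1
  ∑splitAtStart-countTrue zero = cong (2 *_) (∑splitAtStart-0 countTrue)
  ∑splitAtStart-countTrue (suc m1) = begin
    2 * ∑splitAtStart (suc m1) countTrue ≡⟨ cong (2 *_) (∑splitAtStart-suc m1 countTrue) ⟩
    2 * (∑splitAtStart m1 countTrue + suc (countTrue (replicate m1 true))) ≡⟨ cong (λ z → 2 * (∑splitAtStart m1 countTrue + suc z)) (countTrue-replicate-true m1) ⟩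
    2 * (∑splitAtStart m1 countTrue + suc m1) ≡⟨ *-distribˡ-+ 2 (∑splitAtStart m1 countTrue) (suc m1) ⟩
    2 * ∑splitAtStart m1 countTrue + 2 * suc m1 ≡⟨ cong (_+ 2 * suc m1) (∑splitAtStart-countTrue m1) ⟩
    m1 * suc m1 + 2 * suc m1 ≡⟨ poly m1 ⟩
    suc m1 * suc (suc m1) ∎
    where
    poly : ∀ m → m * suc m + 2 * suc m ≡ suc m * suc (suc m)
    poly = solve-∀

  ∑splitPath-1 : ∀ m1 → 2 * ∑splitPath m1 (λ _ → 1) ≡ suc m1 * suc (suc m1)
  ∑splitPath-1 zero = cong (2 *_) (∑splitPath-0 (λ _ → 1))
  ∑splitPath-1 (suc m1) = begin
    2 * ∑splitPath (suc m1) (λ _ → 1) ≡⟨ cong (2 *_) (∑splitPath-suc m1 (λ _ → 1)) ⟩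
    2 * (∑splitAtStart (suc m1) (λ _ → 1) + ∑splitPath m1 (λ _ → 1)) ≡⟨ *-distribˡ-+ 2 (∑splitAtStart (suc m1) (λ _ → 1)) (∑splitPath m1 (λ _ → 1)) ⟩
    2 * ∑splitAtStart (suc m1) (λ _ → 1) + 2 * ∑splitPath m1 (λ _ → 1) ≡⟨ cong₂ (λ a b → 2 * a + b) (∑splitAtStart-1 (suc m1)) (∑splitPath-1 m1) ⟩
    2 * (2 + m1) + suc m1 * (2 + m1) ≡⟨ poly m1 ⟩
    suc (suc m1) * suc (suc (suc m1)) ∎
    where
    poly : ∀ m → 2 * (2 + m) + suc m * (2 + m) ≡ (2 + m) * (3 + m)
    poly = solve-∀

  ∑splitPath-countTrue : ∀ m1 → 3 * ∑splitPath m1 countTrue ≡ m1 * suc m1 * suc (suc m1)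
  ∑splitPath-countTrue zero = cong (3 *_) (∑splitPath-0 countTrue)
  ∑splitPath-countTrue (suc m1) = *-cancelˡ-≡ _ _ 2 (begin
    2 * (3 * ∑splitPath (suc m1) countTrue) ≡⟨ cong (λ z → 2 * (3 * z)) (trans (∑splitPath-suc m1 countTrue) (cong (∑splitAtStart (suc m1) countTrue +_) (∑splitPath-+ m1 (λ _ → 1) countTrue))) ⟩
    2 * (3 * (∑splitAtStart (suc m1) countTrue + (∑splitPath m1 (λ _ → 1) + ∑splitPath m1 countTrue))) ≡⟨ distribute (∑splitAtStart (suc m1) countTrue) (∑splitPath m1 (λ _ → 1)) (∑splitPath m1 countTrue) ⟩
    3 * (2 * ∑splitAtStart (suc m1) countTrue) + 3 * (2 * ∑splitPath m1 (λ _ → 1)) + 2 * (3 * ∑splitPath m1 countTrue)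
      ≡⟨ cong₂ _+_ (cong₂ (λ a b → 3 * a + 3 * b) (∑splitAtStart-countTrue (suc m1)) (∑splitPath-1 m1)) (cong (2 *_) (∑splitPath-countTrue m1)) ⟩
    3 * ((1 + m1) * (2 + m1)) + 3 * ((1 + m1) * (2 + m1)) + 2 * (m1 * (1 + m1) * (2 + m1)) ≡⟨ poly m1 ⟩
    2 * ((1 + m1) * (2 + m1) * (3 + m1)) ∎)
    where
    distribute : ∀ a b c → 2 * (3 * (a + (b + c))) ≡ 3 * (2 * a) + 3 * (2 * b) + 2 * (3 * c)
    distribute = solve-∀
    poly : ∀ m → 3 * ((1 + m) * (2 + m)) + 3 * ((1 + m) * (2 + m)) + 2 * (m * (1 + m) * (2 + m)) ≡ 2 * ((1 + m) * (2 + m) * (3 + m))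
    poly = solve-∀

  LeftEndsIn RightEndsIn ReachesAnEnd ReachesRightEnd : List Bool → List Bool → Set
  LeftEndsIn B Y = ∀ d → T (memb Y (suc d)) → T (memb B d)
  RightEndsIn B Y = ∀ d → T (memb Y d) → suc d < length Y → T (memb B d)
  ReachesAnEnd B Y = ∀ d → T (memb B d) → (∀ d' → d' ≤ d → T (memb Y d')) ⊎ (∀ d' → d < d' → d' < length Y → T (memb Y d'))
  ReachesRightEnd B Y = ∀ d → T (memb B d) → ∀ d' → d < d' → d' < length Y → T (memb Y d')

  SomeAbsent : List Bool → Set
  SomeAbsent Y = ∃ λ d → d < length Y × ¬ T (memb Y d)

  and⇒memb : ∀ xs → T (and xs) → ∀ i → i < length xs → T (memb xs i)
  and⇒memb (true ∷ xs) q zero lt = tt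
  and⇒memb (true ∷ xs) q (suc i) (s≤s lt) = and⇒memb xs q i lt

  memb⇒and : ∀ xs → (∀ i → i < length xs → T (memb xs i)) → T (and xs)
  memb⇒and [] h = tt
  memb⇒and (true ∷ xs) h = memb⇒and xs (λ i lt → h (suc i) (s≤s lt))
  memb⇒and (false ∷ xs) h = h 0 (s≤s z≤n)

  and⇒countTrue : ∀ xs → T (and xs) → countTrue xs ≡ length xs
  and⇒countTrue [] q = refl
  and⇒countTrue (true ∷ xs) q = cong suc (and⇒countTrue xs q)

  splitAtStart⇒ : ∀ B Y → length Y ≡ suc (length B) → T (splitAtStart B Y) → (memb Y 0 ≡ false) × LeftEndsIn B Y × RightEndsIn B Y × ReachesRightEnd B Y
  splitAtStart⇒ [] (false ∷ []) eq q = refl , (λ d ()) , (λ { zero () _ ; (suc d) () _ }) , (λ d ())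
  splitAtStart⇒ (true ∷ B) (false ∷ Y) eq q = refl , e1 , e2 , cs
    where
    qB = ∧-elimˡ (and B) q
    qY = ∧-elimʳ (and B) q
    e1 : LeftEndsIn (true ∷ B) (false ∷ Y)
    e1 zero m = tt
    e1 (suc d) m = and⇒memb B qB d (≤-pred (≤-trans (memb⇒<length Y (suc d) m) (≤-reflexive (suc-injective eq))))
    e2 : RightEndsIn (true ∷ B) (false ∷ Y)
    e2 zero () lt
    e2 (suc d) m lt = e1 (suc d) (and⇒memb Y qY (suc d) (≤-pred lt))
    cs : ReachesRightEnd (true ∷ B) (false ∷ Y)
    cs d _ (suc d') lt lt2 = and⇒memb Y qY d' (≤-pred lt2)
  splitAtStart⇒ (false ∷ B) (false ∷ Y) eq q with splitAtStart⇒ B Y (suc-injective eq) q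
  ... | y0 , e1' , e2' , cs' = refl , e1 , e2 , cs
    where
    e1 : LeftEndsIn (false ∷ B) (false ∷ Y)
    e1 zero m rewrite y0 = m
    e1 (suc d) m = e1' d m
    e2 : RightEndsIn (false ∷ B) (false ∷ Y)
    e2 zero () lt
    e2 (suc d) m lt = e2' d m (≤-pred lt)
    cs : ReachesRightEnd (false ∷ B) (false ∷ Y)
    cs zero () d' lt lt2
    cs (suc d) m (suc d') lt lt2 = cs' d m d' (≤-pred lt) (≤-pred lt2)

  splitPath⇒ : ∀ B Y → length Y ≡ suc (length B) → T (splitPath B Y) → LeftEndsIn B Y × RightEndsIn B Y × ReachesAnEnd B Y × SomeAbsent Y
  splitPath⇒ B (false ∷ Y) eq q with splitAtStart⇒ B (false ∷ Y) eq q
  ... | _ , e1 , e2 , cs = e1 , e2 , (λ d m → inj₂ (cs d m)) , (0 , s≤s z≤n , λ ())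
  splitPath⇒ (true ∷ B) (true ∷ Y) eq q with splitPath⇒ B Y (suc-injective eq) q
  ... | e1' , e2' , cc' , (d0 , lt0 , nd0) = e1 , e2 , cc , (suc d0 , s≤s lt0 , nd0)
    where
    e1 : LeftEndsIn (true ∷ B) (true ∷ Y)
    e1 zero m = tt
    e1 (suc d) m = e1' d m
    e2 : RightEndsIn (true ∷ B) (true ∷ Y)
    e2 zero m lt = tt
    e2 (suc d) m lt = e2' d m (≤-pred lt)
    cc : ReachesAnEnd (true ∷ B) (true ∷ Y)
    cc zero m = inj₁ (λ { zero _ → tt })
    cc (suc d) m with cc' d m
    ... | inj₁ h = inj₁ (λ { zero _ → tt ; (suc d') le → h d' (≤-pred le) })
    ... | inj₂ h = inj₂ (λ { (suc d') lt lt2 → h d' (≤-pred lt) (≤-pred lt2) })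

  splitAtStart⇐ : ∀ B Y → length Y ≡ length B → LeftEndsIn B (false ∷ Y) → RightEndsIn B (false ∷ Y) → ReachesRightEnd B (false ∷ Y) → T (splitAtStart B (false ∷ Y))
  splitAtStart⇐ [] [] eq e1 e2 cs = tt
  splitAtStart⇐ (true ∷ B) Y eq e1 e2 cs = ∧-intro qB qY
    where
    hY : ∀ i → i < length Y → T (memb Y i)
    hY i lt = cs 0 tt (suc i) (s≤s z≤n) (s≤s lt)
    qY = memb⇒and Y hY
    qB = memb⇒and B (λ i lt → e1 (suc i) (hY (suc i) (≤-trans (s≤s lt) (≤-reflexive (sym eq)))))
  splitAtStart⇐ (false ∷ B) (true ∷ Y) eq e1 e2 cs = ⊥-elim (e1 0 tt)
  splitAtStart⇐ (false ∷ B) (false ∷ Y) eq e1 e2 cs =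
    splitAtStart⇐ B Y (suc-injective eq) (λ d m → e1 (suc d) m) (λ d m lt → e2 (suc d) m (s≤s lt))
      (λ d m d' lt lt2 → cs (suc d) m (suc d') (s≤s lt) (s≤s lt2))

  splitPath⇐ : ∀ B Y → length Y ≡ suc (length B) → LeftEndsIn B Y → RightEndsIn B Y → ReachesAnEnd B Y → SomeAbsent Y → T (splitPath B Y)
  splitPath⇐ B (false ∷ Y) eq e1 e2 cc nn = splitAtStart⇐ B Y (suc-injective eq) e1 e2 cs
    where
    cs : ReachesRightEnd B (false ∷ Y)
    cs d m with cc d m
    ... | inj₁ h = ⊥-elim (h 0 z≤n)
    ... | inj₂ h = h
  splitPath⇐ [] (true ∷ []) eq e1 e2 cc (zero , lt , nd) = nd tt
  splitPath⇐ [] (true ∷ []) eq e1 e2 cc (suc d , s≤s () , nd)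
  splitPath⇐ (b ∷ B) (true ∷ Y) eq e1 e2 cc nn with e2 0 tt (s≤s (subst (1 ≤_) (sym (suc-injective eq)) (s≤s z≤n)))
  splitPath⇐ (false ∷ B) (true ∷ Y) eq e1 e2 cc nn | ()
  splitPath⇐ (true ∷ B) (true ∷ Y) eq e1 e2 cc (d0 , lt0 , nd0) | _ =
    splitPath⇐ B Y (suc-injective eq) (λ d m → e1 (suc d) m) (λ d m lt → e2 (suc d) m (s≤s lt)) cc' nn'
    where
    cc' : ReachesAnEnd B Y
    cc' d m with cc (suc d) m
    ... | inj₁ h = inj₁ (λ d' le → h (suc d') (s≤s le))
    ... | inj₂ h = inj₂ (λ d' lt lt2 → h (suc d') (s≤s lt) (s≤s lt2))
    nn' : SomeAbsent Y
    nn' = go d0 lt0 nd0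
      where
      go : ∀ d → d < length (true ∷ Y) → ¬ T (memb (true ∷ Y) d) → SomeAbsent Y
      go zero _ nd = ⊥-elim (nd tt)
      go (suc d) lt nd = d , ≤-pred lt , nd

  splitAtStart-countTrue : ∀ B Y → length Y ≡ suc (length B) → T (splitAtStart B Y) → countTrue B ≡ countTrue Y
  splitAtStart-countTrue [] (false ∷ []) eq q = refl
  splitAtStart-countTrue (true ∷ B) (false ∷ Y) eq q =
    trans (cong suc (and⇒countTrue B (∧-elimˡ (and B) q)))
          (trans (sym (suc-injective eq)) (sym (and⇒countTrue Y (∧-elimʳ (and B) q))))
  splitAtStart-countTrue (false ∷ B) (false ∷ Y) eq q = splitAtStart-countTrue B Y (suc-injective eq) q

  splitPath-countTrue : ∀ B Y → length Y ≡ suc (length B) → T (splitPath B Y) → countTrue B ≡ countTrue Y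
  splitPath-countTrue B (false ∷ Y) eq q = splitAtStart-countTrue B (false ∷ Y) eq q
  splitPath-countTrue (true ∷ B) (true ∷ Y) eq q = cong suc (splitPath-countTrue B Y (suc-injective eq) q)

  open import Data.List using (take)
  open import Data.Bool.Properties using (∧-identityʳ; ∧-assoc)

  and-take-suc : ∀ Y d → d < length Y → and (take (suc d) Y) ≡ and (take d Y) ∧ memb Y d
  and-take-suc (y ∷ Y) zero lt = ∧-identityʳ y
  and-take-suc (y ∷ Y) (suc d) (s≤s lt) = trans (cong (y ∧_) (and-take-suc Y d lt)) (sym (∧-assoc y _ _))

  and-take⇒memb : ∀ Y j → T (and (take j Y)) → ∀ i → i < j → i < length Y → T (memb Y i)
  and-take⇒memb (y ∷ Y) (suc j) q zero lt lt2 = ∧-elimˡ y q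
  and-take⇒memb (y ∷ Y) (suc j) q (suc i) (s≤s lt) (s≤s lt2) = and-take⇒memb Y j (∧-elimʳ y q) i lt lt2

  splitAtStart-empty : ∀ j → T (splitAtStart (replicate j false) (false ∷ replicate j false))
  splitAtStart-empty zero = tt
  splitAtStart-empty (suc j) = splitAtStart-empty j

module Rationals where

  open import Defs
  open import Data.Nat using (ℕ; zero; suc; pred; _+_; _*_; z≤n)
  import Data.Nat as ℕ
  import Data.Nat.Properties as ℕP
  open import Data.Nat.Tactic.RingSolver using (solve-∀)
  open import Data.Integer as ℤ using (+_)
  import Data.Integer.Properties as ℤP
  open import Data.Rational as ℚ using (ℚ; 0ℚ; _-_; -_; ∣_∣; _≤_; _<_; toℚᵘ)
  import Data.Rational.Properties as ℚP
  open import Data.Rational.Unnormalised as U using (mkℚᵘ)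
  import Data.Rational.Unnormalised.Properties as UP
  open import Data.Rational.Solver using (module +-*-Solver)
  open import Data.Sum using (inj₁; inj₂)
  open import Relation.Binary.PropositionalEquality using (_≡_; refl; sym; trans; cong; cong₂; subst; subst₂)
  open +-*-Solver using (solve; _:+_; _:-_; :-_; _:=_)

  ⅔ ¼ : ℚ
  ⅔ = ratio 2 3
  ¼ = ratio 1 4

  private
    toℚᵘ-ratio : ∀ a b → toℚᵘ (ratio a (suc b)) U.≃ mkℚᵘ (+ a) b
    toℚᵘ-ratio a b = ℚP.toℚᵘ-fromℚᵘ (mkℚᵘ (+ a) b)

  ratio-≤ : ∀ a b c d → a * suc d ℕ.≤ c * suc b → ratio a (suc b) ≤ ratio c (suc d)
  ratio-≤ a b c d h = ℚP.toℚᵘ-cancel-≤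
    (UP.≤-respˡ-≃ (UP.≃-sym (toℚᵘ-ratio a b)) (UP.≤-respʳ-≃ (UP.≃-sym (toℚᵘ-ratio c d)) (U.*≤* cross)))
    where
    cross : + a ℤ.* + suc d ℤ.≤ + c ℤ.* + suc b
    cross = subst₂ ℤ._≤_ (ℤP.pos-* a (suc d)) (ℤP.pos-* c (suc b)) (ℤ.+≤+ h)

  ratio-< : ∀ a b c d → a * suc d ℕ.< c * suc b → ratio a (suc b) < ratio c (suc d)
  ratio-< a b c d h = ℚP.toℚᵘ-cancel-<
    (UP.<-respˡ-≃ (UP.≃-sym (toℚᵘ-ratio a b)) (UP.<-respʳ-≃ (UP.≃-sym (toℚᵘ-ratio c d)) (U.*<* cross)))
    where
    cross : + a ℤ.* + suc d ℤ.< + c ℤ.* + suc b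
    cross = subst₂ ℤ._<_ (ℤP.pos-* a (suc d)) (ℤP.pos-* c (suc b)) (ℤ.+<+ h)

  ratio-<⁻ : ∀ a b c d → ratio a (suc b) < ratio c (suc d) → a * suc d ℕ.< c * suc b
  ratio-<⁻ a b c d h with UP.<-respˡ-≃ (toℚᵘ-ratio a b) (UP.<-respʳ-≃ (toℚᵘ-ratio c d) (ℚP.toℚᵘ-mono-< h))
  ... | U.*<* cross = ℤP.drop‿+<+ (subst₂ ℤ._<_ (sym (ℤP.pos-* a (suc d))) (sym (ℤP.pos-* c (suc b))) cross)

  ratio-+ : ∀ a b c d → ratio a (suc b) ℚ.+ ratio c (suc d) ≡ ratio (a * suc d + c * suc b) (suc b * suc d)
  ratio-+ a b c d = ℚP.toℚᵘ-injective (UP.≃-trans (ℚP.toℚᵘ-homo-+ (ratio a (suc b)) (ratio c (suc d)))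
    (UP.≃-trans (UP.+-cong (toℚᵘ-ratio a b) (toℚᵘ-ratio c d)) (UP.≃-trans (UP.≃-reflexive sum-num) (UP.≃-sym (toℚᵘ-ratio _ _)))))
    where
    sum-num : mkℚᵘ (+ a) b U.+ mkℚᵘ (+ c) d ≡ mkℚᵘ (+ (a * suc d + c * suc b)) (pred (suc b * suc d))
    sum-num = cong (λ z → mkℚᵘ z (pred (suc b * suc d)))
      (trans (cong₂ ℤ._+_ (sym (ℤP.pos-* a (suc d))) (sym (ℤP.pos-* c (suc b)))) (sym (ℤP.pos-+ (a * suc d) (c * suc b))))

  0≤ratio : ∀ a b → 0ℚ ≤ ratio a b
  0≤ratio a zero    = ℚP.≤-refl
  0≤ratio a (suc b) = ratio-≤ 0 0 a b z≤n

  ratio-+-≤ : ∀ a b n → ratio (a + b) n ≤ ratio a n ℚ.+ ratio b n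
  ratio-+-≤ a b zero    = ℚP.≤-refl
  ratio-+-≤ a b (suc n) = subst (ratio (a + b) (suc n) ≤_) (sym (ratio-+ a n b n))
    (ratio-≤ (a + b) n (a * suc n + b * suc n) (n + n * suc n) (ℕP.≤-reflexive (distrib a b (suc n))))
    where
    distrib : ∀ a b n → (a + b) * (n * n) ≡ (a * n + b * n) * n
    distrib = solve-∀

  ratio<¼⇒ : ∀ a n → ratio a (suc n) < ¼ → a * 4 ℕ.< suc n
  ratio<¼⇒ a n h = subst (a * 4 ℕ.<_) (ℕP.*-identityˡ (suc n)) (ratio-<⁻ a n 1 3 h)

  ∣p-q∣≤r : ∀ {p q r} → p ≤ q ℚ.+ r → q ≤ p ℚ.+ r → ∣ p - q ∣ ≤ r
  ∣p-q∣≤r {p} {q} {r} p≤q+r q≤p+r with ℚP.∣p∣≡p∨∣p∣≡-p (p - q)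
  ... | inj₁ eq = subst₂ _≤_ (sym eq) (solve 2 (λ q r → (q :+ r) :- q := r) refl q r) (ℚP.+-monoˡ-≤ (- q) p≤q+r)
  ... | inj₂ eq = subst₂ _≤_ (trans (solve 2 (λ p q → q :- p := :- (p :- q)) refl p q) (sym eq))
                    (solve 2 (λ p r → (p :+ r) :- p := r) refl p r) (ℚP.+-monoˡ-≤ (- p) q≤p+r)

  ∣ratio-⅔∣≤ : ∀ {W C n e} → 1 ℕ.≤ C → 1 ℕ.≤ n →
    3 * W ℕ.≤ (2 * n + 3 * e) * C → 2 * n * C ℕ.≤ 3 * W + 3 * e * C → ∣ ratio W (C * n) - ⅔ ∣ ≤ ratio e n
  ∣ratio-⅔∣≤ {W} {suc c} {suc n₀} {e} _ _ upper lower = ∣p-q∣≤r above below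
    where
    n = suc n₀
    C = suc c
    above : ratio W (C * n) ≤ ⅔ ℚ.+ ratio e n
    above = subst (ratio W (C * n) ≤_) (sym (ratio-+ 2 2 e n₀))
      (ratio-≤ W (n₀ + c * n) (2 * n + e * 3) (n₀ + 2 * n)
        (subst₂ ℕ._≤_ (sym (lhs W n)) (rhs n e C) (ℕP.*-monoˡ-≤ n upper)))
      where
      lhs : ∀ W n → W * (3 * n) ≡ 3 * W * n
      lhs = solve-∀
      rhs : ∀ n e C → (2 * n + 3 * e) * C * n ≡ (2 * n + e * 3) * (C * n)
      rhs = solve-∀
    below : ⅔ ≤ ratio W (C * n) ℚ.+ ratio e n
    below = subst (⅔ ≤_) (sym (ratio-+ W (n₀ + c * n) e n₀))
      (ratio-≤ 2 2 (W * n + e * (C * n)) (n₀ + (n₀ + c * n) * n)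
        (subst₂ ℕ._≤_ (sym (lhs n C)) (rhs W n e C) (ℕP.*-monoˡ-≤ n lower)))
      where
      lhs : ∀ n C → 2 * (C * n * n) ≡ 2 * n * C * n
      lhs = solve-∀
      rhs : ∀ W n e C → (3 * W + 3 * e * C) * n ≡ (W * n + e * (C * n)) * 3
      rhs = solve-∀

module Graph where

  open import Defs
  open BoolLemmas
  open Reachability
  open Lists
  open Sums using (∑)
  open Shape
  open import Data.Bool using (Bool; true; false; _∧_; _∨_; not; T; if_then_else_)
  open import Data.Bool.Properties using (T?; T-≡; ⇔→≡)
  open import Function using (_∘_)
  open import Function.Bundles using (Equivalence; mk⇔)
  open import Data.Unit using (tt)
  open import Data.Empty using (⊥; ⊥-elim)
  open import Data.Nat using (ℕ; zero; suc; _+_; _∸_; _≤_; _<_; _≡ᵇ_; _<ᵇ_; z≤n; s≤s)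
  open import Data.Nat.Properties
  open import Data.List using (List; []; _∷_; _++_; map; length; replicate; applyUpTo; upTo; filter)
  open import Data.List.Properties using (map-upTo; length-++; filter-all)
  open import Data.List.Membership.Propositional using (_∈_; lose; find)
  import Data.List.Relation.Unary.All as All
  open import Data.List.Relation.Unary.All.Properties using (all⁺; all⁻)
  open import Data.List.Relation.Unary.Any.Properties using (any⁺; any⁻)
  open import Data.List.Membership.Propositional.Properties using (∈-++⁻; ∈-++⁺ˡ; ∈-++⁺ʳ; ∈-upTo⁻; ∈-upTo⁺)
  open import Data.Bool.ListAction using (and; any; all)
  open import Data.Product using (_×_; _,_; proj₁; proj₂; ∃)
  open import Data.Sum using (_⊎_; inj₁; inj₂)
  open import Relation.Binary.PropositionalEquality using (_≡_; _≢_; refl; sym; trans; cong; cong₂; subst; subst₂; module ≡-Reasoning)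
  open import Relation.Nullary using (¬_; yes; no)
  open import Data.Nat.Tactic.RingSolver
  open import Relation.Binary.Definitions using (tri<; tri≈; tri>)

  applyUpTo-+ : ∀ {A : Set} (f : ℕ → A) a b → applyUpTo f (a + b) ≡ applyUpTo f a ++ applyUpTo (λ i → f (a + i)) b
  applyUpTo-+ f zero b = refl
  applyUpTo-+ f (suc a) b = cong (f 0 ∷_) (applyUpTo-+ (λ i → f (suc i)) a b)

  <ᵇ-false : ∀ {a b} → b ≤ a → (a <ᵇ b) ≡ false
  <ᵇ-false {a} {b} le with a <ᵇ b in eq
  ... | false = refl
  ... | true = ⊥-elim (<⇒≱ (<ᵇ⇒< a b (subst T (sym eq) tt)) le)

  <ᵇ-true : ∀ {a b} → a < b → (a <ᵇ b) ≡ true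
  <ᵇ-true {a} {b} lt with a <ᵇ b in eq
  ... | true = refl
  ... | false = ⊥-elim (subst T eq (<⇒<ᵇ lt))

  bool-ext : ∀ {a b : Bool} → (T a → T b) → (T b → T a) → a ≡ b
  bool-ext a⇒b b⇒a = ⇔→≡ {z = true} (mk⇔ (to T-≡ ∘ a⇒b ∘ from T-≡) (to T-≡ ∘ b⇒a ∘ from T-≡))
    where open Equivalence

  -- containsPstar and Gedges with the edge list and the path length abstracted, so that equations for
  -- these arguments can be substituted.
  containsPstarIn : ℕ → ℕ → ℕ → List Bool → List Edge → Bool
  containsPstarIn n s k S F =
    let L = pathLen n s in
    all (λ i → memb S i) (map (λ j → k ∸ 1 + j) (upTo (L ∸ (k ∸ 1))))
    ∧ all (λ i → any (λ e → (proj₁ e ≡ᵇ i) ∧ (proj₂ e ≡ᵇ suc i)) F)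
          (map (λ j → k ∸ 1 + j) (upTo (L ∸ 1 ∸ (k ∸ 1))))

  GedgesOfLength : ℕ → ℕ → ℕ → List Edge
  GedgesOfLength L s k =
       map (λ i → (i , suc i)) (upTo (L ∸ 1))
    ++ map (λ j → (0 , L + j)) (upTo s)
    ++ map (λ j → (L ∸ 1 , L + s + j)) (upTo s)
    ++ map (λ i → (i , L ∸ 1)) (filter (λ i → T? (suc i <ᵇ L ∸ 1)) (upTo k))

  if-∧ : ∀ {A : Set} b c (x y : A) → T c → (if b then x else y) ≡ (if b ∧ c then x else y)
  if-∧ true true x y _ = refl
  if-∧ false c x y _ = refl

  isSubtree⇒ : ∀ n E S Fb → T (isSubtree n E S Fb) →
    (1 ≤ countTrue S) × (∀ e → e ∈ selected E Fb → T (memb S (proj₁ e)) × T (memb S (proj₂ e)))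
    × (suc (length (selected E Fb)) ≡ countTrue S)
    × (∀ x → x < n → T (memb S x) → T (reach n (selected E Fb) (firstIn S) x))
  isSubtree⇒ n E S Fb q =
    <ᵇ⇒< 0 (countTrue S) (∧-elimˡ a0 q)
    , (λ e mem → let r = All.lookup (all⁺ p1 F (∧-elimˡ a1 q1)) mem in ∧-elimˡ (memb S (proj₁ e)) r , ∧-elimʳ (memb S (proj₁ e)) r)
    , ≡ᵇ⇒≡ _ _ (∧-elimˡ a2 q2)
    , (λ x lt mx → not∨-elim (memb S x) _ (All.lookup (all⁺ p3 (upTo n) q3) (∈-upTo⁺ lt)) mx)
    where
    F = selected E Fb
    p1 : Edge → Bool
    p1 e = memb S (proj₁ e) ∧ memb S (proj₂ e)
    p3 : ℕ → Bool
    p3 x = not (memb S x) ∨ reach n F (firstIn S) x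
    a0 = 0 <ᵇ countTrue S
    a1 = all p1 F
    a2 = suc (length F) ≡ᵇ countTrue S
    q1 = ∧-elimʳ a0 q
    q2 = ∧-elimʳ a1 q1
    q3 = ∧-elimʳ a2 q2

  isSubtree⇐ : ∀ n E S Fb →
    (1 ≤ countTrue S) → (∀ e → e ∈ selected E Fb → T (memb S (proj₁ e)) × T (memb S (proj₂ e)))
    → (suc (length (selected E Fb)) ≡ countTrue S)
    → (∀ x → x < n → T (memb S x) → T (reach n (selected E Fb) (firstIn S) x)) → T (isSubtree n E S Fb)
  isSubtree⇐ n E S Fb h0 h1 h2 h3 =
    ∧-intro (<⇒<ᵇ h0) (∧-intro (all⁻ _ (All.tabulate (λ {e} mem → ∧-intro (proj₁ (h1 e mem)) (proj₂ (h1 e mem)))))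
      (∧-intro (≡⇒≡ᵇ _ _ h2) (all⁻ _ (All.tabulate (λ {x} mem → imp x (∈-upTo⁻ mem))))))
    where
    imp : ∀ x → x < n → T (not (memb S x) ∨ reach n (selected E Fb) (firstIn S) x)
    imp x lt with memb S x in eq
    ... | false = tt
    ... | true = h3 x lt (subst T (sym eq) tt)

  inFamily⇒ : ∀ n s k S Fb → T (inFamily n s k S Fb) →
    T (memb S 0) × T (memb S (k ∸ 1)) × T (memb S (wV n s)) × ¬ T (containsPstar n s k S Fb)
  inFamily⇒ n s k S Fb q = ∧-elimˡ (memb S 0) q , ∧-elimˡ (memb S (k ∸ 1)) q1 , ∧-elimˡ (memb S (wV n s)) q2
    , λ c → not-T (containsPstar n s k S Fb) (∧-elimʳ (memb S (wV n s)) q2) c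
    where
    q1 = ∧-elimʳ (memb S 0) q
    q2 = ∧-elimʳ (memb S (k ∸ 1)) q1
    not-T : ∀ b → T (not b) → T b → ⊥
    not-T true () _
    not-T false _ ()

  inFamily⇐ : ∀ n s k S Fb →
    T (memb S 0) → T (memb S (k ∸ 1)) → T (memb S (wV n s)) → ¬ T (containsPstar n s k S Fb) → T (inFamily n s k S Fb)
  inFamily⇐ n s k S Fb a b c d = ∧-intro a (∧-intro b (∧-intro c (nt (containsPstar n s k S Fb) d)))
    where
    nt : ∀ b → ¬ T b → T (not b)
    nt true h = h tt
    nt false h = tt

  isMember : ℕ → ℕ → ℕ → List Bool → List Bool → Bool
  isMember n s k S Fb = isSubtree n (Gedges n s k) S Fb ∧ inFamily n s k S Fb

  firstIn-0 : ∀ xs ys → T (memb xs 0) → firstIn (xs ++ ys) ≡ 0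
  firstIn-0 (true ∷ xs) ys q = refl

  -- With 1 ≤ m1 the path is long enough that none of the k chords v_i w is a path edge.
  module Decomposition (k' m1 s : ℕ) (hm : 1 ≤ m1) where
    k m L w n : ℕ
    k = suc k'
    m = suc m1
    L = k + m
    w = k' + m
    n = L + s + s

    PLg PRg LAg LBg CHg : ℕ → Edge
    PLg i = (i , suc i)
    PRg d = (k' + d , suc (k' + d))
    LAg j = (0 , L + j)
    LBg j = (w , L + s + j)
    CHg i = (i , w)

    PL PR LA LB CH E' : List Edge
    PL = applyUpTo PLg k'
    PR = applyUpTo PRg m
    LA = applyUpTo LAg s
    LB = applyUpTo LBg s
    CH = applyUpTo CHg k
    E' = PL ++ (PR ++ (LA ++ (LB ++ CH)))

    pathLen-eq : pathLen n s ≡ L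
    pathLen-eq = begin
      (L + s + s) ∸ (s + (s + 0)) ≡⟨ cong (λ z → (L + s + s) ∸ (s + z)) (+-identityʳ s) ⟩
      (L + s + s) ∸ (s + s) ≡⟨ cong (_∸ (s + s)) (+-assoc L s s) ⟩
      (L + (s + s)) ∸ (s + s) ≡⟨ m+n∸n≡m L (s + s) ⟩
      L ∎
      where open ≡-Reasoning

    k<w : ∀ i → i < k → suc i < w
    k<w i (s≤s le) = ≤-trans (s≤s (s≤s le)) (subst (suc (suc k') ≤_) (sym (+-suc k' m1)) (s≤s (subst (_≤ k' + m1) (+-comm k' 1) (+-monoʳ-≤ k' hm))))

    E'-eq : Gedges n s k ≡ E'
    E'-eq = trans (cong (λ z → GedgesOfLength z s k) pathLen-eq) eq2
      where
      open ≡-Reasoning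
      eq2 : GedgesOfLength L s k ≡ E'
      eq2 = begin
        GedgesOfLength L s k ≡⟨ cong (λ z → map (λ i → (i , suc i)) (upTo w) ++ map (λ j → (0 , L + j)) (upTo s) ++ map (λ j → (w , L + s + j)) (upTo s) ++ map (λ i → (i , w)) z)
                       (filter-all (λ i → T? (suc i <ᵇ w)) (All.tabulate (λ {i} mem → <⇒<ᵇ (k<w i (∈-upTo⁻ mem))))) ⟩
        map PLg (upTo w) ++ map LAg (upTo s) ++ map LBg (upTo s) ++ map CHg (upTo k)
          ≡⟨ cong₂ _++_ (map-upTo PLg w) (cong₂ _++_ (map-upTo LAg s) (cong₂ _++_ (map-upTo LBg s) (map-upTo CHg k))) ⟩
        applyUpTo PLg (k' + m) ++ (LA ++ (LB ++ CH)) ≡⟨ cong (_++ (LA ++ (LB ++ CH))) (applyUpTo-+ PLg k' m) ⟩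
        (PL ++ PR) ++ (LA ++ (LB ++ CH)) ≡⟨ Data.List.Properties.++-assoc PL PR _ ⟩
        E' ∎

    idW : k + (m1 + 0) ≡ w
    idW = idW' k' m1
      where
      idW' : ∀ a b → suc a + (b + 0) ≡ a + suc b
      idW' = solve-∀

    idL : ∀ j → k + (m1 + suc j) ≡ L + j
    idL j = idL' k' m1 j
      where
      idL' : ∀ a b c → suc a + (b + suc c) ≡ suc a + suc b + c
      idL' = solve-∀

    idL2 : ∀ j → k + (m1 + suc (s + j)) ≡ L + s + j
    idL2 j = idL2' k' m1 s j
      where
      idL2' : ∀ a b c d → suc a + (b + suc (c + d)) ≡ suc a + suc b + c + d
      idL2' = solve-∀

    k≡ : ∀ d → k' + suc d ≡ k + d
    k≡ d = +-suc k' d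

    data Region : ℕ → Set where
      rA : ∀ i → i < k → Region i
      rB : ∀ d → d < m1 → Region (k + d)
      rW : Region w
      rD1 : ∀ j → j < s → Region (L + j)
      rD2 : ∀ j → j < s → Region (L + s + j)

    region : ∀ x → x < n → Region x
    region x lt with x <? k
    ... | yes p = rA x p
    ... | no p with m≤n⇒∃[o]m+o≡n (≮⇒≥ p)
    ... | d , refl with d <? m1
    ... | yes q = rB d q
    ... | no q with m≤n⇒∃[o]m+o≡n (≮⇒≥ q)
    ... | zero , refl = subst Region (sym idW) rW
    ... | suc e , refl with e <? s
    ... | yes r = subst Region (sym (idL e)) (rD1 e r)
    ... | no r with m≤n⇒∃[o]m+o≡n (≮⇒≥ r)
    ... | f , refl = subst Region (sym (idL2 f)) (rD2 f (+-cancelˡ-< (L + s) f s (subst (_< n) (idL2 f) lt)))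

    memb-off : ∀ xs ys a j → length xs ≡ a → memb (xs ++ ys) (a + j) ≡ memb ys j
    memb-off xs ys a j refl = memb-++ʳ xs ys j

    -- Vertex bits: A for v₁ … v_k, B for v_{k+1} … v_{L-1}, C for w, D1 and D2 for the leaves at v₁ and w.
    -- Edge bits: X for the path edges inside v₁ … v_k, Y for those from v_k to w, Z1 and Z2 for the leaf
    -- edges, W for the chords.
    module Config (A B C D1 D2 X Y Z1 Z2 W : List Bool)
               (lA : length A ≡ k) (lB : length B ≡ m1) (lC : length C ≡ 1)
               (lD1 : length D1 ≡ s) (lD2 : length D2 ≡ s)
               (lX : length X ≡ k') (lY : length Y ≡ m) (lZ1 : length Z1 ≡ s) (lZ2 : length Z2 ≡ s)
               (lW : length W ≡ k) where

      S' Fb : List Bool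
      S' = A ++ (B ++ (C ++ (D1 ++ D2)))
      Fb = X ++ (Y ++ (Z1 ++ (Z2 ++ W)))

      F' Fl : List Edge
      F' = selected E' Fb
      Fl = selected PL X ++ selected CH W

      open import Data.List.Properties using (length-applyUpTo)
      F'-eq : F' ≡ selected PL X ++ (selected PR Y ++ (selected LA Z1 ++ (selected LB Z2 ++ selected CH W)))
      F'-eq = trans (selected-++ PL _ X _ (trans lX (sym (length-applyUpTo PLg k'))))
             (cong (selected PL X ++_) (trans (selected-++ PR _ Y _ (trans lY (sym (length-applyUpTo PRg m))))
             (cong (selected PR Y ++_) (trans (selected-++ LA _ Z1 _ (trans lZ1 (sym (length-applyUpTo LAg s))))
             (cong (selected LA Z1 ++_) (selected-++ LB _ Z2 _ (trans lZ2 (sym (length-applyUpTo LBg s)))))))))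

      mA : ∀ i → i < k → memb S' i ≡ memb A i
      mA i lt = memb-++ˡ A _ i (subst (i <_) (sym lA) lt)

      mB : ∀ d → d < m1 → memb S' (k + d) ≡ memb B d
      mB d lt = trans (memb-off A _ k d lA) (memb-++ˡ B _ d (subst (d <_) (sym lB) lt))

      mRest : ∀ j → memb S' (k + (m1 + j)) ≡ memb (C ++ (D1 ++ D2)) j
      mRest j = trans (memb-off A _ k (m1 + j) lA) (memb-off B _ m1 j lB)

      mW : memb S' w ≡ memb C 0
      mW = trans (cong (memb S') (sym idW)) (trans (mRest 0) (memb-++ˡ C _ 0 (subst (0 <_) (sym lC) (s≤s z≤n))))

      mD1 : ∀ j → j < s → memb S' (L + j) ≡ memb D1 j
      mD1 j lt = trans (cong (memb S') (sym (idL j))) (trans (mRest (suc j)) (trans (memb-off C _ 1 j lC) (memb-++ˡ D1 _ j (subst (j <_) (sym lD1) lt))))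

      mD2 : ∀ j → memb S' (L + s + j) ≡ memb D2 j
      mD2 j = trans (cong (memb S') (sym (idL2 j))) (trans (mRest (suc (s + j))) (trans (memb-off C _ 1 (s + j) lC) (memb-off D1 _ s j lD1)))

      data EdgeIn : Edge → Set where
        cPL : ∀ i → i < k' → T (memb X i) → EdgeIn (PLg i)
        cPR : ∀ d → d < m → T (memb Y d) → EdgeIn (PRg d)
        cLA : ∀ j → j < s → T (memb Z1 j) → EdgeIn (LAg j)
        cLB : ∀ j → j < s → T (memb Z2 j) → EdgeIn (LBg j)
        cCH : ∀ i → i < k → T (memb W i) → EdgeIn (CHg i)

      classify : ∀ e → e ∈ F' → EdgeIn e
      classify e mem with ∈-++⁻ (selected PL X) (subst (e ∈_) F'-eq mem)
      ... | inj₁ m1' with ∈-selected⁻ PLg k' X e m1'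
      ... | i , lt , q , refl = cPL i lt q
      classify e mem | inj₂ m2 with ∈-++⁻ (selected PR Y) m2
      ... | inj₁ m3 with ∈-selected⁻ PRg m Y e m3
      ... | i , lt , q , refl = cPR i lt q
      classify e mem | inj₂ m2 | inj₂ m4 with ∈-++⁻ (selected LA Z1) m4
      ... | inj₁ m5 with ∈-selected⁻ LAg s Z1 e m5
      ... | i , lt , q , refl = cLA i lt q
      classify e mem | inj₂ m2 | inj₂ m4 | inj₂ m6 with ∈-++⁻ (selected LB Z2) m6
      ... | inj₁ m7 with ∈-selected⁻ LBg s Z2 e m7
      ... | i , lt , q , refl = cLB i lt q
      classify e mem | inj₂ m2 | inj₂ m4 | inj₂ m6 | inj₂ m8 with ∈-selected⁻ CHg k W e m8
      ... | i , lt , q , refl = cCH i lt q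

      inF : ∀ {e} → EdgeIn e → e ∈ F'
      inF c = subst (_ ∈_) (sym F'-eq) (go c)
        where
        go : ∀ {e} → EdgeIn e → e ∈ (selected PL X ++ (selected PR Y ++ (selected LA Z1 ++ (selected LB Z2 ++ selected CH W))))
        go (cPL i lt q) = ∈-++⁺ˡ (∈-selected⁺ PLg k' X i lt q)
        go (cPR d lt q) = ∈-++⁺ʳ (selected PL X) (∈-++⁺ˡ (∈-selected⁺ PRg m Y d lt q))
        go (cLA j lt q) = ∈-++⁺ʳ (selected PL X) (∈-++⁺ʳ (selected PR Y) (∈-++⁺ˡ (∈-selected⁺ LAg s Z1 j lt q)))
        go (cLB j lt q) = ∈-++⁺ʳ (selected PL X) (∈-++⁺ʳ (selected PR Y) (∈-++⁺ʳ (selected LA Z1) (∈-++⁺ˡ (∈-selected⁺ LBg s Z2 j lt q))))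
        go (cCH i lt q) = ∈-++⁺ʳ (selected PL X) (∈-++⁺ʳ (selected PR Y) (∈-++⁺ʳ (selected LA Z1) (∈-++⁺ʳ (selected LB Z2) (∈-selected⁺ CHg k W i lt q))))

      classifyL : ∀ e → e ∈ Fl → EdgeIn e
      classifyL e mem with ∈-++⁻ (selected PL X) mem
      ... | inj₁ m1' with ∈-selected⁻ PLg k' X e m1'
      ... | i , lt , q , refl = cPL i lt q
      classifyL e mem | inj₂ m2 with ∈-selected⁻ CHg k W e m2
      ... | i , lt , q , refl = cCH i lt q

      inFl-PL : ∀ i → i < k' → T (memb X i) → PLg i ∈ Fl
      inFl-PL i lt q = ∈-++⁺ˡ (∈-selected⁺ PLg k' X i lt q)

      inFl-CH : ∀ i → i < k → T (memb W i) → CHg i ∈ Fl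
      inFl-CH i lt q = ∈-++⁺ʳ (selected PL X) (∈-selected⁺ CHg k W i lt q)

      Fl⊆F' : ∀ e → e ∈ Fl → e ∈ F'
      Fl⊆F' e mem = inF (classifyL e mem)

      open import Data.List.Properties using (length-++)
      lenF' : length F' ≡ countTrue X + (countTrue Y + (countTrue Z1 + (countTrue Z2 + countTrue W)))
      lenF' = trans (cong length F'-eq)
        (trans (length-++ (selected PL X)) (cong₂ _+_ (length-selected PL X (trans lX (sym (length-applyUpTo PLg k'))))
        (trans (length-++ (selected PR Y)) (cong₂ _+_ (length-selected PR Y (trans lY (sym (length-applyUpTo PRg m))))
        (trans (length-++ (selected LA Z1)) (cong₂ _+_ (length-selected LA Z1 (trans lZ1 (sym (length-applyUpTo LAg s))))
        (trans (length-++ (selected LB Z2)) (cong₂ _+_ (length-selected LB Z2 (trans lZ2 (sym (length-applyUpTo LBg s))))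
          (length-selected CH W (trans lW (sym (length-applyUpTo CHg k))))))))))))

      cntS' : countTrue S' ≡ countTrue A + (countTrue B + (countTrue C + (countTrue D1 + countTrue D2)))
      cntS' = trans (countTrue-++ A _) (cong (countTrue A +_) (trans (countTrue-++ B _) (cong (countTrue B +_)
        (trans (countTrue-++ C _) (cong (countTrue C +_) (countTrue-++ D1 D2))))))

      lenS' : length S' ≡ n
      lenS' = trans (length-++ A) (trans (cong₂ _+_ lA (trans (length-++ B) (cong₂ _+_ lB (trans (length-++ C) (cong₂ _+_ lC (trans (length-++ D1) (cong₂ _+_ lD1 lD2)))))))
        (trans (cong (k +_) (cong (m1 +_) (cong suc refl))) (idL2' k' m1 s)))
        where
        idL2' : ∀ a b c → suc a + (b + suc (c + c)) ≡ suc a + suc b + c + c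
        idL2' = solve-∀

      k≤w : k ≤ w
      k≤w = subst (k ≤_) (sym (+-suc k' m1)) (s≤s (m≤m+n k' m1))

      w<L : w < L
      w<L = ≤-refl

      L≤ : ∀ j → L ≤ L + j
      L≤ j = m≤m+n L j

      ≢L : ∀ {v} j → v < L → v ≢ L + j
      ≢L {v} j lt eq = <⇒≱ lt (subst (L ≤_) (sym eq) (L≤ j))

      endpoints : ∀ {e} → EdgeIn e → proj₁ e < n × proj₂ e < n
      endpoints c = go c
        where
        wn : w < n
        wn = ≤-trans (m≤m+n L s) (m≤m+n (L + s) s)
        kn : ∀ i → i < k → i < n
        kn i lt = ≤-trans lt (≤-trans k≤w (<⇒≤ wn))
        go : ∀ {e} → EdgeIn e → proj₁ e < n × proj₂ e < n
        go (cPL i lt q) = kn i (m<n⇒m<1+n lt) , kn (suc i) (s≤s lt)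
        go (cPR d lt q) = <-trans (+-monoʳ-< k' lt) wn , ≤-<-trans (+-monoʳ-< k' lt) wn
        go (cLA j lt q) = ≤-trans (s≤s z≤n) wn , ≤-trans (+-monoʳ-< L lt) (m≤m+n (L + s) s)
        go (cLB j lt q) = wn , +-monoʳ-< (L + s) lt
        go (cCH i lt q) = kn i lt , wn

      bndF' : EdgesBelow n F'
      bndF' e mem = endpoints (classify e mem)

      2≤L : 2 ≤ L
      2≤L = s≤s (≤-trans hm (subst (m1 ≤_) (sym (+-suc k' m1)) (≤-trans (m≤n+m m1 k') (n≤1+n _))))

      PR-id : ∀ {e} d → EdgeIn e → e ≡ PRg d → d < m → T (memb Y d)
      PR-id d (cPL i lt q) eq dm = ⊥-elim (<⇒≱ lt (subst (k' ≤_) (sym (cong proj₁ eq)) (m≤m+n k' d)))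
      PR-id d (cPR d' lt q) eq dm = subst (λ z → T (memb Y z)) (+-cancelˡ-≡ k' d' d (cong proj₁ eq)) q
      PR-id d (cLA j lt q) eq dm = ⊥-elim (<⇒≱ (s≤s (s≤s z≤n)) (≤-trans 2≤L (≤-trans (L≤ j) (≤-reflexive (trans (cong proj₂ eq) (cong suc (sym (cong proj₁ eq))))))))
      PR-id d (cLB j lt q) eq dm = ⊥-elim (<-irrefl (sym (+-cancelˡ-≡ k' m d (cong proj₁ eq))) dm)
      PR-id d (cCH i lt q) eq dm = ⊥-elim (<⇒≱ (subst (1 ≤_) m1≡d hm) (+-cancelˡ-≤ k' d 0 (subst (_≤ k' + 0) (cong proj₁ eq) (subst (i ≤_) (sym (+-identityʳ k')) (≤-pred lt)))))
        where
        m1≡d : m1 ≡ d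
        m1≡d = suc-injective (+-cancelˡ-≡ k' (suc m1) (suc d) (trans (cong proj₂ eq) (sym (+-suc k' d))))

      <L-k : ∀ v → v < k → v < L
      <L-k v lt = ≤-trans lt (≤-trans k≤w (n≤1+n w))

      isLow : ∀ {e} → EdgeIn e → (proj₁ e < L × proj₂ e < L) ⊎ ((∃ λ j → j < s × e ≡ LAg j × T (memb Z1 j)) ⊎ (∃ λ j → j < s × e ≡ LBg j × T (memb Z2 j)))
      isLow (cPL i lt q) = inj₁ (<L-k i (m<n⇒m<1+n lt) , <L-k (suc i) (s≤s lt))
      isLow (cPR d lt q) = inj₁ (<-trans (+-monoʳ-< k' lt) w<L , s≤s (+-monoʳ-< k' lt))
      isLow (cCH i lt q) = inj₁ (<L-k i lt , w<L)
      isLow (cLA j lt q) = inj₂ (inj₁ (j , lt , refl , q))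
      isLow (cLB j lt q) = inj₂ (inj₂ (j , lt , refl , q))

      0<L : 0 < L
      0<L = s≤s z≤n

      LA-inc : ∀ {e} j → EdgeIn e → (proj₁ e ≡ L + j ⊎ proj₂ e ≡ L + j) → j < s → T (memb Z1 j)
      LA-inc j c h js with isLow c | h
      ... | inj₁ (l1 , l2) | inj₁ eq = ⊥-elim (≢L j l1 eq)
      ... | inj₁ (l1 , l2) | inj₂ eq = ⊥-elim (≢L j l2 eq)
      ... | inj₂ (inj₁ (j' , lt , refl , q)) | inj₁ eq = ⊥-elim (≢L j 0<L eq)
      ... | inj₂ (inj₁ (j' , lt , refl , q)) | inj₂ eq = subst (λ z → T (memb Z1 z)) (+-cancelˡ-≡ L j' j eq) q
      ... | inj₂ (inj₂ (j' , lt , refl , q)) | inj₁ eq = ⊥-elim (≢L j w<L eq)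
      ... | inj₂ (inj₂ (j' , lt , refl , q)) | inj₂ eq =
        ⊥-elim (<⇒≱ js (subst (s ≤_) (+-cancelˡ-≡ L (s + j') j (trans (sym (+-assoc L s j')) eq)) (m≤m+n s j')))

      LB-inc : ∀ {e} j → EdgeIn e → (proj₁ e ≡ L + s + j ⊎ proj₂ e ≡ L + s + j) → T (memb Z2 j)
      LB-inc j c h with isLow c | h
      ... | inj₁ (l1 , l2) | inj₁ eq = ⊥-elim (≢L (s + j) l1 (trans eq (+-assoc L s j)))
      ... | inj₁ (l1 , l2) | inj₂ eq = ⊥-elim (≢L (s + j) l2 (trans eq (+-assoc L s j)))
      ... | inj₂ (inj₁ (j' , lt , refl , q)) | inj₁ eq = ⊥-elim (≢L (s + j) 0<L (trans eq (+-assoc L s j)))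
      ... | inj₂ (inj₁ (j' , lt , refl , q)) | inj₂ eq =
        ⊥-elim (<⇒≱ lt (subst (s ≤_) (sym (+-cancelˡ-≡ L j' (s + j) (trans eq (+-assoc L s j)))) (m≤m+n s j)))
      ... | inj₂ (inj₂ (j' , lt , refl , q)) | inj₁ eq = ⊥-elim (≢L (s + j) w<L (trans eq (+-assoc L s j)))
      ... | inj₂ (inj₂ (j' , lt , refl , q)) | inj₂ eq = subst (λ z → T (memb Z2 z)) (+-cancelˡ-≡ (L + s) j' j eq) q

      open import Data.List.Membership.Propositional.Properties using (∈-map⁺; ∈-map⁻)
      containsP* : ℕ → Bool
      containsP* P = all (λ i → memb S' i) (map (λ j → k' + j) (upTo (P ∸ k')))
             ∧ all (λ i → any (λ e → (proj₁ e ≡ᵇ i) ∧ (proj₂ e ≡ᵇ suc i)) F') (map (λ j → k' + j) (upTo (P ∸ 1 ∸ k')))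

      GE : selected (Gedges n s k) Fb ≡ F'
      GE = cong (λ E → selected E Fb) E'-eq

      containsPstar≡containsP* : containsPstar n s k S' Fb ≡ containsP* L
      containsPstar≡containsP* = trans (cong (containsPstarIn n s k S') GE) (cong containsP* pathLen-eq)

      L∸k' : L ∸ k' ≡ suc m
      L∸k' = trans (cong (_∸ k') (sym (+-suc k' m))) (m+n∸m≡n k' (suc m))

      L∸1∸k' : L ∸ 1 ∸ k' ≡ m
      L∸1∸k' = m+n∸m≡n k' m

      ¬containsP* : ∀ d → d < m → ¬ (PRg d ∈ F') → ¬ T (containsP* L)
      ¬containsP* d dm nin q with find (any⁻ _ F' (All.lookup (all⁺ _ (map (λ j → k' + j) (upTo (L ∸ 1 ∸ k')))
                              (∧-elimʳ (all (λ i → memb S' i) (map (λ j → k' + j) (upTo (L ∸ k')))) q))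
                            (∈-map⁺ (λ j → k' + j) (∈-upTo⁺ (subst (d <_) (sym L∸1∸k') dm)))))
      ... | (a , b) , mem , r with ≡ᵇ⇒≡ a (k' + d) (∧-elimˡ (a ≡ᵇ k' + d) r) | ≡ᵇ⇒≡ b (suc (k' + d)) (∧-elimʳ (a ≡ᵇ k' + d) r)
      ... | refl | refl = nin mem

      containsP*-intro : (∀ d → d ≤ m → T (memb S' (k' + d))) → (∀ d → d < m → PRg d ∈ F') → T (containsP* L)
      containsP*-intro hv he = ∧-intro (all⁻ _ (All.tabulate (λ {x} → h1 x))) (all⁻ _ (All.tabulate (λ {x} → h2 x)))
        where
        h1 : ∀ x → x ∈ map (λ j → k' + j) (upTo (L ∸ k')) → T (memb S' x)
        h1 x mem with ∈-map⁻ (λ j → k' + j) mem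
        ... | j , mj , refl = hv j (≤-pred (subst (j <_) L∸k' (∈-upTo⁻ mj)))
        h2 : ∀ x → x ∈ map (λ j → k' + j) (upTo (L ∸ 1 ∸ k')) → T (any (λ e → (proj₁ e ≡ᵇ x) ∧ (proj₂ e ≡ᵇ suc x)) F')
        h2 x mem with ∈-map⁻ (λ j → k' + j) mem
        ... | j , mj , refl = any⁺ _ (lose (he j (subst (j <_) L∸1∸k' (∈-upTo⁻ mj))) (∧-intro (≡ᵇ-refl (k' + j)) (≡ᵇ-refl (suc (k' + j)))))

    atV₁ : ℕ → Bool
    atV₁ y = y ≡ᵇ 0

    leftVertices : List Bool → List Bool → List Bool
    leftVertices A C = A ++ (replicate m1 false ++ (C ++ (replicate s false ++ replicate s false)))

    leftEdges : List Bool → List Bool → List Edge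
    leftEdges X W = selected PL X ++ selected CH W

    LeftTree : List Bool → List Bool → List Bool → List Bool → Set
    LeftTree A C X W =
      (T (memb A 0) × T (memb A k') × T (memb C 0))
      × (∀ e → e ∈ leftEdges X W → T (memb (leftVertices A C) (proj₁ e)) × T (memb (leftVertices A C) (proj₂ e)))
      × (suc (countTrue X + countTrue W) ≡ countTrue A + countTrue C)
      × (∀ x → T (memb (leftVertices A C) x) → ∃ λ t → T (iter t (leftEdges X W) atV₁ x))

    LeftVertex : ℕ → Set
    LeftVertex v = v < k ⊎ v ≡ w

    open import Data.List.Properties using (length-replicate)

    module Factorisation (A B C D1 D2 X Y Z1 Z2 W : List Bool)
               (lA : length A ≡ k) (lB : length B ≡ m1) (lC : length C ≡ 1)
               (lD1 : length D1 ≡ s) (lD2 : length D2 ≡ s)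
               (lX : length X ≡ k') (lY : length Y ≡ m) (lZ1 : length Z1 ≡ s) (lZ2 : length Z2 ≡ s)
               (lW : length W ≡ k) where

      open Config A B C D1 D2 X Y Z1 Z2 W lA lB lC lD1 lD2 lX lY lZ1 lZ2 lW public
      module Bare = Config A (replicate m1 false) C (replicate s false) (replicate s false) X (replicate m false) (replicate s false) (replicate s false) W
                      lA (length-replicate m1) lC (length-replicate s) (length-replicate s) lX (length-replicate m) (length-replicate s) (length-replicate s) lW

      leftVertices-agree : ∀ v → LeftVertex v → memb (leftVertices A C) v ≡ memb S' v
      leftVertices-agree v (inj₁ lt) = trans (Bare.mA v lt) (sym (mA v lt))
      leftVertices-agree v (inj₂ refl) = trans Bare.mW (sym mW)

      leftVertices⇒LeftVertex : ∀ x → T (memb (leftVertices A C) x) → LeftVertex x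
      leftVertices⇒LeftVertex x q with region x (subst (x <_) Bare.lenS' (memb⇒<length (leftVertices A C) x q))
      ... | rA i lt = inj₁ lt
      ... | rB d lt = ⊥-elim (subst T (trans (Bare.mB d lt) (memb-replicate-false m1 d)) q)
      ... | rW = inj₂ refl
      ... | rD1 j lt = ⊥-elim (subst T (trans (Bare.mD1 j lt) (memb-replicate-false s j)) q)
      ... | rD2 j lt = ⊥-elim (subst T (trans (Bare.mD2 j) (memb-replicate-false s j)) q)

      leftEdges-ends : ∀ e → e ∈ Fl → LeftVertex (proj₁ e) × LeftVertex (proj₂ e)
      leftEdges-ends e mem with ∈-++⁻ (selected PL X) mem
      ... | inj₁ m1' with ∈-selected⁻ PLg k' X e m1'
      ... | i , lt , q , refl = inj₁ (m<n⇒m<1+n lt) , inj₁ (s≤s lt)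
      leftEdges-ends e mem | inj₂ m2 with ∈-selected⁻ CHg k W e m2
      ... | i , lt , q , refl = inj₁ lt , inj₂ refl

      open import Data.List using (take)
      memb⇒<n : ∀ x → T (memb S' x) → x < n
      memb⇒<n x q = subst (x <_) lenS' (memb⇒<length S' x q)

      -- Contracting the inner segment onto its end (v_k or w) that the tree reaches, and the leaves onto
      -- v₁ and w, sends every tree edge to a point or to a left edge, so reachability from v₁ survives.
      collapse-inner : ℕ → ℕ
      collapse-inner d = if d <ᵇ m then (if and (take d Y) then k' else w) else w

      collapse : ℕ → ℕ
      collapse x = if x <ᵇ k then x else (if x <ᵇ suc w then collapse-inner (x ∸ k') else (if x <ᵇ L + s then 0 else w))

      collapse-left : ∀ x → x < k → collapse x ≡ x
      collapse-left x lt rewrite <ᵇ-true lt = refl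

      collapse-inner-vertex : ∀ d → d ≤ m → collapse (k' + d) ≡ collapse-inner d
      collapse-inner-vertex zero _ rewrite +-identityʳ k' | <ᵇ-true {k'} {k} ≤-refl = refl
      collapse-inner-vertex (suc d) le rewrite <ᵇ-false {k' + suc d} {k} (subst (k ≤_) (sym (+-suc k' d)) (s≤s (m≤m+n k' d)))
                           | <ᵇ-true {k' + suc d} {suc w} (s≤s (+-monoʳ-≤ k' le))
                           | m+n∸m≡n k' (suc d) = refl

      collapse-inner-end : collapse-inner m ≡ w
      collapse-inner-end rewrite <ᵇ-false {m} {m} ≤-refl = refl

      collapse-w : collapse w ≡ w
      collapse-w = trans (collapse-inner-vertex m ≤-refl) collapse-inner-end

      collapse-leaf₁ : ∀ j → j < s → collapse (L + j) ≡ 0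
      collapse-leaf₁ j lt rewrite <ᵇ-false {L + j} {k} (≤-trans k≤w (≤-trans (n≤1+n w) (L≤ j)))
                      | <ᵇ-false {L + j} {suc w} (L≤ j)
                      | <ᵇ-true {L + j} {L + s} (+-monoʳ-< L lt) = refl

      collapse-leaf₂ : ∀ j → collapse (L + s + j) ≡ w
      collapse-leaf₂ j rewrite <ᵇ-false {L + s + j} {k} (≤-trans k≤w (≤-trans (n≤1+n w) (≤-trans (m≤m+n L s) (m≤m+n (L + s) j))))
                   | <ᵇ-false {L + s + j} {suc w} (≤-trans (m≤m+n L s) (m≤m+n (L + s) j))
                   | <ᵇ-false {L + s + j} {L + s} (m≤m+n (L + s) j) = refl

      collapse-inner-step : SomeAbsent Y → ∀ d → d < m → T (memb Y d) → collapse-inner d ≡ collapse-inner (suc d)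
      collapse-inner-step nn d lt q with suc d <? m
      ... | yes lt' rewrite <ᵇ-true lt | <ᵇ-true lt' | and-take-suc Y d (subst (d <_) (sym lY) lt) = if-∧ (and (take d Y)) (memb Y d) k' w q
      ... | no nlt with m≤n⇒m<n∨m≡n lt
      ... | inj₁ lt2 = ⊥-elim (nlt lt2)
      ... | inj₂ eq = trans (gd-w (af (and (take d Y)) refl)) (sym (trans (cong collapse-inner eq) collapse-inner-end))
        where
        af : ∀ b → and (take d Y) ≡ b → and (take d Y) ≡ false
        af false e = e
        af true e = ⊥-elim (proj₂ (proj₂ nn) (and-take⇒memb Y (suc d)
                (subst T (sym (trans (and-take-suc Y d (subst (d <_) (sym lY) lt)) (cong (_∧ memb Y d) e))) q) (proj₁ nn)
                (subst (proj₁ nn <_) (trans lY (sym eq)) (proj₁ (proj₂ nn))) (proj₁ (proj₂ nn))))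
        gd-w : and (take d Y) ≡ false → collapse-inner d ≡ w
        gd-w e rewrite <ᵇ-true lt | e = refl

      collapse-edge : SomeAbsent Y → ∀ e → e ∈ F' → collapse (proj₁ e) ≡ collapse (proj₂ e) ⊎ (e ∈ Fl × collapse (proj₁ e) ≡ proj₁ e × collapse (proj₂ e) ≡ proj₂ e)
      collapse-edge nn e mem with classify e mem
      ... | cPL i lt q = inj₂ (inFl-PL i lt q , collapse-left i (m<n⇒m<1+n lt) , collapse-left (suc i) (s≤s lt))
      ... | cCH i lt q = inj₂ (inFl-CH i lt q , collapse-left i lt , collapse-w)
      ... | cLA j lt q = inj₁ (trans (collapse-left 0 (s≤s z≤n)) (sym (collapse-leaf₁ j lt)))
      ... | cLB j lt q = inj₁ (trans collapse-w (sym (collapse-leaf₂ j)))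
      ... | cPR d lt q = inj₁ (trans (collapse-inner-vertex d (<⇒≤ lt)) (trans (collapse-inner-step nn d lt q) (sym (trans (cong collapse (sym (+-suc k' d))) (collapse-inner-vertex (suc d) lt)))))

      collapse-Adj : SomeAbsent Y → ∀ u v → Adj F' u v → collapse u ≡ collapse v ⊎ Adj Fl (collapse u) (collapse v)
      collapse-Adj nn u v (inj₁ mem) with collapse-edge nn (u , v) mem
      ... | inj₁ eq = inj₁ eq
      ... | inj₂ (mfl , eu , ev) rewrite eu | ev = inj₂ (inj₁ mfl)
      collapse-Adj nn u v (inj₂ mem) with collapse-edge nn (v , u) mem
      ... | inj₁ eq = inj₁ (sym eq)
      ... | inj₂ (mfl , ev , eu) rewrite eu | ev = inj₂ (inj₂ mfl)

      collapse-LeftVertex : ∀ x → LeftVertex x → collapse x ≡ x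
      collapse-LeftVertex x (inj₁ lt) = collapse-left x lt
      collapse-LeftVertex x (inj₂ refl) = collapse-w

      EndsIn : Set
      EndsIn = ∀ e → e ∈ F' → T (memb S' (proj₁ e)) × T (memb S' (proj₂ e))

      ReachedFrom0 : Set
      ReachedFrom0 = ∀ x → T (memb S' x) → T (iter n F' atV₁ x)

      leaves₁-agree : EndsIn → ReachedFrom0 → T (eqB D1 Z1)
      leaves₁-agree ends reached = eqB-intro D1 Z1 (trans lD1 (sym lZ1)) (λ j → bool-ext (d→z j) (z→d j))
        where
        z→d : ∀ j → T (memb Z1 j) → T (memb D1 j)
        z→d j q = let j<s = subst (j <_) lZ1 (memb⇒<length Z1 j q) in
          subst T (mD1 j j<s) (proj₂ (ends _ (inF (cLA j j<s q))))
        d→z : ∀ j → T (memb D1 j) → T (memb Z1 j)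
        d→z j q with reached-incident F' 0 n (L + j) (reached (L + j) (subst T (sym (mD1 j j<s)) q))
          where j<s = subst (j <_) lD1 (memb⇒<length D1 j q)
        ... | inj₁ eq = ⊥-elim (≢L j 0<L (sym eq))
        ... | inj₂ (y , inj₁ mem) = LA-inc j (classify _ mem) (inj₂ refl) (subst (j <_) lD1 (memb⇒<length D1 j q))
        ... | inj₂ (y , inj₂ mem) = LA-inc j (classify _ mem) (inj₁ refl) (subst (j <_) lD1 (memb⇒<length D1 j q))

      leaves₂-agree : EndsIn → ReachedFrom0 → T (eqB D2 Z2)
      leaves₂-agree ends reached = eqB-intro D2 Z2 (trans lD2 (sym lZ2)) (λ j → bool-ext (d→z j) (z→d j))
        where
        z→d : ∀ j → T (memb Z2 j) → T (memb D2 j)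
        z→d j q = let j<s = subst (j <_) lZ2 (memb⇒<length Z2 j q) in
          subst T (mD2 j) (proj₂ (ends _ (inF (cLB j j<s q))))
        d→z : ∀ j → T (memb D2 j) → T (memb Z2 j)
        d→z j q with reached-incident F' 0 n (L + s + j) (reached (L + s + j) (subst T (sym (mD2 j)) q))
        ... | inj₁ eq = ⊥-elim (≢L (s + j) 0<L (trans (sym eq) (+-assoc L s j)))
        ... | inj₂ (y , inj₁ mem) = LB-inc j (classify _ mem) (inj₂ refl)
        ... | inj₂ (y , inj₂ mem) = LB-inc j (classify _ mem) (inj₁ refl)

      lenY : length Y ≡ suc (length B)
      lenY = trans lY (cong suc (sym lB))

      right-someAbsent : EndsIn → ¬ T (containsP* L) → SomeAbsent Y
      right-someAbsent ends no-P* with all-below-or-counterexample (memb Y) m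
      ... | inj₂ (d , d<m , absent) = d , subst (d <_) (sym lY) d<m , absent
      ... | inj₁ present = ⊥-elim (no-P* (containsP*-intro vertices edges))
        where
        edges : ∀ d → d < m → PRg d ∈ F'
        edges d d<m = inF (cPR d d<m (present d d<m))
        vertices : ∀ d → d ≤ m → T (memb S' (k' + d))
        vertices d d≤m with m≤n⇒m<n∨m≡n d≤m
        ... | inj₁ d<m  = proj₁ (ends _ (edges d d<m))
        ... | inj₂ refl = subst (λ z → T (memb S' z)) (sym (+-suc k' m1)) (proj₂ (ends _ (edges m1 ≤-refl)))

      right-leftEnds : EndsIn → LeftEndsIn B Y
      right-leftEnds ends d q = subst T (mB d (≤-pred d+1<m))
          (subst (λ z → T (memb S' z)) (k≡ d) (proj₁ (ends _ (inF (cPR (suc d) d+1<m q)))))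
        where d+1<m = subst (suc d <_) lY (memb⇒<length Y (suc d) q)

      right-rightEnds : EndsIn → RightEndsIn B Y
      right-rightEnds ends d q d+1<len = subst T (mB d (≤-pred d+1<m))
          (proj₂ (ends _ (inF (cPR d (<-trans (n<1+n d) d+1<m) q))))
        where d+1<m = subst (suc d <_) lY d+1<len

      -- If vertex k+d is in the tree but the segment edges d₁ ≤ d and d₂ > d are missing, the vertices outside
      -- [k+d₁, k+d₂) form a set closed under the tree edges that contains v₁, so vertex k+d is not reached.
      right-reachesAnEnd : ReachedFrom0 → ReachesAnEnd B Y
      right-reachesAnEnd reached d qb with all-below-or-counterexample (memb Y) (suc d)
      ... | inj₁ prefix = inj₁ (λ d' d'≤d → prefix d' (s≤s d'≤d))
      ... | inj₂ (d₁ , d₁<d+1 , ¬Yd₁) with all-below-or-counterexample (λ d' → not (d <ᵇ d') ∨ memb Y d') m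
      ...   | inj₁ suffix = inj₂ (λ d' d<d' d'<len → not∨-elim (d <ᵇ d') (memb Y d') (suffix d' (subst (d' <_) lY d'<len)) (<⇒<ᵇ d<d'))
      ...   | inj₂ (d₂ , d₂<m , gap) = ⊥-elim (outside (k + d) (+-monoʳ-≤ k (≤-pred d₁<d+1)) (+-monoʳ-< k d<d₂)
              (iter-closed Outside F' closed n atV₁ (λ x r → subst Outside (sym (≡ᵇ⇒≡ x 0 r)) (inj₁ (s≤s z≤n))) (k + d)
                (reached (k + d) (subst T (sym (mB d (subst (d <_) lB (memb⇒<length B d qb)))) qb))))
        where
        d<d₂ : d < d₂
        d<d₂ = <ᵇ⇒< d d₂ (proj₁ (not∨-neg (d <ᵇ d₂) (memb Y d₂) gap))
        ¬Yd₂ = proj₂ (not∨-neg (d <ᵇ d₂) (memb Y d₂) gap)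
        Outside : ℕ → Set
        Outside x = x < k + d₁ ⊎ k + d₂ ≤ x
        outside : ∀ v → k + d₁ ≤ v → v < k + d₂ → ¬ Outside v
        outside v l₁ l₂ (inj₁ c) = <⇒≱ c l₁
        outside v l₁ l₂ (inj₂ c) = <⇒≱ l₂ c
        k+d₂≤w : k + d₂ ≤ w
        k+d₂≤w = +-monoʳ-< k' d₂<m
        outside-left : ∀ v → v < k → Outside v
        outside-left v v<k = inj₁ (≤-trans v<k (m≤m+n k d₁))
        outside-leaves : ∀ v → L ≤ v → Outside v
        outside-leaves v L≤v = inj₂ (≤-trans k+d₂≤w (≤-trans (n≤1+n w) L≤v))
        both : ∀ {p q} → Outside p → Outside q → (Outside p → Outside q) × (Outside q → Outside p)
        both op oq = (λ _ → oq) , (λ _ → op)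
        edge-closed : ∀ e → e ∈ F' → (Outside (proj₁ e) → Outside (proj₂ e)) × (Outside (proj₂ e) → Outside (proj₁ e))
        edge-closed e mem with classify e mem
        ... | cPL i lt _ = both (outside-left i (m<n⇒m<1+n lt)) (outside-left (suc i) (s≤s lt))
        ... | cCH i lt _ = both (outside-left i lt) (inj₂ k+d₂≤w)
        ... | cLA j lt _ = both (outside-left 0 (s≤s z≤n)) (outside-leaves (L + j) (L≤ j))
        ... | cLB j lt _ = both (inj₂ k+d₂≤w) (outside-leaves (L + s + j) (≤-trans (m≤m+n L s) (m≤m+n (L + s) j)))
        ... | cPR d' lt q with <-cmp d' d₁
        ...   | tri≈ _ refl _ = ⊥-elim (¬Yd₁ q)
        ...   | tri< d'<d₁ _ _ = both (inj₁ (≤-trans (+-monoʳ-< k' d'<d₁) (n≤1+n _))) (inj₁ (s≤s (+-monoʳ-< k' d'<d₁)))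
        ...   | tri> _ _ d'>d₁ with <-cmp d' d₂
        ...     | tri≈ _ refl _ = ⊥-elim (¬Yd₂ q)
        ...     | tri> _ _ d'>d₂ = both (inj₂ (+-monoʳ-< k' d'>d₂)) (inj₂ (≤-trans (+-monoʳ-< k' d'>d₂) (n≤1+n _)))
        ...     | tri< d'<d₂ _ _ = (λ c → ⊥-elim (outside _ (+-monoʳ-< k' d'>d₁) (s≤s (+-monoʳ-≤ k' (<⇒≤ d'<d₂))) c))
                                 , (λ c → ⊥-elim (outside _ (s≤s (+-monoʳ-≤ k' (<⇒≤ d'>d₁))) (s≤s (+-monoʳ-< k' d'<d₂)) c))
        closed : ∀ u v → Adj F' u v → Outside u → Outside v
        closed u v (inj₁ mem) = proj₁ (edge-closed (u , v) mem)
        closed u v (inj₂ mem) = proj₂ (edge-closed (v , u) mem)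

      left-count : suc (length F') ≡ countTrue S' → T (splitPath B Y) → T (eqB D1 Z1) → T (eqB D2 Z2) →
        suc (countTrue X + countTrue W) ≡ countTrue A + countTrue C
      left-count edges-vertices split eq₁ eq₂ =
        cancel (countTrue X) (countTrue Y) (countTrue Z1) (countTrue Z2) (countTrue W) (countTrue A) (countTrue C)
          (trans (cong suc (sym lenF')) (trans edges-vertices (trans cntS'
            (cong₂ (λ u v → countTrue A + (u + (countTrue C + v))) (splitPath-countTrue B Y lenY split)
               (cong₂ _+_ (eqB-count D1 Z1 eq₁) (eqB-count D2 Z2 eq₂))))))
        where
        cancel : ∀ x y z₁ z₂ w' a' c' → suc (x + (y + (z₁ + (z₂ + w')))) ≡ a' + (y + (c' + (z₁ + z₂))) → suc (x + w') ≡ a' + c'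
        cancel x y z₁ z₂ w' a' c' h = +-cancelʳ-≡ (y + (z₁ + z₂)) _ _ (trans (p₁ x y z₁ z₂ w') (trans h (p₂ a' y c' z₁ z₂)))
          where
          p₁ : ∀ x y z₁ z₂ w' → suc (x + w') + (y + (z₁ + z₂)) ≡ suc (x + (y + (z₁ + (z₂ + w'))))
          p₁ = solve-∀
          p₂ : ∀ a' y c' z₁ z₂ → a' + (y + (c' + (z₁ + z₂))) ≡ a' + c' + (y + (z₁ + z₂))
          p₂ = solve-∀

      left-reach : ReachedFrom0 → SomeAbsent Y → ∀ x → T (memb (leftVertices A C) x) → ∃ λ t → T (iter t Fl atV₁ x)
      left-reach reached absent x q = n , subst (λ z → T (iter n Fl atV₁ z)) (collapse-LeftVertex x left)
          (iter-simulate collapse F' Fl (collapse-Adj absent) n atV₁ atV₁ keeps-0 x (reached x (subst T (leftVertices-agree x left) q)))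
        where
        left = leftVertices⇒LeftVertex x q
        keeps-0 : ∀ y → T (atV₁ y) → T (atV₁ (collapse y))
        keeps-0 y r rewrite ≡ᵇ⇒≡ y 0 r | collapse-left 0 (s≤s z≤n) = tt

      member⇒parts : T (isMember n s k S' Fb) → LeftTree A C X W × T (splitPath B Y) × T (eqB D1 Z1) × T (eqB D2 Z2)
      member⇒parts q = left , split , eq₁ , eq₂
        where
        IS = isSubtree⇒ n (Gedges n s k) S' Fb (∧-elimˡ (isSubtree n (Gedges n s k) S' Fb) q)
        IF = inFamily⇒ n s k S' Fb (∧-elimʳ (isSubtree n (Gedges n s k) S' Fb) q)
        A0 : T (memb A 0)
        A0 = subst T (mA 0 (s≤s z≤n)) (proj₁ IF)
        ends : EndsIn
        ends e mem = proj₁ (proj₂ IS) e (subst (e ∈_) (sym GE) mem)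
        reached : ReachedFrom0
        reached x mx = subst₂ (λ F r → T (reach n F r x)) GE (firstIn-0 A _ A0) (proj₂ (proj₂ (proj₂ IS)) x (memb⇒<n x mx) mx)
        Iw : T (memb S' w)
        Iw = subst (λ z → T (memb S' (z ∸ 1))) pathLen-eq (proj₁ (proj₂ (proj₂ IF)))
        absent = right-someAbsent ends (λ c → proj₂ (proj₂ (proj₂ IF)) (subst T (sym containsPstar≡containsP*) c))
        split : T (splitPath B Y)
        split = splitPath⇐ B Y lenY (right-leftEnds ends) (right-rightEnds ends) (right-reachesAnEnd reached) absent
        eq₁ = leaves₁-agree ends reached
        eq₂ = leaves₂-agree ends reached
        left : LeftTree A C X W
        left = (A0 , subst T (mA k' ≤-refl) (proj₁ (proj₂ IF)) , subst T mW Iw)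
          , (λ e mem → subst T (sym (leftVertices-agree _ (proj₁ (leftEdges-ends e mem)))) (proj₁ (ends e (Fl⊆F' e mem)))
                     , subst T (sym (leftVertices-agree _ (proj₂ (leftEdges-ends e mem)))) (proj₂ (ends e (Fl⊆F' e mem))))
          , left-count (subst (λ F → suc (length F) ≡ countTrue S') GE (proj₁ (proj₂ (proj₂ IS)))) split eq₁ eq₂
          , left-reach reached absent

      module FromParts (left : LeftTree A C X W) (split : T (splitPath B Y)) (eq₁ : T (eqB D1 Z1)) (eq₂ : T (eqB D2 Z2)) where
        A0 = proj₁ (proj₁ left)
        Ak = proj₁ (proj₂ (proj₁ left))
        C0 = proj₂ (proj₂ (proj₁ left))
        SH = splitPath⇒ B Y lenY split

        I0 : T (memb S' 0)
        I0 = subst T (sym (mA 0 (s≤s z≤n))) A0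

        I1 : T (memb S' k')
        I1 = subst T (sym (mA k' ≤-refl)) Ak

        Iw : T (memb S' w)
        Iw = subst T (sym mW) C0

        no-P* : ¬ T (containsPstar n s k S' Fb)
        no-P* c = ¬containsP* d d<m (λ mem → ¬Yd (PR-id d (classify _ mem) refl d<m)) (subst T containsPstar≡containsP* c)
          where
          d = proj₁ (proj₂ (proj₂ (proj₂ SH)))
          ¬Yd = proj₂ (proj₂ (proj₂ (proj₂ (proj₂ SH))))
          d<m = subst (d <_) lY (proj₁ (proj₂ (proj₂ (proj₂ (proj₂ SH)))))

        ends : EndsIn
        ends e mem with classify e mem
        ... | cPL i lt q = let r = proj₁ (proj₂ left) _ (inFl-PL i lt q) in
                           toS' i (inj₁ (m<n⇒m<1+n lt)) (proj₁ r) , toS' (suc i) (inj₁ (s≤s lt)) (proj₂ r)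
          where toS' = λ v lv → subst T (leftVertices-agree v lv)
        ... | cCH i lt q = let r = proj₁ (proj₂ left) _ (inFl-CH i lt q) in
                           subst T (leftVertices-agree i (inj₁ lt)) (proj₁ r) , subst T (leftVertices-agree w (inj₂ refl)) (proj₂ r)
        ... | cLA j lt q = I0 , subst T (sym (trans (mD1 j lt) (eqB-memb D1 Z1 eq₁ j))) q
        ... | cLB j lt q = Iw , subst T (sym (trans (mD2 j) (eqB-memb D2 Z2 eq₂ j))) q
        ... | cPR d lt q = from-left d lt q , to-right
          where
          from-left : ∀ d → d < m → T (memb Y d) → T (memb S' (k' + d))
          from-left zero     _  _ = subst (λ z → T (memb S' z)) (sym (+-identityʳ k')) I1
          from-left (suc d') lt q = subst (λ z → T (memb S' z)) (sym (k≡ d'))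
            (subst T (sym (mB d' (≤-pred lt))) (proj₁ SH d' q))
          to-right : T (memb S' (suc (k' + d)))
          to-right with suc d <? m
          ... | yes d+1<m = subst T (sym (mB d (≤-pred d+1<m))) (proj₁ (proj₂ SH) d q (subst (suc d <_) (sym lY) d+1<m))
          ... | no d+1≮m with m≤n⇒m<n∨m≡n lt
          ...   | inj₁ d+1<m = ⊥-elim (d+1≮m d+1<m)
          ...   | inj₂ refl  = subst (λ z → T (memb S' z)) (+-suc k' m1) Iw

        edges-vertices : suc (length F') ≡ countTrue S'
        edges-vertices = trans (cong suc lenF') (trans
          (expand (countTrue X) (countTrue Y) (countTrue Z1) (countTrue Z2) (countTrue W) (countTrue A) (countTrue C) (proj₁ (proj₂ (proj₂ left))))
          (trans (cong₂ (λ u v → countTrue A + (u + (countTrue C + v))) (sym (splitPath-countTrue B Y lenY split))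
                 (cong₂ _+_ (sym (eqB-count D1 Z1 eq₁)) (sym (eqB-count D2 Z2 eq₂)))) (sym cntS')))
          where
          expand : ∀ x y z₁ z₂ w' a' c' → suc (x + w') ≡ a' + c' → suc (x + (y + (z₁ + (z₂ + w')))) ≡ a' + (y + (c' + (z₁ + z₂)))
          expand x y z₁ z₂ w' a' c' h = trans (sym (p₁ x y z₁ z₂ w')) (trans (cong (_+ (y + (z₁ + z₂))) h) (sym (p₂ a' y c' z₁ z₂)))
            where
            p₁ : ∀ x y z₁ z₂ w' → suc (x + w') + (y + (z₁ + z₂)) ≡ suc (x + (y + (z₁ + (z₂ + w'))))
            p₁ = solve-∀
            p₂ : ∀ a' y c' z₁ z₂ → a' + (y + (c' + (z₁ + z₂))) ≡ a' + c' + (y + (z₁ + z₂))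
            p₂ = solve-∀

        reached-left : ∀ x → LeftVertex x → T (memb S' x) → ∃ λ t → T (iter t F' atV₁ x)
        reached-left x lv q with proj₂ (proj₂ (proj₂ left)) x (subst T (sym (leftVertices-agree x lv)) q)
        ... | t , r = t , iter-simulate (λ x → x) Fl F' (λ u v adj → inj₂ (Fl⇒F' adj)) t atV₁ atV₁ (λ _ r → r) x r
          where
          Fl⇒F' : ∀ {u v} → Adj Fl u v → Adj F' u v
          Fl⇒F' (inj₁ mem) = inj₁ (Fl⊆F' _ mem)
          Fl⇒F' (inj₂ mem) = inj₂ (Fl⊆F' _ mem)

        rk' = reached-left k' (inj₁ ≤-refl) I1
        rw  = reached-left w (inj₂ refl) Iw

        along-prefix : ∀ d → (∀ d' → d' ≤ d → T (memb Y d')) → ∀ j → j ≤ suc d → T (iter (proj₁ rk' + j) F' atV₁ (k' + j))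
        along-prefix d prefix zero _ =
          subst₂ (λ t z → T (iter t F' atV₁ z)) (sym (+-identityʳ (proj₁ rk'))) (sym (+-identityʳ k')) (proj₂ rk')
        along-prefix d prefix (suc j) j<d+1 = subst₂ (λ t z → T (iter t F' atV₁ z)) (sym (+-suc (proj₁ rk') j)) (sym (+-suc k' j))
            (iter-edge (proj₁ rk' + j) F' atV₁ (inj₁ (inF (cPR j j<m Yj))) (along-prefix d prefix j (<⇒≤ j<d+1)))
          where
          Yj = prefix j (≤-pred j<d+1)
          j<m = subst (j <_) lY (memb⇒<length Y j Yj)

        along-suffix : ∀ d → (∀ d' → d < d' → d' < length Y → T (memb Y d')) →
          ∀ j e → e + j ≡ m → suc d ≤ e → ∃ λ t → T (iter t F' atV₁ (k' + e))
        along-suffix d suffix zero e e≡m _ =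
          proj₁ rw , subst (λ z → T (iter (proj₁ rw) F' atV₁ (k' + z))) (sym (trans (sym (+-identityʳ e)) e≡m)) (proj₂ rw)
        along-suffix d suffix (suc j) e e+j+1≡m d<e with along-suffix d suffix j (suc e) (trans (sym (+-suc e j)) e+j+1≡m) (m≤n⇒m≤1+n d<e)
        ... | t , r = suc t , iter-edge t F' atV₁ (inj₂ (inF (cPR e e<m (suffix e d<e (subst (e <_) (sym lY) e<m)))))
                                (subst (λ z → T (iter t F' atV₁ z)) (+-suc k' e) r)
          where
          e<m : e < m
          e<m = subst (e <_) e+j+1≡m (subst (_≤ e + suc j) (+-comm e 1) (+-monoʳ-≤ e (s≤s z≤n)))

        reached : ∀ x → x < n → T (memb S' x) → ∃ λ t → T (iter t F' atV₁ x)
        reached x x<n q with region x x<n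
        ... | rA i lt = reached-left i (inj₁ lt) q
        ... | rW      = reached-left w (inj₂ refl) q
        ... | rD1 j lt = 1 , iter-edge 0 F' atV₁ (inj₁ (inF (cLA j lt (subst T (trans (mD1 j lt) (eqB-memb D1 Z1 eq₁ j)) q)))) (≡ᵇ-refl 0)
        ... | rD2 j lt = suc (proj₁ rw) , iter-edge (proj₁ rw) F' atV₁ (inj₁ (inF (cLB j lt (subst T (trans (mD2 j) (eqB-memb D2 Z2 eq₂ j)) q)))) (proj₂ rw)
        ... | rB d lt with proj₁ (proj₂ (proj₂ SH)) d (subst T (mB d lt) q)
        ...   | inj₁ prefix = proj₁ rk' + suc d , subst (λ z → T (iter (proj₁ rk' + suc d) F' atV₁ z)) (k≡ d) (along-prefix d prefix (suc d) ≤-refl)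
        ...   | inj₂ suffix = let r = along-suffix d suffix (m ∸ suc d) (suc d) (m+[n∸m]≡n (s≤s (<⇒≤ lt))) ≤-refl in
                              proj₁ r , subst (λ z → T (iter (proj₁ r) F' atV₁ z)) (k≡ d) (proj₂ r)

      parts⇒member : LeftTree A C X W → T (splitPath B Y) → T (eqB D1 Z1) → T (eqB D2 Z2) → T (isMember n s k S' Fb)
      parts⇒member left split eq₁ eq₂ =
        ∧-intro (isSubtree⇐ n (Gedges n s k) S' Fb (memb⇒countTrue-pos S' 0 I0) (λ e mem → ends e (subst (e ∈_) GE mem))
                  (subst (λ F → suc (length F) ≡ countTrue S') (sym GE) edges-vertices) reach-all)
                (inFamily⇐ n s k S' Fb I0 I1 (subst (λ z → T (memb S' (z ∸ 1))) (sym pathLen-eq) Iw) no-P*)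
        where
        open FromParts left split eq₁ eq₂
        reach-all : ∀ x → x < n → T (memb S' x) → T (reach n (selected (Gedges n s k) Fb) (firstIn S') x)
        reach-all x x<n q = subst₂ (λ F r → T (reach n F r x)) (sym GE) (sym (firstIn-0 A _ A0))
          (Saturation.reach-complete n F' 0 bndF' (s≤s z≤n) (proj₁ (reached x x<n q)) x (proj₂ (reached x x<n q)))

    leftEdgeBits : List Bool → List Bool → List Bool
    leftEdgeBits X W = X ++ (replicate m false ++ (replicate s false ++ (replicate s false ++ W)))

    isLeftTree : List Bool → List Bool → List Bool → List Bool → Bool
    isLeftTree A C X W = isMember n s k (leftVertices A C) (leftEdgeBits X W)

    module LeftOnly (A C X W : List Bool) (lA : length A ≡ k) (lC : length C ≡ 1) (lX : length X ≡ k') (lW : length W ≡ k) =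
      Factorisation A (replicate m1 false) C (replicate s false) (replicate s false) X (replicate m false) (replicate s false) (replicate s false) W
          lA (length-replicate m1) lC (length-replicate s) (length-replicate s) lX (length-replicate m) (length-replicate s) (length-replicate s) lW

    LeftTree⇒isLeftTree : ∀ A C X W (lA : length A ≡ k) (lC : length C ≡ 1) (lX : length X ≡ k') (lW : length W ≡ k) → LeftTree A C X W → T (isLeftTree A C X W)
    LeftTree⇒isLeftTree A C X W lA lC lX lW gl = LeftOnly.parts⇒member A C X W lA lC lX lW gl (splitAtStart-empty m1) (eqB-refl (replicate s false)) (eqB-refl (replicate s false))

    isLeftTree⇒LeftTree : ∀ A C X W (lA : length A ≡ k) (lC : length C ≡ 1) (lX : length X ≡ k') (lW : length W ≡ k) → T (isLeftTree A C X W) → LeftTree A C X W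
    isLeftTree⇒LeftTree A C X W lA lC lX lW q = proj₁ (LeftOnly.member⇒parts A C X W lA lC lX lW q)

    isMember-factorises : ∀ A B C D1 D2 X Y Z1 Z2 W → 
               (lA : length A ≡ k) (lB : length B ≡ m1) (lC : length C ≡ 1)
               (lD1 : length D1 ≡ s) (lD2 : length D2 ≡ s)
               (lX : length X ≡ k') (lY : length Y ≡ m) (lZ1 : length Z1 ≡ s) (lZ2 : length Z2 ≡ s)
               (lW : length W ≡ k) →
      isMember n s k (A ++ (B ++ (C ++ (D1 ++ D2)))) (X ++ (Y ++ (Z1 ++ (Z2 ++ W)))) ≡ isLeftTree A C X W ∧ (splitPath B Y ∧ (eqB D1 Z1 ∧ eqB D2 Z2))
    isMember-factorises A B C D1 D2 X Y Z1 Z2 W lA lB lC lD1 lD2 lX lY lZ1 lZ2 lW = bool-ext to from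
      where
      module D = Factorisation A B C D1 D2 X Y Z1 Z2 W lA lB lC lD1 lD2 lX lY lZ1 lZ2 lW
      to : T (isMember n s k D.S' D.Fb) → T (isLeftTree A C X W ∧ (splitPath B Y ∧ (eqB D1 Z1 ∧ eqB D2 Z2)))
      to q with D.member⇒parts q
      ... | gl , sh , e1 , e2 = ∧-intro (LeftTree⇒isLeftTree A C X W lA lC lX lW gl) (∧-intro sh (∧-intro e1 e2))
      from : T (isLeftTree A C X W ∧ (splitPath B Y ∧ (eqB D1 Z1 ∧ eqB D2 Z2))) → T (isMember n s k D.S' D.Fb)
      from q = D.parts⇒member (isLeftTree⇒LeftTree A C X W lA lC lX lW (∧-elimˡ (isLeftTree A C X W) q)) (∧-elimˡ (splitPath B Y) q2) (∧-elimˡ (eqB D1 Z1) q3) (∧-elimʳ (eqB D1 Z1) q3)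
        where
        q2 = ∧-elimʳ (isLeftTree A C X W) q
        q3 = ∧-elimʳ (splitPath B Y) q2

    memb-replicate-true : ∀ j i → i < j → memb (replicate j true) i ≡ true
    memb-replicate-true (suc j) zero lt = refl
    memb-replicate-true (suc j) (suc i) (s≤s lt) = memb-replicate-true j i lt

    starA starC starX starW : List Bool
    starA = replicate k true
    starC = true ∷ []
    starX = replicate k' false
    starW = replicate k true

    module Star = LeftOnly starA starC starX starW (length-replicate k) refl (length-replicate k') (length-replicate k)

    star-LeftTree : LeftTree starA starC starX starW
    star-LeftTree = (tt , subst T (sym (memb-replicate-true k k' ≤-refl)) tt , tt) , gl2 , gl3 , gl4
      where
      gl2 : ∀ e → e ∈ leftEdges starX starW → T (memb (leftVertices starA starC) (proj₁ e)) × T (memb (leftVertices starA starC) (proj₂ e))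
      gl2 e mem with ∈-++⁻ (selected PL starX) mem
      ... | inj₁ m1' with ∈-selected⁻ PLg k' starX e m1'
      ... | i , lt , q , refl = ⊥-elim (subst T (memb-replicate-false k' i) q)
      gl2 e mem | inj₂ m2 with ∈-selected⁻ CHg k starW e m2
      ... | i , lt , q , refl = subst T (sym (trans (Star.mA i lt) (memb-replicate-true k i lt))) tt , subst T (sym Star.mW) tt
      gl3 : suc (countTrue starX + countTrue starW) ≡ countTrue starA + countTrue starC
      gl3 rewrite countTrue-replicate-false k' | countTrue-replicate-true k' = +-comm 1 k
      reachW : T (iter 1 (leftEdges starX starW) atV₁ w)
      reachW = iter-edge 0 (leftEdges starX starW) atV₁ (inj₁ (Star.inFl-CH 0 (s≤s z≤n) tt)) (≡ᵇ-refl 0)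
      gl4 : ∀ x → T (memb (leftVertices starA starC) x) → ∃ λ t → T (iter t (leftEdges starX starW) atV₁ x)
      gl4 x q with Star.leftVertices⇒LeftVertex x q
      ... | inj₂ refl = 1 , reachW
      ... | inj₁ lt = 2 , iter-edge 1 (leftEdges starX starW) atV₁ (inj₂ (Star.inFl-CH x lt (subst T (sym (memb-replicate-true k x lt)) tt))) reachW

    star-isLeftTree : T (isLeftTree starA starC starX starW)
    star-isLeftTree = LeftTree⇒isLeftTree starA starC starX starW (length-replicate k) refl (length-replicate k') (length-replicate k) star-LeftTree

    isLeftTree-size : ∀ A C X W (lA : length A ≡ k) (lC : length C ≡ 1) (lX : length X ≡ k') (lW : length W ≡ k) → T (isLeftTree A C X W) →
      2 ≤ countTrue A + countTrue C × countTrue A + countTrue C ≤ suc k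
    isLeftTree-size A C X W lA lC lX lW q with isLeftTree⇒LeftTree A C X W lA lC lX lW q
    ... | (a0 , _ , c0) , _ = +-mono-≤ (memb⇒countTrue-pos A 0 a0) (memb⇒countTrue-pos C 0 c0)
                            , subst (countTrue A + countTrue C ≤_) (+-comm k 1)
                                (+-mono-≤ (subst (countTrue A ≤_) lA (countTrue≤length A)) (subst (countTrue C ≤_) lC (countTrue≤length C)))

module Count where

  open import Defs
  open BoolLemmas
  open Lists
  open Sums
  open Shape
  open Graph
  open import Data.Bool using (Bool; true; false; _∧_; T)
  open import Data.Bool.Properties using (T-≡)
  open import Function.Bundles using (Equivalence)
  open import Data.Unit using (tt)
  open import Data.Nat using (ℕ; zero; suc; _+_; _*_; _^_; _≤_; z≤n; s≤s)
  open import Data.Nat.Properties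
  open import Data.List using (List; _∷_; _++_; map; length; concatMap)
  open import Data.List.Properties using (length-++; length-applyUpTo)
  open import Data.Nat.ListAction using (sum)
  open import Data.List.Membership.Propositional using (_∈_)
  open import Data.List.Relation.Unary.Any using (here; there)
  open import Data.Product using (_×_; _,_; proj₁; proj₂)
  open import Relation.Binary.PropositionalEquality using (_≡_; refl; sym; trans; cong; cong₂; subst; module ≡-Reasoning)
  open import Data.Nat.Tactic.RingSolver
  open Rationals using (⅔; ∣ratio-⅔∣≤)
  open import Data.Rational as ℚ using (_-_; ∣_∣)

  ∑-family : ∀ n s k (g : List Bool → ℕ) → ∑ (family n s k) (λ p → g (proj₁ p))
    ≡ ∑ (subsets n) (λ S → ∑ (subsets (length (Gedges n s k))) (λ Fb → ind (isMember n s k S Fb) * g S))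
  ∑-family n s k g = begin
    ∑ (family n s k) (λ p → g (proj₁ p))
      ≡⟨ ∑-filter (λ p → inFamily n s k (proj₁ p) (proj₂ p)) (subtrees n E) _ ⟩
    ∑ (subtrees n E) (λ p → ind (inFamily n s k (proj₁ p) (proj₂ p)) * g (proj₁ p))
      ≡⟨ ∑-filter (λ p → isSubtree n E (proj₁ p) (proj₂ p)) (concatMap h (subsets n)) _ ⟩
    ∑ (concatMap h (subsets n)) (λ p → ind (isSubtree n E (proj₁ p) (proj₂ p)) * (ind (inFamily n s k (proj₁ p) (proj₂ p)) * g (proj₁ p)))
      ≡⟨ ∑-concatMap h (subsets n) _ ⟩
    ∑ (subsets n) (λ S → ∑ (h S) (λ p → ind (isSubtree n E (proj₁ p) (proj₂ p)) * (ind (inFamily n s k (proj₁ p) (proj₂ p)) * g (proj₁ p))))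
      ≡⟨ ∑-cong (subsets n) (λ S → trans (∑-map (λ Fb → (S , Fb)) (subsets (length E)) _)
            (∑-cong (subsets (length E)) (λ Fb → trans (sym (*-assoc (ind (isSubtree n E S Fb)) _ _))
                (cong (_* g S) (sym (ind-∧ (isSubtree n E S Fb) (inFamily n s k S Fb))))))) ⟩
    ∑ (subsets n) (λ S → ∑ (subsets (length E)) (λ Fb → ind (isMember n s k S Fb) * g S)) ∎
    where
    open ≡-Reasoning
    E = Gedges n s k
    h : List Bool → List (List Bool × List Bool)
    h S = map (λ Fb → (S , Fb)) (subsets (length E))

  ind-∧⁴ : ∀ a b c d → ind (a ∧ (b ∧ (c ∧ d))) ≡ ind a * (ind b * (ind c * ind d))
  ind-∧⁴ a b c d = trans (ind-∧ a _) (cong (ind a *_) (trans (ind-∧ b _) (cong (ind b *_) (ind-∧ c d))))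

  module Sizes (k' m1 s : ℕ) (hm : 1 ≤ m1) where
    open Decomposition k' m1 s hm

    length-Gedges : length (Gedges n s k) ≡ k' + (m + (s + (s + k)))
    length-Gedges = trans (cong length E'-eq)
      (trans (length-++ PL) (cong₂ _+_ (length-applyUpTo PLg k')
      (trans (length-++ PR) (cong₂ _+_ (length-applyUpTo PRg m)
      (trans (length-++ LA) (cong₂ _+_ (length-applyUpTo LAg s)
      (trans (length-++ LB) (cong₂ _+_ (length-applyUpTo LBg s) (length-applyUpTo CHg k)))))))))

    n-split : n ≡ k + (m1 + (1 + (s + s)))
    n-split = idn k' m1 s
      where
      idn : ∀ a b c → suc a + suc b + c + c ≡ suc a + (b + (1 + (c + c)))
      idn = solve-∀

    sA = subsets k
    sB = subsets m1
    sC = subsets 1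
    sD = subsets s
    sX = subsets k'
    sY = subsets m
    sW = subsets k

    ∑members : (List Bool → ℕ) → ℕ
    ∑members g = ∑ (subsets n) (λ S → ∑ (subsets (length (Gedges n s k))) (λ Fb → ind (isMember n s k S Fb) * g S))

    ∑members-split : ∀ g → ∑members g ≡ ∑⁵ sA sB sC sD sD (λ A B C D1 D2 → ∑⁵ sX sY sD sD sW (λ X Y Z1 Z2 W →
                   ind (isLeftTree A C X W ∧ (splitPath B Y ∧ (eqB D1 Z1 ∧ eqB D2 Z2))) * g (A ++ (B ++ (C ++ (D1 ++ D2))))))
    ∑members-split g = begin
      ∑members g ≡⟨ cong₂ (λ a b → ∑ (subsets a) (λ S → ∑ (subsets b) (λ Fb → ind (isMember n s k S Fb) * g S))) n-split length-Gedges ⟩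
      ∑ (subsets (k + (m1 + (1 + (s + s))))) (λ S → ∑ (subsets (k' + (m + (s + (s + k))))) (λ Fb → ind (isMember n s k S Fb) * g S))
        ≡⟨ ∑-subsets-split⁵ k m1 1 s s (λ S → ∑ (subsets (k' + (m + (s + (s + k))))) (λ Fb → ind (isMember n s k S Fb) * g S)) ⟩
      ∑⁵ sA sB sC sD sD (λ A B C D1 D2 → ∑ (subsets (k' + (m + (s + (s + k))))) (λ Fb → ind (isMember n s k (A ++ (B ++ (C ++ (D1 ++ D2)))) Fb) * g (A ++ (B ++ (C ++ (D1 ++ D2))))))
        ≡⟨ ∑⁵-cong sA sB sC sD sD (λ A B C D1 D2 mA mB mC mD1 mD2 →
             trans (∑-subsets-split⁵ k' m s s k (λ Fb → ind (isMember n s k (A ++ (B ++ (C ++ (D1 ++ D2)))) Fb) * g (A ++ (B ++ (C ++ (D1 ++ D2)))))) (∑⁵-cong sX sY sD sD sW (λ X Y Z1 Z2 W mX mY mZ1 mZ2 mW →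
               cong (_* g (A ++ (B ++ (C ++ (D1 ++ D2)))))
                 (cong ind (isMember-factorises A B C D1 D2 X Y Z1 Z2 W (subsets-length k A mA) (subsets-length m1 B mB) (subsets-length 1 C mC)
                    (subsets-length s D1 mD1) (subsets-length s D2 mD2) (subsets-length k' X mX) (subsets-length m Y mY)
                    (subsets-length s Z1 mZ1) (subsets-length s Z2 mZ2) (subsets-length k W mW)))))) ⟩
      ∑⁵ sA sB sC sD sD (λ A B C D1 D2 → ∑⁵ sX sY sD sD sW (λ X Y Z1 Z2 W →
                   ind (isLeftTree A C X W ∧ (splitPath B Y ∧ (eqB D1 Z1 ∧ eqB D2 Z2))) * g (A ++ (B ++ (C ++ (D1 ++ D2)))))) ∎
      where open ≡-Reasoning

    aL bL N M Q V : ℕ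
    aL = ∑ sA (λ A → ∑ sC (λ C → ∑ sX (λ X → ∑ sW (λ W → ind (isLeftTree A C X W) * 1))))
    bL = ∑ sA (λ A → ∑ sC (λ C → ∑ sX (λ X → ∑ sW (λ W → ind (isLeftTree A C X W) * (countTrue A + countTrue C)))))
    N = ∑splitPath m1 (λ _ → 1)
    M = ∑splitPath m1 countTrue
    Q = ∑ sD (λ _ → 1)
    V = ∑ sD countTrue

    Q≡ : ∑ sD (λ D → ∑ sD (λ Z → ind (eqB D Z) * 1)) ≡ Q
    Q≡ = ∑∑-eqB s (λ _ → 1)

    V≡ : ∑ sD (λ D → ∑ sD (λ Z → ind (eqB D Z) * countTrue D)) ≡ V
    V≡ = ∑∑-eqB s countTrue

    F10 : Set
    F10 = List Bool → List Bool → List Bool → List Bool → List Bool → List Bool → List Bool → List Bool → List Bool → List Bool → ℕ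

    ΣΣ : F10 → ℕ
    ΣΣ F = ∑⁵ sA sB sC sD sD (λ A B C D1 D2 → ∑⁵ sX sY sD sD sW (λ X Y Z1 Z2 W → F A B C D1 D2 X Y Z1 Z2 W))

    ΣΣ-cong : ∀ (F Decomposition : F10) → (∀ A B C D1 D2 X Y Z1 Z2 W → F A B C D1 D2 X Y Z1 Z2 W ≡ Decomposition A B C D1 D2 X Y Z1 Z2 W) → ΣΣ F ≡ ΣΣ Decomposition
    ΣΣ-cong F Decomposition h = ∑⁵-cong sA sB sC sD sD (λ A B C D1 D2 _ _ _ _ _ → ∑⁵-cong sX sY sD sD sW (λ X Y Z1 Z2 W _ _ _ _ _ → h A B C D1 D2 X Y Z1 Z2 W))

    ΣΣ-+ : ∀ (F Decomposition : F10) → ΣΣ (λ A B C D1 D2 X Y Z1 Z2 W → F A B C D1 D2 X Y Z1 Z2 W + Decomposition A B C D1 D2 X Y Z1 Z2 W) ≡ ΣΣ F + ΣΣ Decomposition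
    ΣΣ-+ F Decomposition = trans (∑⁵-cong sA sB sC sD sD (λ A B C D1 D2 _ _ _ _ _ → ∑⁵-+ sX sY sD sD sW (F A B C D1 D2) (Decomposition A B C D1 D2)))
                     (∑⁵-+ sA sB sC sD sD (λ A B C D1 D2 → ∑⁵ sX sY sD sD sW (F A B C D1 D2)) (λ A B C D1 D2 → ∑⁵ sX sY sD sD sW (Decomposition A B C D1 D2)))

    prodF : (List Bool → List Bool → List Bool → List Bool → ℕ) → (List Bool → List Bool → ℕ) → (List Bool → List Bool → ℕ) → (List Bool → List Bool → ℕ) → F10
    prodF pL pR p1 p2 A B C D1 D2 X Y Z1 Z2 W = pL A C X W * (pR B Y * (p1 D1 Z1 * p2 D2 Z2))

    pL0 pL1 : List Bool → List Bool → List Bool → List Bool → ℕ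
    pL0 A C X W = ind (isLeftTree A C X W) * 1
    pL1 A C X W = ind (isLeftTree A C X W) * (countTrue A + countTrue C)

    pR0 pR1 pE0 pE1 : List Bool → List Bool → ℕ
    pR0 B Y = ind (splitPath B Y) * 1
    pR1 B Y = ind (splitPath B Y) * countTrue B
    pE0 D Z = ind (eqB D Z) * 1
    pE1 D Z = ind (eqB D Z) * countTrue D

    ∑members-1 : ∑members (λ _ → 1) ≡ aL * (N * (Q * Q))
    ∑members-1 = begin
      ∑members (λ _ → 1) ≡⟨ ∑members-split (λ _ → 1) ⟩
      ΣΣ (λ A B C D1 D2 X Y Z1 Z2 W → ind (isLeftTree A C X W ∧ (splitPath B Y ∧ (eqB D1 Z1 ∧ eqB D2 Z2))) * 1)
        ≡⟨ ΣΣ-cong _ (prodF pL0 pR0 pE0 pE0) (λ A B C D1 D2 X Y Z1 Z2 W →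
             trans (cong (_* 1) (ind-∧⁴ (isLeftTree A C X W) (splitPath B Y) (eqB D1 Z1) (eqB D2 Z2))) (r (ind (isLeftTree A C X W)) (ind (splitPath B Y)) (ind (eqB D1 Z1)) (ind (eqB D2 Z2)))) ⟩
      ΣΣ (prodF pL0 pR0 pE0 pE0) ≡⟨ ∑⁵∑⁵-product sA sB sC sD sD sX sY sD sD sW pL0 pR0 pE0 pE0 ⟩
      aL * (N * (∑ sD (λ D → ∑ sD (pE0 D)) * ∑ sD (λ D → ∑ sD (pE0 D)))) ≡⟨ cong (λ z → aL * (N * (z * z))) Q≡ ⟩
      aL * (N * (Q * Q)) ∎
      where
      open ≡-Reasoning
      r : ∀ p q r t → p * (q * (r * t)) * 1 ≡ p * 1 * (q * 1 * (r * 1 * (t * 1)))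
      r = solve-∀

    ∑members-countTrue : ∑members countTrue ≡ bL * (N * (Q * Q)) + aL * (M * (Q * Q)) + aL * (N * (V * Q)) + aL * (N * (Q * V))
    ∑members-countTrue = begin
      ∑members countTrue ≡⟨ ∑members-split countTrue ⟩
      ΣΣ (λ A B C D1 D2 X Y Z1 Z2 W → ind (isLeftTree A C X W ∧ (splitPath B Y ∧ (eqB D1 Z1 ∧ eqB D2 Z2))) * countTrue (A ++ (B ++ (C ++ (D1 ++ D2)))))
        ≡⟨ ΣΣ-cong _ _ (λ A B C D1 D2 X Y Z1 Z2 W →
             trans (cong₂ _*_ (ind-∧⁴ (isLeftTree A C X W) (splitPath B Y) (eqB D1 Z1) (eqB D2 Z2)) (cnt5 A B C D1 D2))
               (r (ind (isLeftTree A C X W)) (ind (splitPath B Y)) (ind (eqB D1 Z1)) (ind (eqB D2 Z2)) (countTrue A) (countTrue B) (countTrue C) (countTrue D1) (countTrue D2))) ⟩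
      ΣΣ (λ A B C D1 D2 X Y Z1 Z2 W → prodF pL1 pR0 pE0 pE0 A B C D1 D2 X Y Z1 Z2 W + prodF pL0 pR1 pE0 pE0 A B C D1 D2 X Y Z1 Z2 W
                                     + prodF pL0 pR0 pE1 pE0 A B C D1 D2 X Y Z1 Z2 W + prodF pL0 pR0 pE0 pE1 A B C D1 D2 X Y Z1 Z2 W)
        ≡⟨ trans (ΣΣ-+ (λ A B C D1 D2 X Y Z1 Z2 W → prodF pL1 pR0 pE0 pE0 A B C D1 D2 X Y Z1 Z2 W + prodF pL0 pR1 pE0 pE0 A B C D1 D2 X Y Z1 Z2 W
                                     + prodF pL0 pR0 pE1 pE0 A B C D1 D2 X Y Z1 Z2 W) (prodF pL0 pR0 pE0 pE1)) (cong (_+ ΣΣ (prodF pL0 pR0 pE0 pE1))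
             (trans (ΣΣ-+ (λ A B C D1 D2 X Y Z1 Z2 W → prodF pL1 pR0 pE0 pE0 A B C D1 D2 X Y Z1 Z2 W + prodF pL0 pR1 pE0 pE0 A B C D1 D2 X Y Z1 Z2 W) (prodF pL0 pR0 pE1 pE0)) (cong (_+ ΣΣ (prodF pL0 pR0 pE1 pE0)) (ΣΣ-+ (prodF pL1 pR0 pE0 pE0) (prodF pL0 pR1 pE0 pE0))))) ⟩
      ΣΣ (prodF pL1 pR0 pE0 pE0) + ΣΣ (prodF pL0 pR1 pE0 pE0) + ΣΣ (prodF pL0 pR0 pE1 pE0) + ΣΣ (prodF pL0 pR0 pE0 pE1)
        ≡⟨ cong₂ _+_ (cong₂ _+_ (cong₂ _+_
             (∑⁵∑⁵-product sA sB sC sD sD sX sY sD sD sW pL1 pR0 pE0 pE0)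
             (∑⁵∑⁵-product sA sB sC sD sD sX sY sD sD sW pL0 pR1 pE0 pE0))
             (∑⁵∑⁵-product sA sB sC sD sD sX sY sD sD sW pL0 pR0 pE1 pE0))
             (∑⁵∑⁵-product sA sB sC sD sD sX sY sD sD sW pL0 pR0 pE0 pE1) ⟩
      bL * (N * (Q' * Q')) + aL * (M * (Q' * Q')) + aL * (N * (V' * Q')) + aL * (N * (Q' * V'))
        ≡⟨ cong₂ (λ q v → bL * (N * (q * q)) + aL * (M * (q * q)) + aL * (N * (v * q)) + aL * (N * (q * v))) Q≡ V≡ ⟩
      bL * (N * (Q * Q)) + aL * (M * (Q * Q)) + aL * (N * (V * Q)) + aL * (N * (Q * V)) ∎
      where
      open ≡-Reasoning
      Q' = ∑ sD (λ D → ∑ sD (pE0 D))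
      V' = ∑ sD (λ D → ∑ sD (pE1 D))
      cnt5 : ∀ A B C D1 D2 → countTrue (A ++ (B ++ (C ++ (D1 ++ D2)))) ≡ countTrue A + (countTrue B + (countTrue C + (countTrue D1 + countTrue D2)))
      cnt5 A B C D1 D2 = trans (countTrue-++ A _) (cong (countTrue A +_) (trans (countTrue-++ B _) (cong (countTrue B +_)
        (trans (countTrue-++ C _) (cong (countTrue C +_) (countTrue-++ D1 D2))))))
      r : ∀ p q r t a b c d1 d2 → p * (q * (r * t)) * (a + (b + (c + (d1 + d2))))
          ≡ p * (a + c) * (q * 1 * (r * 1 * (t * 1))) + p * 1 * (q * b * (r * 1 * (t * 1)))
            + p * 1 * (q * 1 * (r * d1 * (t * 1))) + p * 1 * (q * 1 * (r * 1 * (t * d2)))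
      r = solve-∀

    ∑-≥ : ∀ {A : Set} (xs : List A) (f : A → ℕ) {x} → x ∈ xs → f x ≤ ∑ xs f
    ∑-≥ (y ∷ ys) f (here refl) = m≤m+n (f y) _
    ∑-≥ (y ∷ ys) f (there mem) = ≤-trans (∑-≥ ys f mem) (m≤n+m _ (f y))

    aL≥1 : 1 ≤ aL
    aL≥1 = ≤-trans (≤-reflexive (sym (cong (λ b → ind b * 1) (T⇒≡ star-isLeftTree))))
      (≤-trans (∑-≥ sW (λ W → ind (isLeftTree starA starC starX W) * 1) (∈-subsets k starW (length-replicate k)))
      (≤-trans (∑-≥ sX (λ X → ∑ sW (λ W → ind (isLeftTree starA starC X W) * 1)) (∈-subsets k' starX (length-replicate k')))
      (≤-trans (∑-≥ sC (λ C → ∑ sX (λ X → ∑ sW (λ W → ind (isLeftTree starA C X W) * 1))) (∈-subsets 1 starC refl))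
               (∑-≥ sA (λ A → ∑ sC (λ C → ∑ sX (λ X → ∑ sW (λ W → ind (isLeftTree A C X W) * 1)))) (∈-subsets k starA (length-replicate k))))))
      where
      open import Data.List.Properties using (length-replicate)
      T⇒≡ : ∀ {b} → T b → b ≡ true
      T⇒≡ = Equivalence.to T-≡

    ∑⁴-*ˡ : ∀ c (f : List Bool → List Bool → List Bool → List Bool → ℕ) →
      ∑ sA (λ A → ∑ sC (λ C → ∑ sX (λ X → ∑ sW (λ W → c * f A C X W)))) ≡ c * ∑ sA (λ A → ∑ sC (λ C → ∑ sX (λ X → ∑ sW (λ W → f A C X W))))
    ∑⁴-*ˡ c f = trans (∑-cong sA (λ A → trans (∑-cong sC (λ C → trans (∑-cong sX (λ X → ∑-*ˡ sW c (f A C X))) (∑-*ˡ sX c (λ X → ∑ sW (f A C X))))) (∑-*ˡ sC c (λ C → ∑ sX (λ X → ∑ sW (f A C X)))))) (∑-*ˡ sA c (λ A → ∑ sC (λ C → ∑ sX (λ X → ∑ sW (f A C X)))))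

    ∑⁴-mono : ∀ (f g : List Bool → List Bool → List Bool → List Bool → ℕ) →
      (∀ A C X W → A ∈ sA → C ∈ sC → X ∈ sX → W ∈ sW → f A C X W ≤ g A C X W) →
      ∑ sA (λ A → ∑ sC (λ C → ∑ sX (λ X → ∑ sW (λ W → f A C X W)))) ≤ ∑ sA (λ A → ∑ sC (λ C → ∑ sX (λ X → ∑ sW (λ W → g A C X W))))
    ∑⁴-mono f g h = ∑-mono sA (λ A mA → ∑-mono sC (λ C mC → ∑-mono sX (λ X mX → ∑-mono sW (λ W mW → h A C X W mA mC mX mW))))

    bL-bounds : 2 * aL ≤ bL × bL ≤ suc k * aL
    bL-bounds = ≤-trans (≤-reflexive (sym (∑⁴-*ˡ 2 (λ A C X W → ind (isLeftTree A C X W) * 1)))) (∑⁴-mono _ _ lo)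
              , ≤-trans (∑⁴-mono _ _ hi) (≤-reflexive (∑⁴-*ˡ (suc k) (λ A C X W → ind (isLeftTree A C X W) * 1)))
      where
      lo : ∀ A C X W → A ∈ sA → C ∈ sC → X ∈ sX → W ∈ sW → 2 * (ind (isLeftTree A C X W) * 1) ≤ ind (isLeftTree A C X W) * (countTrue A + countTrue C)
      lo A C X W mA mC mX mW with isLeftTree A C X W in eq
      ... | false = z≤n
      ... | true = subst (_≤ 1 * (countTrue A + countTrue C)) (sym (*-identityʳ 2)) (subst (2 ≤_) (sym (*-identityˡ _))
                     (proj₁ (isLeftTree-size A C X W (subsets-length k A mA) (subsets-length 1 C mC) (subsets-length k' X mX) (subsets-length k W mW) (subst T (sym eq) tt))))
      hi : ∀ A C X W → A ∈ sA → C ∈ sC → X ∈ sX → W ∈ sW → ind (isLeftTree A C X W) * (countTrue A + countTrue C) ≤ suc k * (ind (isLeftTree A C X W) * 1)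
      hi A C X W mA mC mX mW with isLeftTree A C X W in eq
      ... | false = ≤-reflexive (sym (*-zeroʳ (suc k)))
      ... | true = subst (1 * (countTrue A + countTrue C) ≤_) (sym (*-identityʳ (suc k))) (subst (_≤ suc k) (sym (*-identityˡ _))
                     (proj₂ (isLeftTree-size A C X W (subsets-length k A mA) (subsets-length 1 C mC) (subsets-length k' X mX) (subsets-length k W mW) (subst T (sym eq) tt))))

    totalSize familySize e : ℕ
    totalSize = sum (map (λ p → countTrue (proj₁ p)) (family n s k))
    familySize = length (family n s k)
    e = k + 1 + s

    familySize≡ : familySize ≡ aL * (N * (Q * Q))
    familySize≡ = trans (length-∑ (family n s k)) (trans (∑-family n s k (λ _ → 1)) ∑members-1)

    totalSize≡ : totalSize ≡ bL * (N * (Q * Q)) + aL * (M * (Q * Q)) + aL * (N * (V * Q)) + aL * (N * (Q * V))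
    totalSize≡ = trans (∑-family n s k countTrue) ∑members-countTrue

    hN : 2 * N ≡ suc m1 * suc (suc m1)
    hN = ∑splitPath-1 m1

    hM : 3 * M ≡ m1 * (2 * N)
    hM = trans (∑splitPath-countTrue m1) (trans (*-assoc m1 (suc m1) _) (cong (m1 *_) (sym hN)))

    hQ : Q ≡ 2 ^ s
    hQ = ∑-subsets-1 s

    hV : 2 * V ≡ s * Q
    hV = trans (∑-subsets-countTrue s) (cong (s *_) (sym hQ))

    -- 3 μ(𝒯) = X3 / aL: on average the left tree contributes bL / aL, the split path 2 m1 / 3 and the leaves s.
    U X3 : ℕ
    U = N * (Q * Q)
    X3 = 3 * bL + 2 * aL * m1 + 3 * aL * s

    totalSize-closed-form : 3 * totalSize ≡ U * X3
    totalSize-closed-form = *-cancelˡ-≡ _ _ 2 (begin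
      2 * (3 * totalSize) ≡⟨ cong (λ z → 2 * (3 * z)) totalSize≡ ⟩
      2 * (3 * (bL * (N * (Q * Q)) + aL * (M * (Q * Q)) + aL * (N * (V * Q)) + aL * (N * (Q * V)))) ≡⟨ p1 bL aL N M Q V ⟩
      6 * bL * N * Q * Q + 2 * aL * Q * Q * (3 * M) + 6 * aL * N * Q * (2 * V) ≡⟨ cong₂ (λ x y → 6 * bL * N * Q * Q + 2 * aL * Q * Q * x + 6 * aL * N * Q * y) hM hV ⟩
      6 * bL * N * Q * Q + 2 * aL * Q * Q * (m1 * (2 * N)) + 6 * aL * N * Q * (s * Q) ≡⟨ p2 bL aL N Q m1 s ⟩
      2 * (U * X3) ∎)
      where
      open ≡-Reasoning
      p1 : ∀ bL aL N M Q V → 2 * (3 * (bL * (N * (Q * Q)) + aL * (M * (Q * Q)) + aL * (N * (V * Q)) + aL * (N * (Q * V))))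
                           ≡ 6 * bL * N * Q * Q + 2 * aL * Q * Q * (3 * M) + 6 * aL * N * Q * (2 * V)
      p1 = solve-∀
      p2 : ∀ bL aL N Q m1 s → 6 * bL * N * Q * Q + 2 * aL * Q * Q * (m1 * (2 * N)) + 6 * aL * N * Q * (s * Q)
                            ≡ 2 * (N * (Q * Q) * (3 * bL + 2 * aL * m1 + 3 * aL * s))
      p2 = solve-∀

    totalSize-upper : 3 * totalSize ≤ (2 * n + 3 * e) * familySize
    totalSize-upper = begin
      3 * totalSize ≡⟨ totalSize-closed-form ⟩
      U * X3 ≤⟨ *-monoʳ-≤ U x3≤ ⟩
      U * ((2 * n + 3 * e) * aL) ≡⟨ p3 U (2 * n + 3 * e) aL ⟩
      (2 * n + 3 * e) * (aL * U) ≡⟨ cong ((2 * n + 3 * e) *_) (sym familySize≡) ⟩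
      (2 * n + 3 * e) * familySize ∎
      where
      open ≤-Reasoning
      p3 : ∀ u c a → u * (c * a) ≡ c * (a * u)
      p3 = solve-∀
      p4 : ∀ k' m1 s aL → (2 * (suc k' + suc m1 + s + s) + 3 * (suc k' + 1 + s)) * aL
                          ≡ 3 * (suc (suc k') * aL) + 2 * aL * m1 + 3 * aL * s + aL * (2 * suc k' + 2 + 4 * s)
      p4 = solve-∀
      x3≤ : X3 ≤ (2 * n + 3 * e) * aL
      x3≤ = begin
        3 * bL + 2 * aL * m1 + 3 * aL * s ≤⟨ +-monoˡ-≤ (3 * aL * s) (+-monoˡ-≤ (2 * aL * m1) (*-monoʳ-≤ 3 (proj₂ bL-bounds))) ⟩
        3 * (suc k * aL) + 2 * aL * m1 + 3 * aL * s ≤⟨ m≤m+n _ _ ⟩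
        3 * (suc k * aL) + 2 * aL * m1 + 3 * aL * s + aL * (2 * k + 2 + 4 * s) ≡⟨ sym (p4 k' m1 s aL) ⟩
        (2 * n + 3 * e) * aL ∎

    totalSize-lower : 2 * n * familySize ≤ 3 * totalSize + 3 * e * familySize
    totalSize-lower = begin
      2 * n * familySize ≡⟨ cong (2 * n *_) familySize≡ ⟩
      2 * n * (aL * U) ≡⟨ p5 n aL U ⟩
      U * (2 * n * aL) ≤⟨ *-monoʳ-≤ U le ⟩
      U * (X3 + 3 * e * aL) ≡⟨ p6 U X3 e aL ⟩
      U * X3 + 3 * e * (aL * U) ≡⟨ cong₂ _+_ (sym totalSize-closed-form) (cong (3 * e *_) (sym familySize≡)) ⟩
      3 * totalSize + 3 * e * familySize ∎
      where
      open ≤-Reasoning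
      p5 : ∀ n a u → 2 * n * (a * u) ≡ u * (2 * n * a)
      p5 = solve-∀
      p6 : ∀ u x e a → u * (x + 3 * e * a) ≡ u * x + 3 * e * (a * u)
      p6 = solve-∀
      p7 : ∀ k' m1 s aL bL → 3 * bL + 2 * aL * m1 + 3 * aL * s + 3 * (suc k' + 1 + s) * aL
                           ≡ 2 * (suc k' + suc m1 + s + s) * aL + (3 * bL + aL * (suc k' + 2 * s + 1))
      p7 = solve-∀
      le : 2 * n * aL ≤ X3 + 3 * e * aL
      le = subst (2 * n * aL ≤_) (sym (p7 k' m1 s aL bL)) (m≤m+n _ _)

    familySize-pos : 1 ≤ familySize
    familySize-pos = subst (1 ≤_) (sym familySize≡) (*-mono-≤ aL≥1 (*-mono-≤ N≥1 (*-mono-≤ Q≥1 Q≥1)))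
      where
      N≥1 : 1 ≤ N
      N≥1 with N | hN
      ... | zero | ()
      ... | suc _ | _ = s≤s z≤n
      Q≥1 : 1 ≤ Q
      Q≥1 = subst (1 ≤_) (sym hQ) (m^n>0 2 s)

  sigma-near-⅔ : ∀ k s n → 1 ≤ k → 2 * s + k + 2 ≤ n → ∣ sigma n s k - ⅔ ∣ ℚ.≤ ratio (k + 1 + s) n
  sigma-near-⅔ (suc k') s _ _ large with m≤n⇒∃[o]m+o≡n large
  ... | o , refl = subst (λ x → ∣ sigma x s (suc k') - ⅔ ∣ ℚ.≤ ratio (suc k' + 1 + s) x) (size k' o s)
    (∣ratio-⅔∣≤ {totalSize} {familySize} {suc k' + suc (suc o) + s + s} {suc k' + 1 + s} familySize-pos (s≤s z≤n) totalSize-upper totalSize-lower)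
    where
    open Sizes k' (suc o) s (s≤s z≤n)
    size : ∀ k' o s → suc k' + suc (suc o) + s + s ≡ 2 * s + suc k' + 2 + o
    size = solve-∀

module Limits where

  open import Defs
  open Rationals
  open import Data.Nat using (ℕ; suc; _+_; _*_; _≤_; _⊔_; s≤s)
  open import Data.Nat.Properties using (≤-trans; m≤m⊔n; m≤n⊔m; *-identityʳ; *-identityˡ; *-monoˡ-≤)
  open import Data.Integer using (+_; -[1+_])
  open import Data.Rational as ℚ using (ℚ; 0ℚ; ½; mkℚ; _-_; ∣_∣)
  import Data.Rational.Properties as ℚP
  open import Data.Rational.Solver using (module +-*-Solver)
  open import Data.Product using (_×_; _,_; ∃)
  open import Relation.Binary.PropositionalEquality using (_≡_; refl; sym; subst)
  open +-*-Solver using (solve; con; _:+_; _:-_; _:*_; _:=_)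

  Eventually : (ℕ → Set) → Set
  Eventually P = ∃ λ N → ∀ n → N ≤ n → P n

  eventually-≥ : ∀ N → Eventually (N ≤_)
  eventually-≥ N = N , λ _ N≤n → N≤n

  eventually-∧ : ∀ {P Q : ℕ → Set} → Eventually P → Eventually Q → Eventually (λ n → P n × Q n)
  eventually-∧ (M , p) (N , q) = M ⊔ N , λ n M⊔N≤n → p n (≤-trans (m≤m⊔n M N) M⊔N≤n) , q n (≤-trans (m≤n⊔m M N) M⊔N≤n)

  eventually-map : ∀ {P Q : ℕ → Set} → (∀ {n} → P n → Q n) → Eventually P → Eventually Q
  eventually-map f (N , p) = N , λ n N≤n → f (p n N≤n)

  tendsToZero-∘ : ∀ {a : ℕ → ℚ} (f : ℕ → ℕ) → (∀ N → Eventually (λ n → N ≤ f n)) → TendsToZero a → TendsToZero (λ n → a (f n))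
  tendsToZero-∘ f f→∞ a→0 ε ε>0 with a→0 ε ε>0
  ... | N , small = eventually-map (λ {n} N≤fn → small (f n) N≤fn) (f→∞ N)

  tendsToZero-dominated : ∀ {a : ℕ → ℚ} (b : ℕ → ℚ) → Eventually (λ n → ∣ a n ∣ ℚ.≤ b n) → TendsToZero b → TendsToZero a
  tendsToZero-dominated b a≤b b→0 ε ε>0 = eventually-map bound (eventually-∧ a≤b (b→0 ε ε>0))
    where
    bound : ∀ {n} → ∣ _ ∣ ℚ.≤ b n × ∣ b n ∣ ℚ.< ε → ∣ _ ∣ ℚ.< ε
    bound (aₙ≤bₙ , ∣bₙ∣<ε) =
      ℚP.≤-<-trans aₙ≤bₙ (subst (ℚ._< ε) (ℚP.0≤p⇒∣p∣≡p (ℚP.≤-trans (ℚP.0≤∣p∣ _) aₙ≤bₙ)) ∣bₙ∣<ε)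

  tendsToZero-triangle : ∀ {x a b : ℕ → ℚ} → (∀ n → ∣ x n ∣ ℚ.≤ ∣ a n ∣ ℚ.+ ∣ b n ∣) →
    TendsToZero a → TendsToZero b → TendsToZero x
  tendsToZero-triangle {x} {a} {b} x≤a+b a→0 b→0 ε ε>0 =
    eventually-map bound (eventually-∧ (a→0 (½ ℚ.* ε) ½ε>0) (b→0 (½ ℚ.* ε) ½ε>0))
    where
    ½ε>0 : 0ℚ ℚ.< ½ ℚ.* ε
    ½ε>0 = subst (ℚ._< ½ ℚ.* ε) (ℚP.*-zeroʳ ½) (ℚP.*-monoʳ-<-pos ½ ε>0)
    halves : ½ ℚ.* ε ℚ.+ ½ ℚ.* ε ≡ ε
    halves = solve 1 (λ e → con ½ :* e :+ con ½ :* e := e) refl ε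
    bound : ∀ {n} → ∣ a n ∣ ℚ.< ½ ℚ.* ε × ∣ b n ∣ ℚ.< ½ ℚ.* ε → ∣ x n ∣ ℚ.< ε
    bound {n} (∣aₙ∣<½ε , ∣bₙ∣<½ε) = ℚP.≤-<-trans (x≤a+b n) (subst (_ ℚ.<_) halves (ℚP.+-mono-< ∣aₙ∣<½ε ∣bₙ∣<½ε))

  tendsToZero-+ : ∀ {a b : ℕ → ℚ} → TendsToZero a → TendsToZero b → TendsToZero (λ n → a n ℚ.+ b n)
  tendsToZero-+ {a} {b} = tendsToZero-triangle (λ n → ℚP.∣p+q∣≤∣p∣+∣q∣ (a n) (b n))

  tendsToZero-ratio : ∀ c → TendsToZero (ratio c)
  tendsToZero-ratio c (mkℚ (+ p) q coprime) ε>0 = suc (c * suc q) , small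
    where
    ε = mkℚ (+ p) q coprime
    p≥1 : 1 ≤ p
    p≥1 = subst (1 ≤_) (*-identityʳ p) (ratio-<⁻ 0 0 p q (subst (0ℚ ℚ.<_) (sym (ℚP.↥p/↧p≡p ε)) ε>0))
    small : ∀ n → suc (c * suc q) ≤ n → ∣ ratio c n ∣ ℚ.< ε
    small (suc n) (s≤s cq≤n) = subst (ℚ._< ε) (sym (ℚP.0≤p⇒∣p∣≡p (0≤ratio c (suc n))))
      (subst (ratio c (suc n) ℚ.<_) (ℚP.↥p/↧p≡p ε)
        (ratio-< c n p q (≤-trans (s≤s cq≤n) (subst (_≤ p * suc n) (*-identityˡ (suc n)) (*-monoˡ-≤ (suc n) p≥1)))))
  tendsToZero-ratio c (mkℚ -[1+ p ] q _) (ℚ.*<* ())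

  _⟶_ : (ℕ → ℚ) → ℚ → Set
  a ⟶ c = TendsToZero (λ n → a n - c)

  ⟶-difference : ∀ {a b c} → a ⟶ c → b ⟶ c → TendsToZero (λ n → a n - b n)
  ⟶-difference {a} {b} {c} = tendsToZero-triangle triangle
    where
    triangle : ∀ n → ∣ a n - b n ∣ ℚ.≤ ∣ a n - c ∣ ℚ.+ ∣ b n - c ∣
    triangle n = subst (λ z → ∣ z ∣ ℚ.≤ ∣ a n - c ∣ ℚ.+ ∣ b n - c ∣)
      (solve 3 (λ x y z → (x :- z) :- (y :- z) := x :- y) refl (a n) (b n) c) (ℚP.∣p-q∣≤∣p∣+∣q∣ (a n - c) (b n - c))

open import Defs
open import Data.Nat using (ℕ; suc; _+_; _*_; _∸_; _≤_; _<_; z≤n; s≤s)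
open import Data.Nat.Properties using (≤-refl; ≤-reflexive; ≤-trans; <⇒≤; m≤m+n; m+n∸n≡m; ∸-monoˡ-≤; *-cancelˡ-<; +-monoʳ-≤; +-monoˡ-<; module ≤-Reasoning)
open import Data.Nat.Tactic.RingSolver using (solve-∀)
open import Data.Rational using (_-_; ∣_∣)
import Data.Rational as ℚ
import Data.Rational.Properties as ℚP
open import Data.Product using (_,_; _×_)
open import Relation.Binary.PropositionalEquality using (_≡_; sym; subst)
open Rationals
open Limits
open Count using (sigma-near-⅔)

sigma⟶⅔ : ∀ k → 1 ≤ k → (s : ℕ → ℕ) → TendsToZero (λ n → ratio (s n) n) → (λ n → sigma n (s n) k) ⟶ ⅔
sigma⟶⅔ k k≥1 s s/n→0 =
  tendsToZero-dominated (λ n → ratio (k + 1) n ℚ.+ ratio (s n) n) near (tendsToZero-+ (tendsToZero-ratio (k + 1)) s/n→0)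
  where
  path-long : ∀ {a n} → 4 + 2 * k ≤ n → a * 4 < n → 2 * a + k + 2 ≤ n
  path-long {a} {n} n≥ 4a<n = <⇒≤ (*-cancelˡ-< 2 (2 * a + k + 2) n (begin-strict
    2 * (2 * a + k + 2)   ≡⟨ regroup a k ⟩
    a * 4 + (4 + 2 * k)   <⟨ +-monoˡ-< (4 + 2 * k) 4a<n ⟩
    n + (4 + 2 * k)       ≤⟨ +-monoʳ-≤ n n≥ ⟩
    n + n                 ≡⟨ double n ⟩
    2 * n                 ∎))
    where
    open ≤-Reasoning
    regroup : ∀ a k → 2 * (2 * a + k + 2) ≡ a * 4 + (4 + 2 * k)
    regroup = solve-∀
    double : ∀ n → n + n ≡ 2 * n
    double = solve-∀

  large : Eventually (λ n → 2 * s n + k + 2 ≤ n)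
  large = eventually-map s-small (eventually-∧ (eventually-≥ (4 + 2 * k)) (s/n→0 ¼ (ratio-< 0 0 1 3 (s≤s z≤n))))
    where
    s-small : ∀ {n} → 4 + 2 * k ≤ n × ∣ ratio (s n) n ∣ ℚ.< ¼ → 2 * s n + k + 2 ≤ n
    s-small {suc n} (n≥ , s/n<¼) =
      path-long {s (suc n)} n≥ (ratio<¼⇒ (s (suc n)) n (subst (ℚ._< ¼) (ℚP.0≤p⇒∣p∣≡p (0≤ratio (s (suc n)) (suc n))) s/n<¼))

  near : Eventually (λ n → ∣ sigma n (s n) k - ⅔ ∣ ℚ.≤ ratio (k + 1) n ℚ.+ ratio (s n) n)
  near = eventually-map (λ {n} n-large → ℚP.≤-trans (sigma-near-⅔ k (s n) n k≥1 n-large) (ratio-+-≤ (k + 1) (s n) n)) large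

n∸k+1→∞ : ∀ k N → Eventually (λ n → N ≤ n ∸ k + 1)
n∸k+1→∞ k N = N + k , λ n N+k≤n → ≤-trans (≤-trans (≤-reflexive (sym (m+n∸n≡m N k))) (∸-monoˡ-≤ k N+k≤n)) (m≤m+n (n ∸ k) 1)

lemma2p3 : (k : ℕ) → 1 ≤ k → (s : ℕ → ℕ) → (m₀ : ℕ) → Admissible k s m₀ →
    TendsToZero (λ n → sigma n (s n) k - sigma (n ∸ k + 1) (s (n ∸ k + 1)) 1)
lemma2p3 k k≥1 s _ (_ , s/n→0 , _) =
  ⟶-difference {σₖ} {λ n → σ₁ (shift n)} {⅔} (sigma⟶⅔ k k≥1 s s/n→0)
    (tendsToZero-∘ {λ n → σ₁ n - ⅔} shift (n∸k+1→∞ k) (sigma⟶⅔ 1 ≤-refl s s/n→0))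
  where
  σₖ σ₁ : ℕ → ℚ.ℚ
  σₖ n = sigma n (s n) k
  σ₁ n = sigma n (s n) 1
  shift : ℕ → ℕ
  shift n = n ∸ k + 1
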